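{- For any $\lambda\in\mathbf{k}$, $(\mathrm{HSym},\overline{\star}_\lambda,\Delta,\epsilon)$ is a Hopf algebra (the Hopf algebra of signed permutations of weight $\lambda$). It contains the Malvenuto–Reutenauer Hopf algebra $\mathrm{SSym}$ as a Hopf subalgebra.
   Context: $\mathbf{k}$ is a field of characteristic zero. For $n\ge0$, a signed permutation of $[n]$ is a permutation $\pi$ of $\{ -n,\dots,n\}$ with $\pi(-i)=-\pi(i)$, written as the word $\pi_1\cdots\pi_n$ with $\pi_i=\pi(i)$; $\mathfrak{B}_n$ is the set of these ($\mathfrak{B}_0=\{\imath\}$), and $\mathfrak{S}_n\subseteq\mathfrak{B}_n$ consists of those with all $\pi_i>0$. Write $i^-$ for $-i$. $\mathrm{HSym}=\bigoplus_{n\ge0}\mathbf{k}\mathfrak{B}_n$ and $\mathrm{SSym}=\bigoplus_{n\ge0}\mathbf{k}\mathfrak{S}_n$. For a word $w=a_1\cdots a_n$ on $\mathbb{Z}\setminus\{0\}$, $\mathrm{st}(w)=b_1\cdots b_n\in\mathfrak{B}_n$ is the unique signed permutation with $b_i$ of the same sign as $a_i$ and $|b_i|<|b_j|$ whenever $|a_i|<|a_j|$ or ($|a_i|=|a_j|$ and $i<j$); extended linearly. On words over $A=\mathbb{Z}\setminus\{0\}$ let $a\bullet b=a$ if $a,b<0$ and $0$ otherwise, and let $\star_\lambda$ be the bilinear product with identity the empty word $\imath$ and $au\star_\lambda bv=a(u\star_\lambda bv)+b(au\star_\lambda v)+\lambda(a\bullet b)(u\star_\lambda v)$ for letters $a,b$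 and words $u,v$. For $\tau\in\mathfrak{B}_n$, $\tau[m]$ replaces each positive letter $i$ by $i+m$ and each negative letter $i^-$ by $(i+m)^-$. The product is $\sigma\overline{\star}_\lambda\tau=\mathrm{st}(\sigma\star_\lambda\tau[m])$ for $\sigma\in\mathfrak{B}_m$, $\tau\in\mathfrak{B}_n$. The coproduct is $\Delta(\sigma_1\cdots\sigma_m)=\sum_{p=0}^m\mathrm{st}(\sigma_1\cdots\sigma_p)\otimes\mathrm{st}(\sigma_{p+1}\cdots\sigma_m)$ and the counit $\epsilon(\sigma)$ is $1$ if $\sigma=\imath$ and $0$ otherwise. $\mathrm{SSym}$ is the Malvenuto–Reutenauer Hopf algebra: product the shifted shuffle $\sigma\overline{\sqcup\!\sqcup}\tau=\sigma\sqcup\!\sqcup\,\tau[m]$ (shuffle of words) for $\sigma\in\mathfrak{S}_m$, with the same coproduct $\Delta$ and counit. -}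

module Defs where

open import Level using (Level; _⊔_) renaming (suc to lsuc)
open import Algebra.Bundles using (CommutativeRing)
open import Data.Bool using (Bool; true; false; T; if_then_else_; _∧_; _∨_; not)
open import Data.Bool.Properties using (T?)
open import Data.Nat using (ℕ; zero; suc) renaming (_+_ to _+ℕ_)
open import Data.Nat using ( _<ᵇ_; _≡ᵇ_)
open import Data.Integer using (ℤ; +_; -[1+_]; ∣_∣)
import Data.Integer.Properties as ℤP
open import Data.List using (List; []; _∷_; _++_; map; length; upTo; zip; take; drop; foldr; concatMap)
import Data.List.Properties as LP
open import Data.Product using (Σ; ∃; _×_; _,_; proj₁; proj₂)
open import Data.Product.Properties using (≡-dec)
open import Data.Unit using (tt)
open import Relation.Nullary using (¬_; Dec; yes; no; does)
open import Relation.Binary.PropositionalEquality using (_≡_; refl; cong)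
open import Relation.Binary.Definitions using (DecidableEquality)

record Field (c ℓ : Level) : Set (lsuc (c ⊔ ℓ)) where
  field
    commutativeRing : CommutativeRing c ℓ
  open CommutativeRing commutativeRing public
  field
    0≉1     : ¬ (0# ≈ 1#)
    inverse : ∀ x → ¬ (x ≈ 0#) → ∃ λ y → (x * y) ≈ 1#

module _ {c ℓ} (F : Field c ℓ) where
  open Field F
  ofℕ : ℕ → Carrier
  ofℕ zero    = 0#
  ofℕ (suc n) = 1# + ofℕ n

  CharZero : Set ℓ
  CharZero = ∀ n → ¬ (ofℕ (suc n) ≈ 0#)

-- Free k-modules on a basis X: finite formal linear combinations,
-- compared coefficientwise.  The tensor product of free modules on X
-- and Y is identified with the free module on X × Y.

module FreeModule {c ℓ} (F : Field c ℓ) where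
  open Field F

  Lin : Set → Set c
  Lin X = List (Carrier × X)

  module _ {X : Set} (_≟X_ : DecidableEquality X) where
    coeff : Lin X → X → Carrier
    coeff []            x = 0#
    coeff ((a , y) ∷ u) x = (if does (y ≟X x) then a else 0#) + coeff u x

    _≋_ : Lin X → Lin X → Set ℓ
    u ≋ v = ∀ x → coeff u x ≈ coeff v x

  basis : {X : Set} → X → Lin X
  basis x = (1# , x) ∷ []

  scale : {X : Set} → Carrier → Lin X → Lin X
  scale a = map (λ p → (a * proj₁ p , proj₂ p))

  mapLin : {X Y : Set} → (X → Y) → Lin X → Lin Y
  mapLin f = map (λ p → (proj₁ p , f (proj₂ p)))

  ext : {X Y : Set} → (X → Lin Y) → Lin X → Lin Y
  ext f []            = []
  ext f ((a , x) ∷ u) = scale a (f x) ++ ext f u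

  tensor : {X Y : Set} → Lin X → Lin Y → Lin (X × Y)
  tensor u v = concatMap (λ p → map (λ q → (proj₁ p * proj₁ q , (proj₂ p , proj₂ q))) v) u

  extF : {X : Set} → (X → Carrier) → Lin X → Carrier
  extF f []            = 0#
  extF f ((a , x) ∷ u) = (a * f x) + extF f u

  ext2 : {X Y Z : Set} → (X → Y → Lin Z) → Lin X → Lin Y → Lin Z
  ext2 f u v = ext (λ p → f (proj₁ p) (proj₂ p)) (tensor u v)

  _⊗L_ : {X X' Y Y' : Set} → (X → Lin X') → (Y → Lin Y') → Lin (X × Y) → Lin (X' × Y')
  (f ⊗L g) = ext (λ p → tensor (f (proj₁ p)) (g (proj₂ p)))

  module HopfAxioms {X : Set} (_≟X_ : DecidableEquality X)
                    (μ : X → X → Lin X) (η : X)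
                    (δ : X → Lin (X × X)) (ε : X → Carrier) where

    _≟2_ : DecidableEquality (X × X)
    _≟2_ = ≡-dec _≟X_ _≟X_

    _≟3_ : DecidableEquality (X × (X × X))
    _≟3_ = ≡-dec _≟X_ _≟2_

    mul : Lin X → Lin X → Lin X
    mul = ext2 μ

    unit : Lin X
    unit = basis η

    Δ : Lin X → Lin (X × X)
    Δ = ext δ

    counit : Lin X → Carrier
    counit = extF ε

    reassoc : (X × X) × X → X × (X × X)
    reassoc ((x , y) , z) = (x , (y , z))

    mul2 : Lin (X × X) → Lin (X × X) → Lin (X × X)
    mul2 = ext2 (λ p q → tensor (μ (proj₁ p) (proj₁ q)) (μ (proj₂ p) (proj₂ q)))

    record IsBialgebra : Set (c ⊔ ℓ) where
      field
        mul-assoc   : ∀ u v w → _≋_ _≟X_ (mul (mul u v) w) (mul u (mul v w))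
        mul-unitˡ   : ∀ u → _≋_ _≟X_ (mul unit u) u
        mul-unitʳ   : ∀ u → _≋_ _≟X_ (mul u unit) u
        coassoc     : ∀ u → _≋_ _≟3_ (mapLin reassoc ((δ ⊗L basis) (Δ u)))
                                      ((basis ⊗L δ) (Δ u))
        counitˡ     : ∀ u → _≋_ _≟X_ (ext (λ p → scale (ε (proj₁ p)) (basis (proj₂ p))) (Δ u)) u
        counitʳ     : ∀ u → _≋_ _≟X_ (ext (λ p → scale (ε (proj₂ p)) (basis (proj₁ p))) (Δ u)) u
        Δ-mul       : ∀ u v → _≋_ _≟2_ (Δ (mul u v)) (mul2 (Δ u) (Δ v))
        Δ-unit      : _≋_ _≟2_ (Δ unit) (tensor unit unit)
        counit-mul  : ∀ u v → counit (mul u v) ≈ (counit u * counit v)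
        counit-unit : counit unit ≈ 1#

    record IsAntipode (S : X → Lin X) : Set (c ⊔ ℓ) where
      field
        antipodeˡ : ∀ u → _≋_ _≟X_ (ext (λ p → mul (S (proj₁ p)) (basis (proj₂ p))) (Δ u))
                                   (scale (counit u) unit)
        antipodeʳ : ∀ u → _≋_ _≟X_ (ext (λ p → mul (basis (proj₁ p)) (S (proj₂ p))) (Δ u))
                                   (scale (counit u) unit)

isNeg : ℤ → Bool
isNeg -[1+ _ ] = true
isNeg (+ _)    = false

allᵇ : {A : Set} → (A → Bool) → List A → Bool
allᵇ p = foldr (λ a b → p a ∧ b) true

countᵇ : {A : Set} → (A → Bool) → List A → ℕ
countᵇ p = foldr (λ a n → if p a then suc n else n) 0

-- w = a₁⋯aₙ is a signed permutation of [n]: each of 1..n occurs exactly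
-- once among |a₁|,…,|aₙ| (hence no letter is 0 and none exceeds n in
-- absolute value).
isSPerm : List ℤ → Bool
isSPerm w = allᵇ (λ i → countᵇ (λ a → ∣ a ∣ ≡ᵇ i) w ≡ᵇ 1) (map suc (upTo (length w)))

record SPerm : Set where
  constructor sp
  field
    word   : List ℤ
    .valid : T (isSPerm word)
open SPerm public

_≟SP_ : DecidableEquality SPerm
sp w _ ≟SP sp w' _ with LP.≡-dec ℤP._≟_ w w'
... | yes refl = yes refl
... | no  ne   = no (λ eq → ne (cong word eq))

ι : SPerm
ι = sp [] tt

size : SPerm → ℕ
size σ = length (word σ)

isUnsigned : SPerm → Bool
isUnsigned σ = allᵇ (λ a → not (isNeg a)) (word σ)

stWord : List ℤ → List ℤ
stWord w = map letter (zip (upTo (length w)) w)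
  where
    enum = zip (upTo (length w)) w
    rank : ℕ → ℤ → ℕ   -- number of letters strictly before in the st order
    rank i a = countᵇ (λ q → (∣ proj₂ q ∣ <ᵇ ∣ a ∣) ∨ ((∣ proj₂ q ∣ ≡ᵇ ∣ a ∣) ∧ (proj₁ q <ᵇ i))) enum
    letter : ℕ × ℤ → ℤ
    letter (i , a) = if isNeg a then -[1+ rank i a ] else + suc (rank i a)

shiftL : ℕ → ℤ → ℤ
shiftL m (+ n)     = + (n +ℕ m)
shiftL m -[1+ n ]  = -[1+ (n +ℕ m) ]

shift : ℕ → List ℤ → List ℤ
shift m = map (shiftL m)

module HSymDefs {c ℓ} (F : Field c ℓ) where
  open Field F
  open FreeModule F public

  -- a word that is a signed permutation, viewed as a basis vector
  -- (any other word gives 0; never used on such words)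
  asBasis : List ℤ → Lin SPerm
  asBasis w with T? (isSPerm w)
  ... | yes p = basis (sp w p)
  ... | no  _ = []

  st : Lin (List ℤ) → Lin SPerm
  st = ext (λ w → asBasis (stWord w))

  prepend : ℤ → Lin (List ℤ) → Lin (List ℤ)
  prepend a = mapLin (a ∷_)

  star : Carrier → List ℤ → List ℤ → Lin (List ℤ)
  star λ' []      v       = basis v
  star λ' (a ∷ u) []      = basis (a ∷ u)
  star λ' (a ∷ u) (b ∷ v) =
    prepend a (star λ' u (b ∷ v)) ++ prepend b (star λ' (a ∷ u) v)
    ++ (if isNeg a ∧ isNeg b then scale λ' (prepend a (star λ' u v)) else [])

  shuffle : List ℤ → List ℤ → Lin (List ℤ)
  shuffle []      v       = basis v
  shuffle (a ∷ u) []      = basis (a ∷ u)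
  shuffle (a ∷ u) (b ∷ v) = prepend a (shuffle u (b ∷ v)) ++ prepend b (shuffle (a ∷ u) v)

  starBar : Carrier → SPerm → SPerm → Lin SPerm
  starBar λ' σ τ = st (star λ' (word σ) (shift (size σ) (word τ)))

  shuffleBar : SPerm → SPerm → Lin SPerm
  shuffleBar σ τ = ext asBasis (shuffle (word σ) (shift (size σ) (word τ)))

  coprod : SPerm → Lin (SPerm × SPerm)
  coprod σ = concatMap (λ p → tensor (asBasis (stWord (take p (word σ))))
                                     (asBasis (stWord (drop p (word σ)))))
                       (upTo (suc (size σ)))

  counitB : SPerm → Carrier
  counitB σ with word σ
  ... | []    = 1#
  ... | _ ∷ _ = 0#

  module HSymHopf (λ' : Carrier) = HopfAxioms {SPerm} _≟SP_ (starBar λ') ι coprod counitB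

  record SSymHopfSub (λ' : Carrier) (S : SPerm → Lin SPerm) : Set (c ⊔ ℓ) where
    field
      unit-in     : T (isUnsigned ι)
      mul-closed  : ∀ σ τ → T (isUnsigned σ) → T (isUnsigned τ) →
                      ∀ ρ → ¬ T (isUnsigned ρ) → coeff _≟SP_ (starBar λ' σ τ) ρ ≈ 0#
      Δ-closed    : ∀ σ → T (isUnsigned σ) →
                      ∀ ρ₁ ρ₂ → ¬ (T (isUnsigned ρ₁) × T (isUnsigned ρ₂)) →
                      coeff (≡-dec _≟SP_ _≟SP_) (coprod σ) (ρ₁ , ρ₂) ≈ 0#
      S-closed    : ∀ σ → T (isUnsigned σ) →
                      ∀ ρ → ¬ T (isUnsigned ρ) → coeff _≟SP_ (S σ) ρ ≈ 0#
      mul-is-MR   : ∀ σ τ → T (isUnsigned σ) → T (isUnsigned τ) →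
                      _≋_ _≟SP_ (starBar λ' σ τ) (shuffleBar σ τ)

Theorem2p5 : (c ℓ : Level) → Set (lsuc (c ⊔ ℓ))
Theorem2p5 c ℓ =
  (F : Field c ℓ) → CharZero F → (λ' : Field.Carrier F) →
  let open HSymDefs F
      open HSymHopf λ'
  in IsBialgebra × Σ (SPerm → Lin SPerm) (λ S → IsAntipode S × SSymHopfSub λ' S)

-- Every identity is checked after pairing both sides with an arbitrary coefficient function on
-- the basis, which turns vectors into finite sums.  On words, the weighted quasi-shuffle ⋆_λ is
-- associative and deconcatenation is coassociative and multiplicative for ⋆_λ, each by
-- induction on the first letters.  These identities descend to signed permutations
-- because standardization commutes with ⋆_λ on words whose letters have distinct absolute values
-- and whose left factor lies below the right one, and with deconcatenation.  The antipode is
-- given by the recursion S σ = − Σ S(σ₍₁₎) σ₍₂₎ over the splittings with nonempty right part,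
-- which makes it a left convolution inverse of the identity; associativity of convolution and
-- induction on the size make it a right inverse too.  On positive words ⋆_λ is the shuffle,
-- whence the Hopf subalgebra SSym with the Malvenuto–Reutenauer product.

module Submission where

open import Defs
open import Level using (Level)
open import Data.Bool using (Bool; true; false; T; not; if_then_else_; _∧_; _∨_)
open import Data.Bool.Properties using (T?; ∨-identityʳ)
open import Data.Nat using (ℕ; zero; suc; pred; _∸_; _≤_; _<_; z≤n; s≤s; _<ᵇ_; _≡ᵇ_; >-nonZero)
  renaming (_+_ to _+ℕ_)
import Data.Nat.Properties as ℕₚ
open import Data.Integer using (ℤ; +_; -[1+_]; ∣_∣)
import Data.Integer.Properties as ℤₚ
open import Data.List
  using (List; []; _∷_; _++_; map; length; upTo; applyUpTo; zip; take; drop; concat; concatMap; filter; filterᵇ)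
import Data.List.Properties as Listₚ
open import Data.List.Relation.Unary.All as All using (All; []; _∷_)
import Data.List.Relation.Unary.All.Properties as Allₚ
open import Data.List.Relation.Unary.Any as Any using (Any; here; there)
open import Data.List.Relation.Unary.AllPairs as AllPairs using (AllPairs; []; _∷_)
import Data.List.Relation.Unary.AllPairs.Properties as AllPairsₚ
open import Data.List.Membership.Propositional using (_∈_)
open import Data.List.Membership.DecPropositional ℤₚ._≟_ using (_∈?_)
open import Data.List.Membership.Propositional.Properties
  using (∈-map⁺; ∈-++⁺ˡ; ∈-++⁺ʳ; ∈-++⁻; ∈-upTo⁺; ∈-upTo⁻; ∈-filter⁺)
open import Data.Product using (∃; _×_; _,_; proj₁; proj₂)
open import Data.Product.Properties using (≡-dec)
open import Data.Sum using (inj₁; inj₂)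
open import Data.Empty using (⊥-elim)
open import Data.Unit using (tt)
open import Function using (_∘_; id; _|>_)
open import Relation.Nullary using (¬_; Dec; yes; no; does; ¬?)
open import Relation.Nullary.Decidable using (recompute)
open import Relation.Binary.Definitions using (DecidableEquality; tri<; tri≈; tri>)
open import Relation.Binary.PropositionalEquality as ≡ using (_≡_; _≢_; cong; cong₂; subst)

module Counting where
  open ≡ using (refl; sym; trans)
  open ℕₚ

  T⇒≡true : ∀ {b} → T b → b ≡ true
  T⇒≡true {true} _ = refl

  ¬T⇒≡false : ∀ {b} → ¬ T b → b ≡ false
  ¬T⇒≡false {false} _ = refl
  ¬T⇒≡false {true}  ¬t = ⊥-elim (¬t tt)

  T-not⇒≡false : ∀ {b} → T (not b) → b ≡ false
  T-not⇒≡false {false} _ = refl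

  T-ext : ∀ {a b} → (T a → T b) → (T b → T a) → a ≡ b
  T-ext {false} {false} _ _ = refl
  T-ext {false} {true}  _ g = ⊥-elim (g tt)
  T-ext {true}  {false} f _ = ⊥-elim (f tt)
  T-ext {true}  {true}  _ _ = refl

  module _ {A : Set} where

    count-cong : ∀ {p q : A → Bool} l → All (λ x → p x ≡ q x) l → countᵇ p l ≡ countᵇ q l
    count-cong []      []       = refl
    count-cong (x ∷ l) (e ∷ es) rewrite e | count-cong l es = refl

    count-mono : ∀ {p q : A → Bool} l → All (λ x → T (p x) → T (q x)) l → countᵇ p l ≤ countᵇ q l
    count-mono [] [] = z≤n
    count-mono {p} {q} (x ∷ l) (h ∷ hs) with p x | q x | h
    ... | true  | true  | _  = s≤s (count-mono l hs)
    ... | true  | false | h' = ⊥-elim (h' tt)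
    ... | false | true  | _  = m≤n⇒m≤1+n (count-mono l hs)
    ... | false | false | _  = count-mono l hs

    count-mono-< : ∀ {p q : A → Bool} l → All (λ x → T (p x) → T (q x)) l →
                   Any (λ x → T (q x) × ¬ T (p x)) l → countᵇ p l < countᵇ q l
    count-mono-< (x ∷ l) (h ∷ hs) (here (qx , ¬px))
      rewrite T⇒≡true qx | ¬T⇒≡false ¬px = s≤s (count-mono l hs)
    count-mono-< {p} {q} (x ∷ l) (h ∷ hs) (there any) with p x | q x | h
    ... | true  | true  | _  = s≤s (count-mono-< l hs any)
    ... | true  | false | h' = ⊥-elim (h' tt)
    ... | false | true  | _  = m<n⇒m<1+n (count-mono-< l hs any)
    ... | false | false | _  = count-mono-< l hs any

    count-true : ∀ l → countᵇ (λ (_ : A) → true) l ≡ length l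
    count-true []      = refl
    count-true (_ ∷ l) = cong suc (count-true l)

    count≡length-filterᵇ : ∀ p (l : List A) → countᵇ p l ≡ length (filterᵇ p l)
    count≡length-filterᵇ p []      = refl
    count≡length-filterᵇ p (x ∷ l) with p x
    ... | true  = cong suc (count≡length-filterᵇ p l)
    ... | false = count≡length-filterᵇ p l

    count≡0⇒none : ∀ p (l : List A) → countᵇ p l ≡ 0 → All (λ x → ¬ T (p x)) l
    count≡0⇒none p []      _ = []
    count≡0⇒none p (x ∷ l) e with p x in eq
    ... | false = (λ t → subst T eq t) ∷ count≡0⇒none p l e

    none⇒count≡0 : ∀ p (l : List A) → All (λ x → ¬ T (p x)) l → countᵇ p l ≡ 0
    none⇒count≡0 p []      []       = refl
    none⇒count≡0 p (x ∷ l) (h ∷ hs) rewrite ¬T⇒≡false h = none⇒count≡0 p l hs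

    count>0⇒any : ∀ p (l : List A) → 1 ≤ countᵇ p l → Any (T ∘ p) l
    count>0⇒any p (x ∷ l) le with p x in eq
    ... | true  = here (subst T (sym eq) tt)
    ... | false = there (count>0⇒any p l le)

    count-++ : ∀ p (u v : List A) → countᵇ p (u ++ v) ≡ countᵇ p u +ℕ countᵇ p v
    count-++ p []      v = refl
    count-++ p (x ∷ u) v with p x
    ... | true  = cong suc (count-++ p u v)
    ... | false = count-++ p u v

    count-middle : ∀ p (xs : List A) y ys → countᵇ p (xs ++ y ∷ ys) ≡ countᵇ p (y ∷ xs ++ ys)
    count-middle p []       y ys = refl
    count-middle p (x ∷ xs) y ys with p x | p y | count-middle p xs y ys
    ... | true  | true  | e = cong suc e
    ... | true  | false | e = cong suc e
    ... | false | true  | e = e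
    ... | false | false | e = e

    allᵇ⁺ : ∀ p (l : List A) → All (T ∘ p) l → T (allᵇ p l)
    allᵇ⁺ p []      []       = tt
    allᵇ⁺ p (x ∷ l) (t ∷ ts) rewrite T⇒≡true t = allᵇ⁺ p l ts

    allᵇ⁻ : ∀ p (l : List A) → T (allᵇ p l) → All (T ∘ p) l
    allᵇ⁻ p []      _ = []
    allᵇ⁻ p (x ∷ l) t with p x in eq
    ... | true = subst T (sym eq) tt ∷ allᵇ⁻ p l t

    allᵇ-cong : ∀ (p q : A → Bool) l → (∀ x → p x ≡ q x) → allᵇ p l ≡ allᵇ q l
    allᵇ-cong p q []      e = refl
    allᵇ-cong p q (x ∷ l) e = cong₂ _∧_ (e x) (allᵇ-cong p q l e)

    count-map : ∀ {B : Set} (p : B → Bool) (f : A → B) l → countᵇ p (map f l) ≡ countᵇ (p ∘ f) l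
    count-map p f []      = refl
    count-map p f (x ∷ l) rewrite count-map p f l = refl

    AllPairs-map-within : ∀ {R S : A → A → Set} (w : List A) {l} →
                          (∀ {a b} → a ∈ w → b ∈ w → R a b → S a b) →
                          All (_∈ w) l → AllPairs R l → AllPairs S l
    AllPairs-map-within w f []         []       = []
    AllPairs-map-within w f (m ∷ ms) (h ∷ hs) =
      All.zipWith (λ (my , r) → f m my r) (ms , h) ∷ AllPairs-map-within w f ms hs

    AllPairs-key-injective : ∀ {B : Set} (key : A → B) {l} → AllPairs (λ x y → key x ≢ key y) l →
                             ∀ {x y} → x ∈ l → y ∈ l → key x ≡ key y → x ≡ y
    AllPairs-key-injective key (h ∷ hs) (here refl) (here refl) e = refl
    AllPairs-key-injective key (h ∷ hs) (here refl) (there my) e = ⊥-elim (All.lookup h my e)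
    AllPairs-key-injective key (h ∷ hs) (there mx) (here refl) e = ⊥-elim (All.lookup h mx (sym e))
    AllPairs-key-injective key (h ∷ hs) (there mx) (there my) e = AllPairs-key-injective key hs mx my e

  Distinct : List ℕ → Set
  Distinct = AllPairs _≢_

  ≢? : ∀ m x → Dec (x ≢ m)
  ≢? m x = ¬? (x ≟ m)

  remove : ℕ → List ℕ → List ℕ
  remove m = filter (≢? m)

  length≤1+length-remove : ∀ m {xs} → Distinct xs → length xs ≤ suc (length (remove m xs))
  length≤1+length-remove m {[]}     []        = z≤n
  length≤1+length-remove m {x ∷ xs} (x∉ ∷ d) with x ≟ m
  ... | yes refl = s≤s (≤-reflexive (cong length (sym (begin
    filter (≢? m) (m ∷ xs) ≡⟨ Listₚ.filter-reject (≢? m) (λ ne → ne refl) ⟩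
    filter (≢? m) xs       ≡⟨ Listₚ.filter-all (≢? m) (All.map (λ ne e → ne (sym e)) x∉) ⟩
    xs                     ∎))))
    where open ≡.≡-Reasoning
  ... | no x≢m   = ≤-trans (s≤s (length≤1+length-remove m d))
                           (≤-reflexive (cong (suc ∘ length) (sym (Listₚ.filter-accept (≢? m) x≢m))))

  1+length-remove≤ : ∀ m {xs} → m ∈ xs → suc (length (remove m xs)) ≤ length xs
  1+length-remove≤ m {xs} m∈ = Listₚ.filter-notAll (≢? m) xs (Any.map (λ e ne → ne (sym e)) m∈)

  below-remove : ∀ m {ns} → All (_< suc m) ns → All (_< m) (remove m ns)
  below-remove m {ns} bd =
    All.zipWith (λ (lt , ne) → ≤∧≢⇒< (≤-pred lt) ne) (Allₚ.filter⁺ (≢? m) bd , Allₚ.all-filter (≢? m) ns)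

  distinct-below⇒length≤ : ∀ n {ns} → Distinct ns → All (_< n) ns → length ns ≤ n
  distinct-below⇒length≤ zero    {[]}    _ _        = z≤n
  distinct-below⇒length≤ zero    {_ ∷ _} _ (() ∷ _)
  distinct-below⇒length≤ (suc m) d bd =
    ≤-trans (length≤1+length-remove m d)
            (s≤s (distinct-below⇒length≤ m (AllPairsₚ.filter⁺ (≢? m) d) (below-remove m bd)))

  distinct-below-missing⇒length< : ∀ n {ns} k → k < n → Distinct ns → All (_< n) ns →
                                   All (_≢ k) ns → length ns < n
  distinct-below-missing⇒length< (suc m) k k<n d bd ∌k with k ≟ m
  ... | yes refl = s≤s (distinct-below⇒length≤ m d (All.zipWith (λ (lt , ne) → ≤∧≢⇒< (≤-pred lt) ne) (bd , ∌k)))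
  ... | no k≢m   =
    ≤-trans (s≤s (length≤1+length-remove m d))
            (s≤s (distinct-below-missing⇒length< m k (≤∧≢⇒< (≤-pred k<n) k≢m)
                    (AllPairsₚ.filter⁺ (≢? m) d) (below-remove m bd) (Allₚ.filter⁺ (≢? m) ∌k)))

  covers⇒length≥ : ∀ n L → (∀ j → 0 < j → j ≤ n → j ∈ L) → n ≤ length L
  covers⇒length≥ zero    L _ = z≤n
  covers⇒length≥ (suc n) L covers =
    ≤-trans (s≤s (covers⇒length≥ n (remove (suc n) L) covers′))
            (1+length-remove≤ (suc n) (covers (suc n) (s≤s z≤n) ≤-refl))
    where
    covers′ : ∀ j → 0 < j → j ≤ n → j ∈ remove (suc n) L
    covers′ j 0<j j≤n = ∈-filter⁺ (≢? (suc n)) (covers j 0<j (m≤n⇒m≤1+n j≤n)) (λ e → <-irrefl e (s≤s j≤n))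

  distinct⇒count≤1 : ∀ k {ns} → Distinct ns → countᵇ (_≡ᵇ k) ns ≤ 1
  distinct⇒count≤1 k {[]}     []        = z≤n
  distinct⇒count≤1 k {x ∷ ns} (x∉ ∷ d) with x ≡ᵇ k in eq
  ... | true  = s≤s (≤-reflexive (none⇒count≡0 _ ns (All.map (λ ne t → ne (trans x≡k (sym (≡ᵇ⇒≡ _ k t)))) x∉)))
    where x≡k = ≡ᵇ⇒≡ x k (subst T (sym eq) tt)
  ... | false = distinct⇒count≤1 k d

  distinct-full⇒count≡1 : ∀ n {ns} → Distinct ns → All (_< n) ns → length ns ≡ n →
                          ∀ k → k < n → countᵇ (_≡ᵇ k) ns ≡ 1
  distinct-full⇒count≡1 n {ns} d bd len k k<n = ≤-antisym (distinct⇒count≤1 k d) present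
    where
    present : 1 ≤ countᵇ (_≡ᵇ k) ns
    present with countᵇ (_≡ᵇ k) ns in eq
    ... | suc _ = s≤s z≤n
    ... | zero  = ⊥-elim (<-irrefl len (distinct-below-missing⇒length< n k k<n d bd
                    (All.map (λ ¬t e → ¬t (≡⇒≡ᵇ _ k e)) (count≡0⇒none _ ns eq))))

  count≤1⇒distinct : ∀ (l : List ℕ) → (∀ {x} → x ∈ l → countᵇ (_≡ᵇ x) l ≤ 1) → Distinct l
  count≤1⇒distinct []      _  = []
  count≤1⇒distinct (x ∷ t) at-most-once = x∉t ∷ count≤1⇒distinct t (λ y∈t → ≤-trans (count-tail y∈t) (at-most-once (there y∈t)))
    where
    count-tail : ∀ {y} → y ∈ t → countᵇ (_≡ᵇ y) t ≤ countᵇ (_≡ᵇ y) (x ∷ t)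
    count-tail {y} _ with x ≡ᵇ y
    ... | true  = n≤1+n _
    ... | false = ≤-refl
    none-in-t : countᵇ (_≡ᵇ x) t ≡ 0
    none-in-t = n≤0⇒n≡0 (≤-pred (subst (λ b → (if b then suc (countᵇ (_≡ᵇ x) t) else countᵇ (_≡ᵇ x) t) ≤ 1)
                                       (T⇒≡true (≡⇒≡ᵇ x x refl)) (at-most-once (here refl))))
    x∉t : All (x ≢_) t
    x∉t = All.map (λ ¬t e → ¬t (≡⇒≡ᵇ _ x (sym e))) (count≡0⇒none _ t none-in-t)

module Standardization where
  open Counting
  open ≡ using (refl; sym; trans)
  open ≡.≡-Reasoning
  open ℕₚ

  Word : Set
  Word = List ℤ

  AbsDistinct : Word → Set
  AbsDistinct = AllPairs (λ a b → ∣ a ∣ ≢ ∣ b ∣)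

  countBelow : Word → ℕ → ℕ
  countBelow w n = countᵇ (λ b → ∣ b ∣ <ᵇ n) w

  rank : Word → ℤ → ℕ
  rank w a = countBelow w ∣ a ∣

  signedSuc : ℤ → ℕ → ℤ
  signedSuc a k = if isNeg a then -[1+ k ] else + suc k

  stLetter : Word → ℤ → ℤ
  stLetter w a = signedSuc a (rank w a)

  ∣signedSuc∣ : ∀ a k → ∣ signedSuc a k ∣ ≡ suc k
  ∣signedSuc∣ (+ _)    k = refl
  ∣signedSuc∣ -[1+ _ ] k = refl

  isNeg-signedSuc : ∀ a k → isNeg (signedSuc a k) ≡ isNeg a
  isNeg-signedSuc (+ _)    k = refl
  isNeg-signedSuc -[1+ _ ] k = refl

  <ᵇ-irrefl : ∀ n → (n <ᵇ n) ≡ false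
  <ᵇ-irrefl zero    = refl
  <ᵇ-irrefl (suc n) = <ᵇ-irrefl n

  countBelow-mono : ∀ w {m n} → m ≤ n → countBelow w m ≤ countBelow w n
  countBelow-mono w {m} {n} m≤n =
    count-mono w (All.tabulate (λ {b} _ t → <⇒<ᵇ (<-≤-trans (<ᵇ⇒< ∣ b ∣ m t) m≤n)))

  rank<countBelow : ∀ w {a n} → a ∈ w → ∣ a ∣ < n → rank w a < countBelow w n
  rank<countBelow w {a} {n} a∈ ∣a∣<n =
    count-mono-< w (All.tabulate (λ {b} _ t → <⇒<ᵇ (<-trans (<ᵇ⇒< ∣ b ∣ ∣ a ∣ t) ∣a∣<n)))
                   (Any.map (λ { refl → <⇒<ᵇ ∣a∣<n , subst T (<ᵇ-irrefl ∣ a ∣) }) a∈)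

  rank<length : ∀ w {a} → a ∈ w → rank w a < length w
  rank<length w {a} a∈ = subst (rank w a <_) (count-true w)
    (count-mono-< w (All.tabulate (λ _ _ → tt)) (Any.map (λ { refl → tt , subst T (<ᵇ-irrefl ∣ a ∣) }) a∈))

  rank-<ᵇ : ∀ w {a b} → a ∈ w → b ∈ w → (rank w a <ᵇ rank w b) ≡ (∣ a ∣ <ᵇ ∣ b ∣)
  rank-<ᵇ w {a} {b} a∈ b∈ = T-ext reflect (λ t → <⇒<ᵇ (rank<countBelow w a∈ (<ᵇ⇒< ∣ a ∣ ∣ b ∣ t)))
    where
    reflect : T (rank w a <ᵇ rank w b) → T (∣ a ∣ <ᵇ ∣ b ∣)
    reflect t with ∣ a ∣ <? ∣ b ∣
    ... | yes lt = <⇒<ᵇ lt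
    ... | no ¬lt = ⊥-elim (<⇒≱ (<ᵇ⇒< _ _ t) (countBelow-mono w (≮⇒≥ ¬lt)))

  rank-≡ᵇ : ∀ w {a b} → a ∈ w → b ∈ w → (rank w a ≡ᵇ rank w b) ≡ (∣ a ∣ ≡ᵇ ∣ b ∣)
  rank-≡ᵇ w {a} {b} a∈ b∈ = T-ext reflect (λ t → ≡⇒≡ᵇ _ _ (cong (countBelow w) (≡ᵇ⇒≡ ∣ a ∣ ∣ b ∣ t)))
    where
    reflect : T (rank w a ≡ᵇ rank w b) → T (∣ a ∣ ≡ᵇ ∣ b ∣)
    reflect t with <-cmp ∣ a ∣ ∣ b ∣
    ... | tri< lt _ _ = ⊥-elim (<-irrefl (≡ᵇ⇒≡ _ _ t) (rank<countBelow w a∈ lt))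
    ... | tri≈ _ e _  = ≡⇒≡ᵇ _ _ e
    ... | tri> _ _ gt = ⊥-elim (<-irrefl (sym (≡ᵇ⇒≡ _ _ t)) (rank<countBelow w b∈ gt))

  OrderEmbeddingOn : (ℤ → ℤ) → Word → Set
  OrderEmbeddingOn φ w = ∀ {a b} → a ∈ w → b ∈ w →
    ((∣ φ a ∣ <ᵇ ∣ φ b ∣) ≡ (∣ a ∣ <ᵇ ∣ b ∣)) × ((∣ φ a ∣ ≡ᵇ ∣ φ b ∣) ≡ (∣ a ∣ ≡ᵇ ∣ b ∣))

  OrderEmbeddingOn-⊆ : ∀ {φ w v} → OrderEmbeddingOn φ w → All (_∈ w) v → OrderEmbeddingOn φ v
  OrderEmbeddingOn-⊆ emb v⊆w a∈ b∈ = emb (All.lookup v⊆w a∈) (All.lookup v⊆w b∈)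

  stLetter-embedding : ∀ w → OrderEmbeddingOn (stLetter w) w
  stLetter-embedding w {a} {b} a∈ b∈ rewrite ∣signedSuc∣ a (rank w a) | ∣signedSuc∣ b (rank w b) =
    rank-<ᵇ w a∈ b∈ , rank-≡ᵇ w a∈ b∈

  enumerate : Word → List (ℕ × ℤ)
  enumerate w = zip (upTo (length w)) w

  stRankIn : List (ℕ × ℤ) → ℕ → ℤ → ℕ
  stRankIn e i a = countᵇ (λ q → (∣ proj₂ q ∣ <ᵇ ∣ a ∣) ∨ ((∣ proj₂ q ∣ ≡ᵇ ∣ a ∣) ∧ (proj₁ q <ᵇ i))) e

  stLetterIn : List (ℕ × ℤ) → ℕ × ℤ → ℤ
  stLetterIn e (i , a) = signedSuc a (stRankIn e i a)

  map-proj₂-zip-applyUpTo : ∀ (f : ℕ → ℕ) (w : Word) → map proj₂ (zip (applyUpTo f (length w)) w) ≡ w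
  map-proj₂-zip-applyUpTo f []      = refl
  map-proj₂-zip-applyUpTo f (a ∷ w) = cong (a ∷_) (map-proj₂-zip-applyUpTo (f ∘ suc) w)

  map-proj₂-enumerate : ∀ w → map proj₂ (enumerate w) ≡ w
  map-proj₂-enumerate = map-proj₂-zip-applyUpTo id

  ∈-enumerate⁻ : ∀ w {q} → q ∈ enumerate w → proj₂ q ∈ w
  ∈-enumerate⁻ w q∈ = subst (_ ∈_) (map-proj₂-enumerate w) (∈-map⁺ proj₂ q∈)

  count-enumerate : ∀ w (p : ℤ → Bool) → countᵇ p w ≡ countᵇ (p ∘ proj₂) (enumerate w)
  count-enumerate w p = trans (cong (countᵇ p) (sym (map-proj₂-enumerate w))) (count-map p proj₂ (enumerate w))

  length-stWord : ∀ w → length (stWord w) ≡ length w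
  length-stWord w = trans (Listₚ.length-map _ (enumerate w)) (length-zip id w)
    where
    length-zip : ∀ (f : ℕ → ℕ) (w : Word) → length (zip (applyUpTo f (length w)) w) ≡ length w
    length-zip f []      = refl
    length-zip f (_ ∷ w) = cong suc (length-zip (f ∘ suc) w)

  stWord-absDistinct : ∀ w → AbsDistinct w → stWord w ≡ map (stLetter w) w
  stWord-absDistinct w d = begin
    map (stLetterIn e) e                ≡⟨ Listₚ.map-cong-local (All.tabulate letter≡) ⟩
    map (stLetter w ∘ proj₂) e          ≡⟨ Listₚ.map-∘ e ⟩
    map (stLetter w) (map proj₂ e)      ≡⟨ cong (map (stLetter w)) (map-proj₂-enumerate w) ⟩
    map (stLetter w) w                  ∎
    where
    e = enumerate w
    d′ : AllPairs (λ q r → ∣ proj₂ q ∣ ≢ ∣ proj₂ r ∣) e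
    d′ = AllPairsₚ.map⁻ (subst AbsDistinct (sym (map-proj₂-enumerate w)) d)
    -- with distinct absolute values the tie-break by position never applies
    rank≡ : ∀ {q} → q ∈ e → stRankIn e (proj₁ q) (proj₂ q) ≡ rank w (proj₂ q)
    rank≡ {q} q∈ = sym (trans (count-enumerate w _) (count-cong e (All.tabulate no-tie)))
      where
      no-tie : ∀ {r} → r ∈ e →
               (∣ proj₂ r ∣ <ᵇ ∣ proj₂ q ∣) ≡
               ((∣ proj₂ r ∣ <ᵇ ∣ proj₂ q ∣) ∨ ((∣ proj₂ r ∣ ≡ᵇ ∣ proj₂ q ∣) ∧ (proj₁ r <ᵇ proj₁ q)))
      no-tie {r} r∈ with ∣ proj₂ r ∣ ≡ᵇ ∣ proj₂ q ∣ in eq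
      ... | false = sym (∨-identityʳ _)
      ... | true with AllPairs-key-injective (λ x → ∣ proj₂ x ∣) d′ r∈ q∈ (≡ᵇ⇒≡ _ _ (subst T (sym eq) tt))
      ... | refl rewrite <ᵇ-irrefl (proj₁ r) | <ᵇ-irrefl ∣ proj₂ r ∣ = refl
    letter≡ : ∀ {q} → q ∈ e → stLetterIn e q ≡ stLetter w (proj₂ q)
    letter≡ q∈ = cong (signedSuc _) (rank≡ q∈)

  zip-map₂ : ∀ (φ : ℤ → ℤ) (xs : List ℕ) w → zip xs (map φ w) ≡ map (λ q → (proj₁ q , φ (proj₂ q))) (zip xs w)
  zip-map₂ φ []       w       = refl
  zip-map₂ φ (_ ∷ _)  []      = refl
  zip-map₂ φ (_ ∷ xs) (_ ∷ w) = cong (_ ∷_) (zip-map₂ φ xs w)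

  stWord-map : ∀ φ → (∀ x → isNeg (φ x) ≡ isNeg x) → ∀ w → OrderEmbeddingOn φ w → stWord (map φ w) ≡ stWord w
  stWord-map φ sign w emb = begin
    stWord (map φ w)                  ≡⟨ cong (λ e → map (stLetterIn e) e) enumerate-map ⟩
    map (stLetterIn e′) (map h e)     ≡⟨ Listₚ.map-∘ e ⟨
    map (stLetterIn e′ ∘ h) e         ≡⟨ Listₚ.map-cong-local (All.tabulate letter≡) ⟩
    map (stLetterIn e) e              ∎
    where
    e = enumerate w
    h = λ (q : ℕ × ℤ) → (proj₁ q , φ (proj₂ q))
    e′ = map h e
    enumerate-map : enumerate (map φ w) ≡ e′
    enumerate-map = trans (cong (λ n → zip (upTo n) (map φ w)) (Listₚ.length-map φ w)) (zip-map₂ φ (upTo (length w)) w)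
    rank≡ : ∀ {q} → q ∈ e → stRankIn e′ (proj₁ q) (φ (proj₂ q)) ≡ stRankIn e (proj₁ q) (proj₂ q)
    rank≡ {q} q∈ = trans (count-map _ h e) (count-cong e (All.tabulate same-test))
      where
      same-test : ∀ {r} → r ∈ e →
        ((∣ φ (proj₂ r) ∣ <ᵇ ∣ φ (proj₂ q) ∣) ∨ ((∣ φ (proj₂ r) ∣ ≡ᵇ ∣ φ (proj₂ q) ∣) ∧ (proj₁ r <ᵇ proj₁ q))) ≡
        ((∣ proj₂ r ∣ <ᵇ ∣ proj₂ q ∣) ∨ ((∣ proj₂ r ∣ ≡ᵇ ∣ proj₂ q ∣) ∧ (proj₁ r <ᵇ proj₁ q)))
      same-test {r} r∈ with emb (∈-enumerate⁻ w r∈) (∈-enumerate⁻ w q∈)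
      ... | <-same , ≡-same = cong₂ (λ x y → x ∨ (y ∧ (proj₁ r <ᵇ proj₁ q))) <-same ≡-same
    letter≡ : ∀ {q} → q ∈ e → stLetterIn e′ (h q) ≡ stLetterIn e q
    letter≡ {q} q∈ rewrite sign (proj₂ q) | rank≡ q∈ = refl

  stLetters-isSPerm : ∀ w → AbsDistinct w → T (isSPerm (map (stLetter w) w))
  stLetters-isSPerm w d rewrite Listₚ.length-map (stLetter w) w =
    allᵇ⁺ _ _ (Allₚ.map⁺ (All.tabulate (λ {k} k∈ → subst (λ c → T (c ≡ᵇ 1)) (sym (once k (∈-upTo⁻ k∈))) tt)))
    where
    ranks-distinct : Distinct (map (rank w) w)
    ranks-distinct = AllPairsₚ.map⁺ (AllPairs-map-within w
      (λ a∈ b∈ ne e → ne (≡ᵇ⇒≡ _ _ (subst T (rank-≡ᵇ w a∈ b∈) (≡⇒≡ᵇ _ _ e)))) (All.tabulate id) d)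
    ranks-below : All (_< length w) (map (rank w) w)
    ranks-below = Allₚ.map⁺ (All.tabulate (rank<length w))
    once : ∀ k → k < length w → countᵇ (λ a → ∣ a ∣ ≡ᵇ suc k) (map (stLetter w) w) ≡ 1
    once k k<n = begin
      countᵇ (λ a → ∣ a ∣ ≡ᵇ suc k) (map (stLetter w) w)  ≡⟨ count-map _ (stLetter w) w ⟩
      countᵇ (λ a → ∣ stLetter w a ∣ ≡ᵇ suc k) w
        ≡⟨ count-cong w (All.tabulate (λ {a} _ → cong (_≡ᵇ suc k) (∣signedSuc∣ a (rank w a)))) ⟩
      countᵇ (λ a → rank w a ≡ᵇ k) w                      ≡⟨ count-map (_≡ᵇ k) (rank w) w ⟨
      countᵇ (_≡ᵇ k) (map (rank w) w)
        ≡⟨ distinct-full⇒count≡1 (length w) ranks-distinct ranks-below (Listₚ.length-map _ w) k k<n ⟩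
      1                                                   ∎

  stWord-isSPerm : ∀ w → AbsDistinct w → T (isSPerm (stWord w))
  stWord-isSPerm w d = subst (T ∘ isSPerm) (sym (stWord-absDistinct w d)) (stLetters-isSPerm w d)

  module SignedPermutation (v : Word) (valid : T (isSPerm v)) where

    absolutes : List ℕ
    absolutes = map ∣_∣ v

    count-absolutes≡1 : ∀ j → 0 < j → j ≤ length v → countᵇ (_≡ᵇ j) absolutes ≡ 1
    count-absolutes≡1 (suc k) _ k<n =
      trans (count-map _ ∣_∣ v) (≡ᵇ⇒≡ _ 1 (All.lookup (allᵇ⁻ _ _ valid) (∈-map⁺ suc (∈-upTo⁺ k<n))))

    ∈-absolutes : ∀ j → 0 < j → j ≤ length v → j ∈ absolutes
    ∈-absolutes j 0<j j≤n = Any.map (λ t → sym (≡ᵇ⇒≡ _ _ t))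
      (count>0⇒any _ absolutes (≤-reflexive (sym (count-absolutes≡1 j 0<j j≤n))))

    -- 1, …, n already fill the n entries of absolutes, leaving no room for any other value
    absolutes-in-range : All (λ x → 0 < x × x ≤ length v) absolutes
    absolutes-in-range = All.tabulate in-range
      where
      listed : ∀ {x} → x ∈ absolutes → ¬ (∀ j → 0 < j → j ≤ length v → j ≢ x)
      listed {x} x∈ ≢x = 1+n≰n (≤-trans
        (s≤s (covers⇒length≥ (length v) (remove x absolutes)
               (λ j 0<j j≤n → ∈-filter⁺ (≢? x) (∈-absolutes j 0<j j≤n) (≢x j 0<j j≤n))))
        (subst (suc (length (remove x absolutes)) ≤_) (Listₚ.length-map ∣_∣ v) (1+length-remove≤ x x∈)))
      in-range : ∀ {x} → x ∈ absolutes → 0 < x × x ≤ length v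
      in-range {x} x∈ with 0 <? x | x ≤? length v
      ... | yes p  | yes q  = p , q
      ... | no ¬p  | _      = ⊥-elim (listed x∈ (λ j 0<j _ e → ¬p (subst (0 <_) e 0<j)))
      ... | yes _  | no ¬q  = ⊥-elim (listed x∈ (λ j _ j≤n e → ¬q (subst (_≤ length v) e j≤n)))

    absolutes-distinct : Distinct absolutes
    absolutes-distinct = count≤1⇒distinct absolutes (λ x∈ →
      let 0<x , x≤n = All.lookup absolutes-in-range x∈ in ≤-reflexive (count-absolutes≡1 _ 0<x x≤n))

    absDistinct : AbsDistinct v
    absDistinct = AllPairsₚ.map⁻ absolutes-distinct

    abs-bounds : ∀ {a} → a ∈ v → 0 < ∣ a ∣ × ∣ a ∣ ≤ length v
    abs-bounds a∈ = All.lookup absolutes-in-range (∈-map⁺ ∣_∣ a∈)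

    abs-positive : All (λ a → 0 < ∣ a ∣) v
    abs-positive = All.tabulate (proj₁ ∘ abs-bounds)

    abs-bounded : All (λ a → ∣ a ∣ ≤ length v) v
    abs-bounded = All.tabulate (proj₂ ∘ abs-bounds)

    rank≡pred : ∀ {a} → a ∈ v → rank v a ≡ pred ∣ a ∣
    rank≡pred {a} a∈ = ≤-antisym (<⇒≤pred rank<∣a∣)
      (subst (pred ∣ a ∣ ≤_) (sym rank≡) (covers⇒length≥ (pred ∣ a ∣) below covers))
      where
      0<∣a∣ = proj₁ (abs-bounds a∈)
      below = filterᵇ (_<ᵇ ∣ a ∣) absolutes
      rank≡ : rank v a ≡ length below
      rank≡ = trans (sym (count-map (_<ᵇ ∣ a ∣) ∣_∣ v)) (count≡length-filterᵇ _ absolutes)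
      rank<∣a∣ : rank v a < ∣ a ∣
      rank<∣a∣ rewrite rank≡ = distinct-below-missing⇒length< ∣ a ∣ 0 0<∣a∣
        (AllPairsₚ.filter⁺ _ absolutes-distinct)
        (Allₚ.all-filter (T? ∘ (_<ᵇ ∣ a ∣)) absolutes |> All.map (<ᵇ⇒< _ _))
        (Allₚ.filter⁺ _ (All.map (λ (0<x , _) e → <-irrefl (sym e) 0<x) absolutes-in-range))
      covers : ∀ j → 0 < j → j ≤ pred ∣ a ∣ → j ∈ below
      covers j 0<j j≤ = ∈-filter⁺ (T? ∘ (_<ᵇ ∣ a ∣))
        (∈-absolutes j 0<j (≤-trans (≤pred⇒≤ j≤) (proj₂ (abs-bounds a∈))))
        (<⇒<ᵇ (m≤pred[n]⇒suc[m]≤n {{>-nonZero 0<∣a∣}} j≤))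

    stLetter≡id : ∀ {a} → a ∈ v → stLetter v a ≡ a
    stLetter≡id {a} a∈ = fixed a (rank≡pred a∈) (proj₁ (abs-bounds a∈))
      where
      fixed : ∀ a → rank v a ≡ pred ∣ a ∣ → 0 < ∣ a ∣ → signedSuc a (rank v a) ≡ a
      fixed (+ suc k) e _ rewrite e = refl
      fixed -[1+ k ]  e _ rewrite e = refl

    stWord-id : stWord v ≡ v
    stWord-id = trans (stWord-absDistinct v absDistinct) (Listₚ.map-id-local (All.tabulate stLetter≡id))

  isSPerm-word : (σ : SPerm) → T (isSPerm (word σ))
  isSPerm-word (sp w p) = recompute (T? (isSPerm w)) p

  module SPerm-properties (σ : SPerm) = SignedPermutation (word σ) (isSPerm-word σ)

  stSPerm : (w : Word) → AbsDistinct w → SPerm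
  stSPerm w d = sp (stWord w) (stWord-isSPerm w d)

  sp-cong : ∀ {w w′} .{p : T (isSPerm w)} .{p′ : T (isSPerm w′)} → w ≡ w′ → sp w p ≡ sp w′ p′
  sp-cong refl = refl

  stSPerm-word : ∀ σ → stSPerm (word σ) (SPerm-properties.absDistinct σ) ≡ σ
  stSPerm-word σ = sp-cong (SPerm-properties.stWord-id σ)

  isNeg-shiftL : ∀ k x → isNeg (shiftL k x) ≡ isNeg x
  isNeg-shiftL k (+ _)    = refl
  isNeg-shiftL k -[1+ _ ] = refl

  ∣shiftL∣ : ∀ k x → ∣ shiftL k x ∣ ≡ ∣ x ∣ +ℕ k
  ∣shiftL∣ k (+ _)    = refl
  ∣shiftL∣ k -[1+ _ ] = refl

  shift-shift : ∀ m n v → shift m (shift n v) ≡ shift (m +ℕ n) v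
  shift-shift m n v = trans (sym (Listₚ.map-∘ v)) (Listₚ.map-cong shiftL-shiftL v)
    where
    shiftL-shiftL : ∀ x → shiftL m (shiftL n x) ≡ shiftL (m +ℕ n) x
    shiftL-shiftL (+ j)    = cong +_ (trans (+-assoc j n m) (cong (j +ℕ_) (+-comm n m)))
    shiftL-shiftL -[1+ j ] = cong -[1+_] (trans (+-assoc j n m) (cong (j +ℕ_) (+-comm n m)))

  <ᵇ-≡ᵇ-agree-< : ∀ {x y x′ y′} → x < y → x′ < y′ → ((x <ᵇ y) ≡ (x′ <ᵇ y′)) × ((x ≡ᵇ y) ≡ (x′ ≡ᵇ y′))
  <ᵇ-≡ᵇ-agree-< lt lt′ =
    trans (T⇒≡true (<⇒<ᵇ lt)) (sym (T⇒≡true (<⇒<ᵇ lt′))) ,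
    trans (¬T⇒≡false (λ t → <⇒≢ lt (≡ᵇ⇒≡ _ _ t))) (sym (¬T⇒≡false (λ t → <⇒≢ lt′ (≡ᵇ⇒≡ _ _ t))))

  <ᵇ-≡ᵇ-agree-> : ∀ {x y x′ y′} → y < x → y′ < x′ → ((x <ᵇ y) ≡ (x′ <ᵇ y′)) × ((x ≡ᵇ y) ≡ (x′ ≡ᵇ y′))
  <ᵇ-≡ᵇ-agree-> gt gt′ =
    trans (¬T⇒≡false (λ t → <-asym gt (<ᵇ⇒< _ _ t))) (sym (¬T⇒≡false (λ t → <-asym gt′ (<ᵇ⇒< _ _ t)))) ,
    trans (¬T⇒≡false (λ t → <⇒≢ gt (sym (≡ᵇ⇒≡ _ _ t)))) (sym (¬T⇒≡false (λ t → <⇒≢ gt′ (sym (≡ᵇ⇒≡ _ _ t)))))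

  +-cancelʳ-<ᵇ-≡ᵇ : ∀ x y k → (((x +ℕ k) <ᵇ (y +ℕ k)) ≡ (x <ᵇ y)) × (((x +ℕ k) ≡ᵇ (y +ℕ k)) ≡ (x ≡ᵇ y))
  +-cancelʳ-<ᵇ-≡ᵇ x y k =
    T-ext (λ t → <⇒<ᵇ (+-cancelʳ-< k x y (<ᵇ⇒< _ _ t))) (λ t → <⇒<ᵇ (+-monoˡ-< k (<ᵇ⇒< x y t))) ,
    T-ext (λ t → ≡⇒≡ᵇ x y (+-cancelʳ-≡ k x y (≡ᵇ⇒≡ _ _ t))) (λ t → ≡⇒≡ᵇ _ _ (cong (_+ℕ k) (≡ᵇ⇒≡ x y t)))

  shiftL-embedding : ∀ k w → OrderEmbeddingOn (shiftL k) w
  shiftL-embedding k w {a} {b} _ _ rewrite ∣shiftL∣ k a | ∣shiftL∣ k b = +-cancelʳ-<ᵇ-≡ᵇ ∣ a ∣ ∣ b ∣ k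

  stWord-shift : ∀ k w → stWord (shift k w) ≡ stWord w
  stWord-shift k w = stWord-map (shiftL k) (isNeg-shiftL k) w (shiftL-embedding k w)

  absDistinct-shift : ∀ k {v} → AbsDistinct v → AbsDistinct (shift k v)
  absDistinct-shift k d = AllPairsₚ.map⁺ (AllPairs.map (λ {a} {b} ne e →
    ne (+-cancelʳ-≡ k _ _ (trans (sym (∣shiftL∣ k a)) (trans e (∣shiftL∣ k b))))) d)

  shift-above : ∀ k {v} → All (λ b → 0 < ∣ b ∣) v → All (λ b → k < ∣ b ∣) (shift k v)
  shift-above k p = Allₚ.map⁺ (All.map (λ {b} 0<b → subst (k <_) (sym (∣shiftL∣ k b)) (+-monoˡ-< k 0<b)) p)

  shift-below : ∀ k {K v} → All (λ b → ∣ b ∣ ≤ K) v → All (λ b → ∣ b ∣ ≤ K +ℕ k) (shift k v)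
  shift-below k p = Allₚ.map⁺ (All.map (λ {b} b≤ → subst (_≤ _) (sym (∣shiftL∣ k b)) (+-monoˡ-≤ k b≤)) p)

  Separated : Word → Word → Set
  Separated u v = All (λ a → All (λ b → ∣ a ∣ < ∣ b ∣) v) u

  separated-by : ∀ K {u v} → All (λ a → ∣ a ∣ ≤ K) u → All (λ b → K < ∣ b ∣) v → Separated u v
  separated-by K u≤ v> = All.map (λ a≤ → All.map (≤-<-trans a≤) v>) u≤

  absDistinct-++ : ∀ {u v} → AbsDistinct u → AbsDistinct v → Separated u v → AbsDistinct (u ++ v)
  absDistinct-++ du dv sep = AllPairsₚ.++⁺ du dv (All.map (All.map <⇒≢) sep)

  module SeparatedStandardization (u v : Word) (du : AbsDistinct u) (dv : AbsDistinct v) (sep : Separated u v) where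

    relabel : ℤ → ℤ
    relabel x = if does (x ∈? u) then stLetter u x else shiftL (length u) (stLetter v x)

    isNeg-relabel : ∀ x → isNeg (relabel x) ≡ isNeg x
    isNeg-relabel x with does (x ∈? u)
    ... | true  = isNeg-signedSuc x _
    ... | false = trans (isNeg-shiftL _ _) (isNeg-signedSuc x _)

    relabel-left : ∀ {a} → a ∈ u → relabel a ≡ stLetter u a
    relabel-left {a} a∈ with a ∈? u
    ... | yes _  = refl
    ... | no a∉ = ⊥-elim (a∉ a∈)

    relabel-right : ∀ {b} → b ∈ v → relabel b ≡ shiftL (length u) (stLetter v b)
    relabel-right {b} b∈ with b ∈? u
    ... | yes b∈u = ⊥-elim (<-irrefl refl (All.lookup (All.lookup sep b∈u) b∈))
    ... | no _    = refl

    map-relabel-left : map relabel u ≡ stWord u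
    map-relabel-left = trans (Listₚ.map-cong-local (All.tabulate relabel-left)) (sym (stWord-absDistinct u du))

    map-relabel-right : map relabel v ≡ shift (length u) (stWord v)
    map-relabel-right = trans (Listₚ.map-cong-local (All.tabulate relabel-right))
      (trans (Listₚ.map-∘ v) (cong (shift (length u)) (sym (stWord-absDistinct v dv))))

    ∣relabel-left∣ : ∀ {a} → a ∈ u → ∣ relabel a ∣ ≤ length u
    ∣relabel-left∣ {a} a∈ rewrite relabel-left a∈ | ∣signedSuc∣ a (rank u a) = rank<length u a∈

    ∣relabel-right∣ : ∀ {b} → b ∈ v → length u < ∣ relabel b ∣
    ∣relabel-right∣ {b} b∈ rewrite relabel-right b∈ | ∣shiftL∣ (length u) (stLetter v b) | ∣signedSuc∣ b (rank v b) =
      s≤s (m≤n+m _ _)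

    relabel-embedding : OrderEmbeddingOn relabel (u ++ v)
    relabel-embedding {a} {b} a∈ b∈ with ∈-++⁻ u a∈ | ∈-++⁻ u b∈
    ... | inj₁ a∈u | inj₁ b∈u rewrite relabel-left a∈u | relabel-left b∈u = stLetter-embedding u a∈u b∈u
    ... | inj₂ a∈v | inj₂ b∈v rewrite relabel-right a∈v | relabel-right b∈v
                                    | ∣shiftL∣ (length u) (stLetter v a) | ∣shiftL∣ (length u) (stLetter v b)
                                    | proj₁ (+-cancelʳ-<ᵇ-≡ᵇ ∣ stLetter v a ∣ ∣ stLetter v b ∣ (length u))
                                    | proj₂ (+-cancelʳ-<ᵇ-≡ᵇ ∣ stLetter v a ∣ ∣ stLetter v b ∣ (length u)) =
      stLetter-embedding v a∈v b∈v
    ... | inj₁ a∈u | inj₂ b∈v = <ᵇ-≡ᵇ-agree-< (≤-<-trans (∣relabel-left∣ a∈u) (∣relabel-right∣ b∈v))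
                                              (All.lookup (All.lookup sep a∈u) b∈v)
    ... | inj₂ a∈v | inj₁ b∈u = <ᵇ-≡ᵇ-agree-> (≤-<-trans (∣relabel-left∣ b∈u) (∣relabel-right∣ a∈v))
                                              (All.lookup (All.lookup sep b∈u) a∈v)

  AbsDistinctOver : Word → Word → Set
  AbsDistinctOver S w = AbsDistinct w × All (_∈ S) w

  ∷-absDistinctOver : ∀ {S T a w} → (∀ {x} → x ∈ T → x ∈ S) → a ∈ S → All (λ x → ∣ a ∣ ≢ ∣ x ∣) T →
                      AbsDistinctOver T w → AbsDistinctOver S (a ∷ w)
  ∷-absDistinctOver T⊆S a∈S fresh (dw , w⊆T) = (All.map (All.lookup fresh) w⊆T ∷ dw) , (a∈S ∷ All.map T⊆S w⊆T)

  ∈-insert⁺ : ∀ xs {y ys} {x : ℤ} → x ∈ xs ++ ys → x ∈ xs ++ y ∷ ys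
  ∈-insert⁺ xs x∈ with ∈-++⁻ xs x∈
  ... | inj₁ x∈xs = ∈-++⁺ˡ x∈xs
  ... | inj₂ x∈ys = ∈-++⁺ʳ xs (there x∈ys)

  All-remove : ∀ {P : ℤ → Set} xs {y ys} → All P (xs ++ y ∷ ys) → All P (xs ++ ys) × P y
  All-remove []       (py ∷ ps) = ps , py
  All-remove (_ ∷ xs) (px ∷ ps) = let ps′ , py = All-remove xs ps in (px ∷ ps′) , py

  absDistinct-remove : ∀ xs {y ys} → AbsDistinct (xs ++ y ∷ ys) →
                       AbsDistinct (xs ++ ys) × All (λ x → ∣ y ∣ ≢ ∣ x ∣) (xs ++ ys)
  absDistinct-remove []       (fresh ∷ d) = d , fresh
  absDistinct-remove (x ∷ xs) (fresh ∷ d) =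
    let d′ , y-fresh = absDistinct-remove xs d
        x-fresh , x≢y = All-remove xs fresh
    in (x-fresh ∷ d′) , ((λ e → x≢y (sym e)) ∷ y-fresh)

  isSPerm-++-shift : ∀ u v → T (isSPerm u) → T (isSPerm v) → T (isSPerm (u ++ shift (length u) v))
  isSPerm-++-shift u v valid-u valid-v =
    allᵇ⁺ _ _ (Allₚ.map⁺ (All.tabulate (λ {k} k∈ →
      subst (λ c → T (c ≡ᵇ 1)) (sym (once k (<-≤-trans (∈-upTo⁻ k∈) (≤-reflexive length≡)))) tt)))
    where
    module U = SignedPermutation u valid-u
    module V = SignedPermutation v valid-v
    m = length u
    n = length v
    length≡ : length (u ++ shift m v) ≡ m +ℕ n
    length≡ = trans (Listₚ.length-++ u) (cong (m +ℕ_) (Listₚ.length-map _ v))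
    once : ∀ k → k < m +ℕ n → countᵇ (λ a → ∣ a ∣ ≡ᵇ suc k) (u ++ shift m v) ≡ 1
    once k k<m+n rewrite count-++ (λ a → ∣ a ∣ ≡ᵇ suc k) u (shift m v) with suc k ≤? m
    ... | yes k<m = cong₂ _+ℕ_ in-u none-in-v
      where
      in-u = trans (sym (count-map _ ∣_∣ u)) (U.count-absolutes≡1 (suc k) (s≤s z≤n) k<m)
      none-in-v = none⇒count≡0 _ (shift m v)
        (All.map (λ m<∣b∣ t → <-irrefl (sym (≡ᵇ⇒≡ _ _ t)) (≤-<-trans k<m m<∣b∣)) (shift-above m V.abs-positive))
    ... | no k≮m  = cong₂ _+ℕ_ none-in-u in-v
      where
      j = suc k ∸ m
      m<1+k = ≰⇒> k≮m
      j+m≡1+k : j +ℕ m ≡ suc k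
      j+m≡1+k = m∸n+n≡m (<⇒≤ m<1+k)
      none-in-u = none⇒count≡0 _ u (All.map (λ ∣a∣≤m t → k≮m (subst (_≤ m) (≡ᵇ⇒≡ _ _ t) ∣a∣≤m)) U.abs-bounded)
      in-v = begin
        countᵇ (λ a → ∣ a ∣ ≡ᵇ suc k) (shift m v)        ≡⟨ count-map _ (shiftL m) v ⟩
        countᵇ (λ a → ∣ shiftL m a ∣ ≡ᵇ suc k) v         ≡⟨ count-cong v (All.tabulate (λ {a} _ → shifted a)) ⟩
        countᵇ (λ a → ∣ a ∣ ≡ᵇ j) v                      ≡⟨ count-map _ ∣_∣ v ⟨
        countᵇ (_≡ᵇ j) V.absolutes                      ≡⟨ V.count-absolutes≡1 j (m<n⇒0<n∸m m<1+k)
                                                             (+-cancelʳ-≤ m j n (≤-trans (≤-reflexive j+m≡1+k)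
                                                                (≤-trans k<m+n (≤-reflexive (+-comm m n))))) ⟩
        1                                               ∎
        where
        shifted : ∀ a → (∣ shiftL m a ∣ ≡ᵇ suc k) ≡ (∣ a ∣ ≡ᵇ j)
        shifted a = trans (cong₂ _≡ᵇ_ (∣shiftL∣ m a) (sym j+m≡1+k)) (proj₂ (+-cancelʳ-<ᵇ-≡ᵇ ∣ a ∣ j m))

  Positive : Word → Set
  Positive = All (λ a → isNeg a ≡ false)

  unsigned⇒positive : ∀ σ → T (isUnsigned σ) → Positive (word σ)
  unsigned⇒positive σ t = All.map T-not⇒≡false (allᵇ⁻ _ (word σ) t)

  positive⇒unsigned : ∀ σ → Positive (word σ) → T (isUnsigned σ)
  positive⇒unsigned σ p = allᵇ⁺ _ (word σ) (All.map (λ e → subst (T ∘ not) (sym e) tt) p)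

  positive-stWord : ∀ w → Positive w → Positive (stWord w)
  positive-stWord w p = Allₚ.map⁺ (All.tabulate (λ {q} q∈ →
    trans (isNeg-signedSuc (proj₂ q) _) (All.lookup p (∈-enumerate⁻ w q∈))))

  positive-shift : ∀ k {w} → Positive w → Positive (shift k w)
  positive-shift k p = Allₚ.map⁺ (All.map (λ {a} e → trans (isNeg-shiftL k a) e) p)

  isSPerm-cong : ∀ w w′ → (∀ p → countᵇ p w ≡ countᵇ p w′) → length w ≡ length w′ → isSPerm w ≡ isSPerm w′
  isSPerm-cong w w′ counts lengths rewrite lengths =
    allᵇ-cong _ _ (map suc (upTo (length w′))) (λ i → cong (_≡ᵇ 1) (counts (λ a → ∣ a ∣ ≡ᵇ i)))

open Counting
open Standardization

module Pairing {c ℓ} (F : Field c ℓ) where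
  open Field F
  open HSymDefs F
  open import Relation.Binary.Reasoning.Setoid setoid
  open import Algebra.Properties.Ring ring using (-1*x≈-x; x∙y⁻¹≈ε⇒x≈y)
  open import Algebra.Properties.CommutativeSemigroup +-commutativeSemigroup using (interchange)

  ⟨_∣_⟩ : {X : Set} → Lin X → (X → Carrier) → Carrier
  ⟨ u ∣ g ⟩ = extF g u

  ⟨⟩-++ : {X : Set} (g : X → Carrier) (u v : Lin X) → ⟨ u ++ v ∣ g ⟩ ≈ ⟨ u ∣ g ⟩ + ⟨ v ∣ g ⟩
  ⟨⟩-++ g []            v = sym (+-identityˡ _)
  ⟨⟩-++ g ((a , x) ∷ u) v = trans (+-congˡ (⟨⟩-++ g u v)) (sym (+-assoc _ _ _))

  ⟨⟩-scale : {X : Set} (g : X → Carrier) (a : Carrier) (u : Lin X) → ⟨ scale a u ∣ g ⟩ ≈ a * ⟨ u ∣ g ⟩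
  ⟨⟩-scale g a []            = sym (zeroʳ a)
  ⟨⟩-scale g a ((b , x) ∷ u) = begin
    (a * b) * g x + ⟨ scale a u ∣ g ⟩ ≈⟨ +-cong (*-assoc a b (g x)) (⟨⟩-scale g a u) ⟩
    a * (b * g x) + a * ⟨ u ∣ g ⟩     ≈⟨ distribˡ a _ _ ⟨
    a * (b * g x + ⟨ u ∣ g ⟩)         ∎

  ⟨⟩-ext : {X Y : Set} (g : Y → Carrier) (f : X → Lin Y) (u : Lin X) → ⟨ ext f u ∣ g ⟩ ≈ ⟨ u ∣ (λ x → ⟨ f x ∣ g ⟩) ⟩
  ⟨⟩-ext g f []            = refl
  ⟨⟩-ext g f ((a , x) ∷ u) = begin
    ⟨ scale a (f x) ++ ext f u ∣ g ⟩          ≈⟨ ⟨⟩-++ g (scale a (f x)) (ext f u) ⟩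
    ⟨ scale a (f x) ∣ g ⟩ + ⟨ ext f u ∣ g ⟩   ≈⟨ +-cong (⟨⟩-scale g a (f x)) (⟨⟩-ext g f u) ⟩
    a * ⟨ f x ∣ g ⟩ + ⟨ u ∣ (λ x → ⟨ f x ∣ g ⟩) ⟩ ∎

  ⟨⟩-mapLin : {X Y : Set} (g : Y → Carrier) (h : X → Y) (u : Lin X) → ⟨ mapLin h u ∣ g ⟩ ≡ ⟨ u ∣ g ∘ h ⟩
  ⟨⟩-mapLin g h []            = ≡.refl
  ⟨⟩-mapLin g h ((a , x) ∷ u) = cong (λ r → a * g (h x) + r) (⟨⟩-mapLin g h u)

  ⟨⟩-basis : {X : Set} (g : X → Carrier) (x : X) → ⟨ basis x ∣ g ⟩ ≈ g x
  ⟨⟩-basis g x = trans (+-identityʳ _) (*-identityˡ _)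

  ⟨⟩-cong : {X : Set} {g g′ : X → Carrier} (u : Lin X) → (∀ x → g x ≈ g′ x) → ⟨ u ∣ g ⟩ ≈ ⟨ u ∣ g′ ⟩
  ⟨⟩-cong []            e = refl
  ⟨⟩-cong ((a , x) ∷ u) e = +-cong (*-congˡ (e x)) (⟨⟩-cong u e)

  ⟨⟩-cong-local : {X : Set} {g g′ : X → Carrier} (u : Lin X) →
                  All (λ p → g (proj₂ p) ≈ g′ (proj₂ p)) u → ⟨ u ∣ g ⟩ ≈ ⟨ u ∣ g′ ⟩
  ⟨⟩-cong-local []            []       = refl
  ⟨⟩-cong-local ((a , x) ∷ u) (e ∷ es) = +-cong (*-congˡ e) (⟨⟩-cong-local u es)

  ⟨⟩-+ : {X : Set} (g h : X → Carrier) (u : Lin X) → ⟨ u ∣ (λ x → g x + h x) ⟩ ≈ ⟨ u ∣ g ⟩ + ⟨ u ∣ h ⟩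
  ⟨⟩-+ g h []            = sym (+-identityˡ _)
  ⟨⟩-+ g h ((a , x) ∷ u) = begin
    a * (g x + h x) + ⟨ u ∣ (λ x → g x + h x) ⟩   ≈⟨ +-cong (distribˡ a _ _) (⟨⟩-+ g h u) ⟩
    (a * g x + a * h x) + (⟨ u ∣ g ⟩ + ⟨ u ∣ h ⟩) ≈⟨ interchange _ _ _ _ ⟩
    (a * g x + ⟨ u ∣ g ⟩) + (a * h x + ⟨ u ∣ h ⟩) ∎

  ⟨⟩-* : {X : Set} (k : Carrier) (g : X → Carrier) (u : Lin X) → ⟨ u ∣ (λ x → k * g x) ⟩ ≈ k * ⟨ u ∣ g ⟩
  ⟨⟩-* k g []            = sym (zeroʳ k)
  ⟨⟩-* k g ((a , x) ∷ u) = begin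
    a * (k * g x) + ⟨ u ∣ (λ x → k * g x) ⟩ ≈⟨ +-cong (x∙yz≈y∙xz a k (g x)) (⟨⟩-* k g u) ⟩
    k * (a * g x) + k * ⟨ u ∣ g ⟩           ≈⟨ distribˡ k _ _ ⟨
    k * (a * g x + ⟨ u ∣ g ⟩)               ∎
    where open import Algebra.Properties.CommutativeSemigroup *-commutativeSemigroup using (x∙yz≈y∙xz)

  ⟨⟩-split₃ : {X : Set} (L : Lin X) (f₁ f₂ f₃ : X → Carrier) (k : Carrier) →
              ⟨ L ∣ (λ w → f₁ w + (f₂ w + k * f₃ w)) ⟩ ≈ ⟨ L ∣ f₁ ⟩ + (⟨ L ∣ f₂ ⟩ + k * ⟨ L ∣ f₃ ⟩)
  ⟨⟩-split₃ L f₁ f₂ f₃ k = trans (⟨⟩-+ f₁ _ L) (+-congˡ (trans (⟨⟩-+ f₂ _ L) (+-congˡ (⟨⟩-* k f₃ L))))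

  ⟨⟩-0 : {X : Set} (u : Lin X) → ⟨ u ∣ (λ _ → 0#) ⟩ ≈ 0#
  ⟨⟩-0 []            = refl
  ⟨⟩-0 ((a , x) ∷ u) = trans (+-cong (zeroʳ a) (⟨⟩-0 u)) (+-identityˡ 0#)

  ⟨⟩-tensor : {X Y : Set} (g : X × Y → Carrier) (u : Lin X) (v : Lin Y) →
              ⟨ tensor u v ∣ g ⟩ ≈ ⟨ u ∣ (λ x → ⟨ v ∣ (λ y → g (x , y)) ⟩) ⟩
  ⟨⟩-tensor g []            v = refl
  ⟨⟩-tensor g ((a , x) ∷ u) v = begin
    ⟨ row v ++ tensor u v ∣ g ⟩         ≈⟨ ⟨⟩-++ g (row v) (tensor u v) ⟩
    ⟨ row v ∣ g ⟩ + ⟨ tensor u v ∣ g ⟩  ≈⟨ +-cong (⟨row⟩ v) (⟨⟩-tensor g u v) ⟩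
    a * ⟨ v ∣ (λ y → g (x , y)) ⟩ + _   ∎
    where
    row = map (λ q → (a * proj₁ q , (x , proj₂ q)))
    ⟨row⟩ : (v : Lin _) → ⟨ row v ∣ g ⟩ ≈ a * ⟨ v ∣ (λ y → g (x , y)) ⟩
    ⟨row⟩ []            = sym (zeroʳ a)
    ⟨row⟩ ((b , y) ∷ v) = trans (+-cong (*-assoc a b _) (⟨row⟩ v)) (sym (distribˡ a _ _))

  ⟨⟩-swap : {X Y : Set} (g : X → Y → Carrier) (u : Lin X) (v : Lin Y) →
            ⟨ u ∣ (λ x → ⟨ v ∣ g x ⟩) ⟩ ≈ ⟨ v ∣ (λ y → ⟨ u ∣ (λ x → g x y) ⟩) ⟩
  ⟨⟩-swap g []            v = sym (⟨⟩-0 v)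
  ⟨⟩-swap g ((a , x) ∷ u) v = begin
    a * ⟨ v ∣ g x ⟩ + ⟨ u ∣ (λ x → ⟨ v ∣ g x ⟩) ⟩
      ≈⟨ +-cong (sym (⟨⟩-* a (g x) v)) (⟨⟩-swap g u v) ⟩
    ⟨ v ∣ (λ y → a * g x y) ⟩ + ⟨ v ∣ (λ y → ⟨ u ∣ (λ x → g x y) ⟩) ⟩ ≈⟨ ⟨⟩-+ _ _ v ⟨
    ⟨ v ∣ (λ y → a * g x y + ⟨ u ∣ (λ x → g x y) ⟩) ⟩               ∎

  ⟨⟩-ext2 : {X Y Z : Set} (f : X → Y → Lin Z) (u : Lin X) (v : Lin Y) (g : Z → Carrier) →
            ⟨ ext2 f u v ∣ g ⟩ ≈ ⟨ u ∣ (λ x → ⟨ v ∣ (λ y → ⟨ f x y ∣ g ⟩) ⟩) ⟩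
  ⟨⟩-ext2 f u v g = trans (⟨⟩-ext g (λ p → f (proj₁ p) (proj₂ p)) (tensor u v))
                          (⟨⟩-tensor (λ p → ⟨ f (proj₁ p) (proj₂ p) ∣ g ⟩) u v)

  ext-cong-local : {X Y : Set} {f g : X → Lin Y} (L : Lin X) → All (λ q → f (proj₂ q) ≡ g (proj₂ q)) L → ext f L ≡ ext g L
  ext-cong-local []            []       = ≡.refl
  ext-cong-local ((a , x) ∷ L) (e ∷ es) = cong₂ (λ u v → scale a u ++ v) e (ext-cong-local L es)

  ∑ : {A : Set} → List A → (A → Carrier) → Carrier
  ∑ []      h = 0#
  ∑ (x ∷ l) h = h x + ∑ l h

  ∑-cong-local : {A : Set} (l : List A) {h k : A → Carrier} → (∀ {x} → x ∈ l → h x ≈ k x) → ∑ l h ≈ ∑ l k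
  ∑-cong-local []      e = refl
  ∑-cong-local (x ∷ l) e = +-cong (e (here ≡.refl)) (∑-cong-local l (e ∘ there))

  ∑-0 : {A : Set} (l : List A) → ∑ l (λ _ → 0#) ≈ 0#
  ∑-0 []      = refl
  ∑-0 (_ ∷ l) = trans (+-identityˡ _) (∑-0 l)

  ∑-++ : {A : Set} (l l′ : List A) (h : A → Carrier) → ∑ (l ++ l′) h ≈ ∑ l h + ∑ l′ h
  ∑-++ []      l′ h = sym (+-identityˡ _)
  ∑-++ (x ∷ l) l′ h = trans (+-congˡ (∑-++ l l′ h)) (sym (+-assoc _ _ _))

  ∑-applyUpTo : ∀ (f g : ℕ → ℕ) n (h k : ℕ → Carrier) → (∀ i → h (f i) ≡ k (g i)) →
                ∑ (applyUpTo f n) h ≡ ∑ (applyUpTo g n) k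
  ∑-applyUpTo f g zero    h k e = ≡.refl
  ∑-applyUpTo f g (suc n) h k e = cong₂ _+_ (e 0) (∑-applyUpTo (f ∘ suc) (g ∘ suc) n h k (e ∘ suc))

  ⟨⟩-concatMap : {X A : Set} (f : A → Lin X) (l : List A) (g : X → Carrier) →
                 ⟨ concatMap f l ∣ g ⟩ ≈ ∑ l (λ p → ⟨ f p ∣ g ⟩)
  ⟨⟩-concatMap f []      g = refl
  ⟨⟩-concatMap f (x ∷ l) g = trans (⟨⟩-++ g (f x) (concatMap f l)) (+-congˡ (⟨⟩-concatMap f l g))

  x+-1*x≈0 : ∀ x → x + - 1# * x ≈ 0#
  x+-1*x≈0 x = trans (+-congˡ (-1*x≈-x x)) (-‿inverseʳ x)

  x+-1*y≈0⇒x≈y : ∀ {x y} → x + - 1# * y ≈ 0# → x ≈ y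
  x+-1*y≈0⇒x≈y {x} {y} e = x∙y⁻¹≈ε⇒x≈y x y (trans (+-congˡ (sym (-1*x≈-x y))) e)

  module _ {X : Set} (_≟X_ : DecidableEquality X) where

    indicator : X → X → Carrier
    indicator x y = if does (y ≟X x) then 1# else 0#

    coeff≈⟨indicator⟩ : (u : Lin X) (x : X) → coeff _≟X_ u x ≈ ⟨ u ∣ indicator x ⟩
    coeff≈⟨indicator⟩ []            x = refl
    coeff≈⟨indicator⟩ ((a , y) ∷ u) x with does (y ≟X x)
    ... | true  = +-cong (sym (*-identityʳ a)) (coeff≈⟨indicator⟩ u x)
    ... | false = +-cong (sym (zeroʳ a)) (coeff≈⟨indicator⟩ u x)

    ≋-intro : {u v : Lin X} → (∀ g → ⟨ u ∣ g ⟩ ≈ ⟨ v ∣ g ⟩) → _≋_ _≟X_ u v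
    ≋-intro {u} {v} p x = trans (coeff≈⟨indicator⟩ u x) (trans (p (indicator x)) (sym (coeff≈⟨indicator⟩ v x)))

module QuasiShuffle {c ℓ} (F : Field c ℓ) (λ' : Field.Carrier F) where
  open Field F
  open HSymDefs F
  open Pairing F
  open import Relation.Binary.Reasoning.Setoid setoid
  import Algebra.Solver.CommutativeMonoid +-commutativeMonoid as +-Solver
  open import Data.Fin using () renaming (zero to #0; suc to #s)
  open import Data.Vec using ([]; _∷_)

  infix 6 _⋆_
  _⋆_ : Word → Word → Lin Word
  _⋆_ = star λ'

  weight : ℤ → ℤ → Carrier
  weight a b = if isNeg a ∧ isNeg b then λ' else 0#

  ⋆-identityʳ : ∀ w → w ⋆ [] ≡ basis w
  ⋆-identityʳ []      = ≡.refl
  ⋆-identityʳ (_ ∷ _) = ≡.refl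

  ⟨⟩-prepend : ∀ a (L : Lin Word) g → ⟨ prepend a L ∣ g ⟩ ≈ ⟨ L ∣ g ∘ (a ∷_) ⟩
  ⟨⟩-prepend a L g = reflexive (⟨⟩-mapLin g (a ∷_) L)

  ⟨⟩-weighted : ∀ a b (L : Lin Word) g →
                ⟨ (if isNeg a ∧ isNeg b then scale λ' L else []) ∣ g ⟩ ≈ weight a b * ⟨ L ∣ g ⟩
  ⟨⟩-weighted a b L g with isNeg a ∧ isNeg b
  ... | true  = ⟨⟩-scale g λ' L
  ... | false = sym (zeroˡ _)

  ⟨⋆⟩-∷ : ∀ a u b v g → ⟨ (a ∷ u) ⋆ (b ∷ v) ∣ g ⟩ ≈
          ⟨ u ⋆ (b ∷ v) ∣ g ∘ (a ∷_) ⟩ + (⟨ (a ∷ u) ⋆ v ∣ g ∘ (b ∷_) ⟩ + weight a b * ⟨ u ⋆ v ∣ g ∘ (a ∷_) ⟩)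
  ⟨⋆⟩-∷ a u b v g = begin
    ⟨ prepend a (u ⋆ (b ∷ v)) ++ (prepend b ((a ∷ u) ⋆ v) ++ R) ∣ g ⟩
      ≈⟨ ⟨⟩-++ g (prepend a (u ⋆ (b ∷ v))) _ ⟩
    ⟨ prepend a (u ⋆ (b ∷ v)) ∣ g ⟩ + ⟨ prepend b ((a ∷ u) ⋆ v) ++ R ∣ g ⟩
      ≈⟨ +-congˡ (⟨⟩-++ g (prepend b ((a ∷ u) ⋆ v)) R) ⟩
    ⟨ prepend a (u ⋆ (b ∷ v)) ∣ g ⟩ + (⟨ prepend b ((a ∷ u) ⋆ v) ∣ g ⟩ + ⟨ R ∣ g ⟩)
      ≈⟨ +-cong (⟨⟩-prepend a (u ⋆ (b ∷ v)) g)
         (+-cong (⟨⟩-prepend b ((a ∷ u) ⋆ v) g)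
                 (trans (⟨⟩-weighted a b _ g) (*-congˡ (⟨⟩-prepend a (u ⋆ v) g)))) ⟩
    _ ∎
    where R = if isNeg a ∧ isNeg b then scale λ' (prepend a (u ⋆ v)) else []

  -- both bracketings of a triple product expand into seven terms, one for each way the
  -- first letters of x, y, z can contribute to the first letter of the result
  sum₇ : Carrier → Carrier → Carrier → Carrier → Carrier → Carrier → Carrier → Carrier
  sum₇ t₁ t₂ t₃ t₄ t₅ t₆ t₇ = t₁ + (t₂ + (t₃ + (t₄ + (t₅ + (t₆ + t₇)))))

  sum₇-cong : ∀ {a₁ a₂ a₃ a₄ a₅ a₆ a₇ b₁ b₂ b₃ b₄ b₅ b₆ b₇} →
    a₁ ≈ b₁ → a₂ ≈ b₂ → a₃ ≈ b₃ → a₄ ≈ b₄ → a₅ ≈ b₅ → a₆ ≈ b₆ → a₇ ≈ b₇ →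
    sum₇ a₁ a₂ a₃ a₄ a₅ a₆ a₇ ≈ sum₇ b₁ b₂ b₃ b₄ b₅ b₆ b₇
  sum₇-cong e₁ e₂ e₃ e₄ e₅ e₆ e₇ = +-cong e₁ (+-cong e₂ (+-cong e₃ (+-cong e₄ (+-cong e₅ (+-cong e₆ e₇)))))

  *-distribˡ-+₃ : ∀ w r₁ r₂ r₃ u → w * (r₁ + (r₂ + u * r₃)) ≈ w * r₁ + (w * r₂ + (w * u) * r₃)
  *-distribˡ-+₃ w r₁ r₂ r₃ u = trans (distribˡ w r₁ _) (+-congˡ (trans (distribˡ w r₂ _) (+-congˡ (sym (*-assoc w u r₃)))))

  regroupˡ : ∀ p₁ p₂ p₃ q₁ q₂ q₃ r₁ r₂ r₃ u v w →
    (p₁ + (p₂ + u * p₃)) + ((q₁ + (q₂ + v * q₃)) + w * (r₁ + (r₂ + u * r₃))) ≈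
    sum₇ p₁ q₁ (w * r₁) (p₂ + (q₂ + w * r₂)) (u * p₃) (v * q₃) ((w * u) * r₃)
  regroupˡ p₁ p₂ p₃ q₁ q₂ q₃ r₁ r₂ r₃ u v w = trans (+-congˡ (+-congˡ (*-distribˡ-+₃ w r₁ r₂ r₃ u)))
    (prove 9 ((P₁ ⊕ (P₂ ⊕ P₃)) ⊕ ((Q₁ ⊕ (Q₂ ⊕ Q₃)) ⊕ (R₁ ⊕ (R₂ ⊕ R₃))))
             (P₁ ⊕ (Q₁ ⊕ (R₁ ⊕ ((P₂ ⊕ (Q₂ ⊕ R₂)) ⊕ (P₃ ⊕ (Q₃ ⊕ R₃))))))
             (p₁ ∷ p₂ ∷ u * p₃ ∷ q₁ ∷ q₂ ∷ v * q₃ ∷ w * r₁ ∷ w * r₂ ∷ (w * u) * r₃ ∷ []))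
    where
    open +-Solver
    P₁ = var #0 ; P₂ = var (#s #0) ; P₃ = var (#s (#s #0))
    Q₁ = var (#s (#s (#s #0))) ; Q₂ = var (#s (#s (#s (#s #0)))) ; Q₃ = var (#s (#s (#s (#s (#s #0)))))
    R₁ = var (#s (#s (#s (#s (#s (#s #0)))))) ; R₂ = var (#s (#s (#s (#s (#s (#s (#s #0)))))))
    R₃ = var (#s (#s (#s (#s (#s (#s (#s (#s #0))))))))

  regroupʳ : ∀ p₁ p₂ p₃ q₁ q₂ q₃ r₁ r₂ r₃ u v w →
    (p₁ + (q₁ + u * r₁)) + ((p₂ + (q₂ + v * r₂)) + w * (p₃ + (q₃ + u * r₃))) ≈
    sum₇ (p₁ + (p₂ + w * p₃)) q₁ (u * r₁) q₂ (v * r₂) (w * q₃) ((w * u) * r₃)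
  regroupʳ p₁ p₂ p₃ q₁ q₂ q₃ r₁ r₂ r₃ u v w = trans (+-congˡ (+-congˡ (*-distribˡ-+₃ w p₃ q₃ r₃ u)))
    (prove 9 ((P₁ ⊕ (Q₁ ⊕ R₁)) ⊕ ((P₂ ⊕ (Q₂ ⊕ R₂)) ⊕ (P₃ ⊕ (Q₃ ⊕ R₃))))
             ((P₁ ⊕ (P₂ ⊕ P₃)) ⊕ (Q₁ ⊕ (R₁ ⊕ (Q₂ ⊕ (R₂ ⊕ (Q₃ ⊕ R₃))))))
             (p₁ ∷ q₁ ∷ u * r₁ ∷ p₂ ∷ q₂ ∷ v * r₂ ∷ w * p₃ ∷ w * q₃ ∷ (w * u) * r₃ ∷ []))
    where
    open +-Solver
    P₁ = var #0 ; Q₁ = var (#s #0) ; R₁ = var (#s (#s #0))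
    P₂ = var (#s (#s (#s #0))) ; Q₂ = var (#s (#s (#s (#s #0)))) ; R₂ = var (#s (#s (#s (#s (#s #0)))))
    P₃ = var (#s (#s (#s (#s (#s (#s #0)))))) ; Q₃ = var (#s (#s (#s (#s (#s (#s (#s #0)))))))
    R₃ = var (#s (#s (#s (#s (#s (#s (#s (#s #0))))))))

  -- λ² when a, b, c are all negative, 0 otherwise
  weight-triple : ∀ a b c → weight a b * weight a c ≈ weight b c * weight a b
  weight-triple a b c with isNeg a | isNeg b | isNeg c
  ... | true  | true  | true  = refl
  ... | true  | true  | false = *-comm _ _
  ... | true  | false | true  = trans (zeroˡ _) (sym (zeroˡ _))
  ... | true  | false | false = refl
  ... | false | true  | true  = trans (zeroˡ _) (sym (zeroʳ _))
  ... | false | true  | false = refl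
  ... | false | false | true  = refl
  ... | false | false | false = refl

  ⟨[⋆]⋆⟩ : Word → Word → Word → (Word → Carrier) → Carrier
  ⟨[⋆]⋆⟩ x y z g = ⟨ x ⋆ y ∣ (λ w → ⟨ w ⋆ z ∣ g ⟩) ⟩

  ⟨⋆[⋆]⟩ : Word → Word → Word → (Word → Carrier) → Carrier
  ⟨⋆[⋆]⟩ x y z g = ⟨ y ⋆ z ∣ (λ w → ⟨ x ⋆ w ∣ g ⟩) ⟩

  ⟨[⋆]⋆⟩-∷ : ∀ a x b y c z g → ⟨[⋆]⋆⟩ (a ∷ x) (b ∷ y) (c ∷ z) g ≈
    sum₇ (⟨[⋆]⋆⟩ x (b ∷ y) (c ∷ z) (g ∘ (a ∷_))) (⟨[⋆]⋆⟩ (a ∷ x) y (c ∷ z) (g ∘ (b ∷_)))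
         (weight a b * ⟨[⋆]⋆⟩ x y (c ∷ z) (g ∘ (a ∷_))) (⟨[⋆]⋆⟩ (a ∷ x) (b ∷ y) z (g ∘ (c ∷_)))
         (weight a c * ⟨[⋆]⋆⟩ x (b ∷ y) z (g ∘ (a ∷_))) (weight b c * ⟨[⋆]⋆⟩ (a ∷ x) y z (g ∘ (b ∷_)))
         ((weight a b * weight a c) * ⟨[⋆]⋆⟩ x y z (g ∘ (a ∷_)))
  ⟨[⋆]⋆⟩-∷ a x b y c z g = begin
    ⟨[⋆]⋆⟩ (a ∷ x) (b ∷ y) (c ∷ z) g ≈⟨ ⟨⋆⟩-∷ a x b y h ⟩
    ⟨ x ⋆ (b ∷ y) ∣ h ∘ (a ∷_) ⟩ + (⟨ (a ∷ x) ⋆ y ∣ h ∘ (b ∷_) ⟩ + weight a b * ⟨ x ⋆ y ∣ h ∘ (a ∷_) ⟩)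
      ≈⟨ +-cong (expand a (x ⋆ (b ∷ y))) (+-cong (expand b ((a ∷ x) ⋆ y)) (*-congˡ (expand a (x ⋆ y)))) ⟩
    _ ≈⟨ regroupˡ _ _ _ _ _ _ _ _ _ _ _ _ ⟩
    sum₇ _ _ _ (⟨ x ⋆ (b ∷ y) ∣ h′ ∘ (a ∷_) ⟩ + (⟨ (a ∷ x) ⋆ y ∣ h′ ∘ (b ∷_) ⟩ + weight a b * ⟨ x ⋆ y ∣ h′ ∘ (a ∷_) ⟩)) _ _ _
      ≈⟨ sum₇-cong refl refl refl (sym (⟨⋆⟩-∷ a x b y h′)) refl refl refl ⟩
    _ ∎
    where
    h = λ w → ⟨ w ⋆ (c ∷ z) ∣ g ⟩
    h′ = λ w → ⟨ w ⋆ z ∣ g ∘ (c ∷_) ⟩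
    expand : ∀ d L → ⟨ L ∣ h ∘ (d ∷_) ⟩ ≈
      ⟨ L ∣ (λ w → ⟨ w ⋆ (c ∷ z) ∣ g ∘ (d ∷_) ⟩) ⟩ +
      (⟨ L ∣ (λ w → ⟨ (d ∷ w) ⋆ z ∣ g ∘ (c ∷_) ⟩) ⟩ + weight d c * ⟨ L ∣ (λ w → ⟨ w ⋆ z ∣ g ∘ (d ∷_) ⟩) ⟩)
    expand d L = trans (⟨⟩-cong L (λ w → ⟨⋆⟩-∷ d w c z g)) (⟨⟩-split₃ L _ _ _ _)

  ⟨⋆[⋆]⟩-∷ : ∀ a x b y c z g → ⟨⋆[⋆]⟩ (a ∷ x) (b ∷ y) (c ∷ z) g ≈
    sum₇ (⟨⋆[⋆]⟩ x (b ∷ y) (c ∷ z) (g ∘ (a ∷_))) (⟨⋆[⋆]⟩ (a ∷ x) y (c ∷ z) (g ∘ (b ∷_)))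
         (weight a b * ⟨⋆[⋆]⟩ x y (c ∷ z) (g ∘ (a ∷_))) (⟨⋆[⋆]⟩ (a ∷ x) (b ∷ y) z (g ∘ (c ∷_)))
         (weight a c * ⟨⋆[⋆]⟩ x (b ∷ y) z (g ∘ (a ∷_))) (weight b c * ⟨⋆[⋆]⟩ (a ∷ x) y z (g ∘ (b ∷_)))
         ((weight b c * weight a b) * ⟨⋆[⋆]⟩ x y z (g ∘ (a ∷_)))
  ⟨⋆[⋆]⟩-∷ a x b y c z g = begin
    ⟨⋆[⋆]⟩ (a ∷ x) (b ∷ y) (c ∷ z) g ≈⟨ ⟨⋆⟩-∷ b y c z k ⟩
    ⟨ y ⋆ (c ∷ z) ∣ k ∘ (b ∷_) ⟩ + (⟨ (b ∷ y) ⋆ z ∣ k ∘ (c ∷_) ⟩ + weight b c * ⟨ y ⋆ z ∣ k ∘ (b ∷_) ⟩)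
      ≈⟨ +-cong (expand b (y ⋆ (c ∷ z))) (+-cong (expand c ((b ∷ y) ⋆ z)) (*-congˡ (expand b (y ⋆ z)))) ⟩
    _ ≈⟨ regroupʳ _ _ _ _ _ _ _ _ _ _ _ _ ⟩
    sum₇ (⟨ y ⋆ (c ∷ z) ∣ k′ ∘ (b ∷_) ⟩ + (⟨ (b ∷ y) ⋆ z ∣ k′ ∘ (c ∷_) ⟩ + weight b c * ⟨ y ⋆ z ∣ k′ ∘ (b ∷_) ⟩)) _ _ _ _ _ _
      ≈⟨ sum₇-cong (sym (⟨⋆⟩-∷ b y c z k′)) refl refl refl refl refl refl ⟩
    _ ∎
    where
    k = λ w → ⟨ (a ∷ x) ⋆ w ∣ g ⟩
    k′ = λ w → ⟨ x ⋆ w ∣ g ∘ (a ∷_) ⟩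
    expand : ∀ d L → ⟨ L ∣ k ∘ (d ∷_) ⟩ ≈
      ⟨ L ∣ (λ w → ⟨ x ⋆ (d ∷ w) ∣ g ∘ (a ∷_) ⟩) ⟩ +
      (⟨ L ∣ (λ w → ⟨ (a ∷ x) ⋆ w ∣ g ∘ (d ∷_) ⟩) ⟩ + weight a d * ⟨ L ∣ (λ w → ⟨ x ⋆ w ∣ g ∘ (a ∷_) ⟩) ⟩)
    expand d L = trans (⟨⟩-cong L (λ w → ⟨⋆⟩-∷ a x d w g)) (⟨⟩-split₃ L _ _ _ _)

  ⋆-assoc : ∀ x y z g → ⟨[⋆]⋆⟩ x y z g ≈ ⟨⋆[⋆]⟩ x y z g
  ⋆-assoc [] y z g =
    trans (⟨⟩-basis (λ w → ⟨ w ⋆ z ∣ g ⟩) y) (sym (⟨⟩-cong (y ⋆ z) (⟨⟩-basis g)))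
  ⋆-assoc (a ∷ x) [] z g =
    trans (⟨⟩-basis (λ w → ⟨ w ⋆ z ∣ g ⟩) (a ∷ x)) (sym (⟨⟩-basis (λ w → ⟨ (a ∷ x) ⋆ w ∣ g ⟩) z))
  ⋆-assoc (a ∷ x) (b ∷ y) [] g = begin
    ⟨[⋆]⋆⟩ (a ∷ x) (b ∷ y) [] g
      ≈⟨ ⟨⟩-cong ((a ∷ x) ⋆ (b ∷ y)) (λ w → trans (reflexive (cong (extF g) (⋆-identityʳ w))) (⟨⟩-basis g w)) ⟩
    ⟨ (a ∷ x) ⋆ (b ∷ y) ∣ g ⟩   ≈⟨ ⟨⟩-basis (λ w → ⟨ (a ∷ x) ⋆ w ∣ g ⟩) (b ∷ y) ⟨
    ⟨⋆[⋆]⟩ (a ∷ x) (b ∷ y) [] g ∎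
  ⋆-assoc (a ∷ x) (b ∷ y) (c ∷ z) g = begin
    ⟨[⋆]⋆⟩ (a ∷ x) (b ∷ y) (c ∷ z) g ≈⟨ ⟨[⋆]⋆⟩-∷ a x b y c z g ⟩
    _ ≈⟨ sum₇-cong (⋆-assoc x (b ∷ y) (c ∷ z) _) (⋆-assoc (a ∷ x) y (c ∷ z) _) (*-congˡ (⋆-assoc x y (c ∷ z) _))
                   (⋆-assoc (a ∷ x) (b ∷ y) z _) (*-congˡ (⋆-assoc x (b ∷ y) z _)) (*-congˡ (⋆-assoc (a ∷ x) y z _))
                   (*-cong (weight-triple a b c) (⋆-assoc x y z _)) ⟩
    _ ≈⟨ ⟨⋆[⋆]⟩-∷ a x b y c z g ⟨
    ⟨⋆[⋆]⟩ (a ∷ x) (b ∷ y) (c ∷ z) g ∎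

module Deconcatenation {c ℓ} (F : Field c ℓ) (λ' : Field.Carrier F) where
  open Field F
  open HSymDefs F
  open Pairing F
  open QuasiShuffle F λ'
  open import Relation.Binary.Reasoning.Setoid setoid
  import Algebra.Solver.CommutativeMonoid +-commutativeMonoid as +-Solver
  open import Data.Fin using () renaming (zero to #0; suc to #s)
  open import Data.Vec using ([]; _∷_)

  consˡ : ℤ → Word × Word → Word × Word
  consˡ a (x , y) = (a ∷ x , y)

  deconcat : Word → Lin (Word × Word)
  deconcat []      = basis ([] , [])
  deconcat (a ∷ x) = basis ([] , a ∷ x) ++ mapLin (consˡ a) (deconcat x)

  ⟨deconcat⟩-∷ : ∀ a x h → ⟨ deconcat (a ∷ x) ∣ h ⟩ ≈ h ([] , a ∷ x) + ⟨ deconcat x ∣ h ∘ consˡ a ⟩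
  ⟨deconcat⟩-∷ a x h = trans (⟨⟩-++ h (basis ([] , a ∷ x)) (mapLin (consˡ a) (deconcat x)))
                            (+-cong (⟨⟩-basis h ([] , a ∷ x)) (reflexive (⟨⟩-mapLin h (consˡ a) (deconcat x))))

  ⟨basis⊗basis⟩ : ∀ x y (h : Word × Word → Carrier) →
                  ⟨ basis x ∣ (λ w₁ → ⟨ basis y ∣ (λ w₂ → h (w₁ , w₂)) ⟩) ⟩ ≈ h (x , y)
  ⟨basis⊗basis⟩ x y h = trans (⟨⟩-basis (λ w₁ → ⟨ basis y ∣ (λ w₂ → h (w₁ , w₂)) ⟩) x) (⟨⟩-basis (λ w₂ → h (x , w₂)) y)

  ⟨[Δ]Δ⟩ ⟨Δ[Δ]⟩ : Word → (Word × (Word × Word) → Carrier) → Carrier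
  ⟨[Δ]Δ⟩ w g = ⟨ deconcat w ∣ (λ p → ⟨ deconcat (proj₁ p) ∣ (λ q → g (proj₁ q , (proj₂ q , proj₂ p))) ⟩) ⟩
  ⟨Δ[Δ]⟩ w g = ⟨ deconcat w ∣ (λ p → ⟨ deconcat (proj₂ p) ∣ (λ q → g (proj₁ p , (proj₁ q , proj₂ q))) ⟩) ⟩

  deconcat-coassoc : ∀ w g → ⟨[Δ]Δ⟩ w g ≈ ⟨Δ[Δ]⟩ w g
  deconcat-coassoc []      g = refl
  deconcat-coassoc (a ∷ x) g = begin
    ⟨[Δ]Δ⟩ (a ∷ x) g
      ≈⟨ ⟨deconcat⟩-∷ a x _ ⟩
    ⟨ deconcat [] ∣ (λ q → g (proj₁ q , (proj₂ q , a ∷ x))) ⟩ +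
    ⟨ deconcat x ∣ (λ p → ⟨ deconcat (a ∷ proj₁ p) ∣ (λ q → g (proj₁ q , (proj₂ q , proj₂ p))) ⟩) ⟩
      ≈⟨ +-cong (⟨⟩-basis (λ q → g (proj₁ q , (proj₂ q , a ∷ x))) ([] , []))
                (trans (⟨⟩-cong (deconcat x) (λ p → ⟨deconcat⟩-∷ a (proj₁ p) _)) (⟨⟩-+ _ _ (deconcat x))) ⟩
    g ([] , ([] , a ∷ x)) + (⟨ deconcat x ∣ (λ p → g ([] , consˡ a p)) ⟩ + ⟨[Δ]Δ⟩ x g′)
      ≈⟨ +-assoc _ _ _ ⟨
    (g ([] , ([] , a ∷ x)) + ⟨ deconcat x ∣ (λ p → g ([] , consˡ a p)) ⟩) + ⟨[Δ]Δ⟩ x g′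
      ≈⟨ +-cong (sym (⟨deconcat⟩-∷ a x (λ q → g ([] , q)))) (deconcat-coassoc x g′) ⟩
    ⟨ deconcat (a ∷ x) ∣ (λ q → g ([] , q)) ⟩ + ⟨Δ[Δ]⟩ x g′
      ≈⟨ ⟨deconcat⟩-∷ a x _ ⟨
    ⟨Δ[Δ]⟩ (a ∷ x) g ∎
    where g′ = λ t → g (a ∷ proj₁ t , proj₂ t)

  ⟨⋆⊗⋆⟩ : (Word × Word → Carrier) → Word × Word → Word × Word → Carrier
  ⟨⋆⊗⋆⟩ h p q = ⟨ proj₁ p ⋆ proj₁ q ∣ (λ w₁ → ⟨ proj₂ p ⋆ proj₂ q ∣ (λ w₂ → h (w₁ , w₂)) ⟩) ⟩

  ⟨Δ[⋆]⟩ ⟨[Δ]⋆[Δ]⟩ : Word → Word → (Word × Word → Carrier) → Carrier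
  ⟨Δ[⋆]⟩ u v h = ⟨ u ⋆ v ∣ (λ w → ⟨ deconcat w ∣ h ⟩) ⟩
  ⟨[Δ]⋆[Δ]⟩ u v h = ⟨ deconcat u ∣ (λ p → ⟨ deconcat v ∣ ⟨⋆⊗⋆⟩ h p ⟩) ⟩

  ⟨Δ[⋆]⟩-∷ : ∀ a u b v h → ⟨Δ[⋆]⟩ (a ∷ u) (b ∷ v) h ≈
    ⟨ (a ∷ u) ⋆ (b ∷ v) ∣ (λ w → h ([] , w)) ⟩ +
    (⟨Δ[⋆]⟩ u (b ∷ v) (h ∘ consˡ a) + (⟨Δ[⋆]⟩ (a ∷ u) v (h ∘ consˡ b) + weight a b * ⟨Δ[⋆]⟩ u v (h ∘ consˡ a)))
  ⟨Δ[⋆]⟩-∷ a u b v h = begin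
    ⟨Δ[⋆]⟩ (a ∷ u) (b ∷ v) h ≈⟨ ⟨⋆⟩-∷ a u b v (λ w → ⟨ deconcat w ∣ h ⟩) ⟩
    _ ≈⟨ +-cong (expand a (u ⋆ (b ∷ v))) (+-cong (expand b ((a ∷ u) ⋆ v)) (*-congˡ (expand a (u ⋆ v)))) ⟩
    (p₁ + q₁) + ((p₂ + q₂) + weight a b * (p₃ + q₃))               ≈⟨ +-congˡ (+-congˡ (distribˡ _ p₃ q₃)) ⟩
    (p₁ + q₁) + ((p₂ + q₂) + (weight a b * p₃ + weight a b * q₃)) ≈⟨ regroup ⟩
    (p₁ + (p₂ + weight a b * p₃)) + (q₁ + (q₂ + weight a b * q₃))
      ≈⟨ +-congʳ (sym (⟨⋆⟩-∷ a u b v (λ w → h ([] , w)))) ⟩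
    _ ∎
    where
    expand : ∀ d L → ⟨ L ∣ (λ w → ⟨ deconcat (d ∷ w) ∣ h ⟩) ⟩ ≈
                     ⟨ L ∣ (λ w → h ([] , d ∷ w)) ⟩ + ⟨ L ∣ (λ w → ⟨ deconcat w ∣ h ∘ consˡ d ⟩) ⟩
    expand d L = trans (⟨⟩-cong L (λ w → ⟨deconcat⟩-∷ d w h)) (⟨⟩-+ _ _ L)
    p₁ = ⟨ u ⋆ (b ∷ v) ∣ (λ w → h ([] , a ∷ w)) ⟩
    q₁ = ⟨Δ[⋆]⟩ u (b ∷ v) (h ∘ consˡ a)
    p₂ = ⟨ (a ∷ u) ⋆ v ∣ (λ w → h ([] , b ∷ w)) ⟩
    q₂ = ⟨Δ[⋆]⟩ (a ∷ u) v (h ∘ consˡ b)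
    p₃ = ⟨ u ⋆ v ∣ (λ w → h ([] , a ∷ w)) ⟩
    q₃ = ⟨Δ[⋆]⟩ u v (h ∘ consˡ a)
    regroup = prove 6 ((P₁ ⊕ Q₁) ⊕ ((P₂ ⊕ Q₂) ⊕ (P₃ ⊕ Q₃))) ((P₁ ⊕ (P₂ ⊕ P₃)) ⊕ (Q₁ ⊕ (Q₂ ⊕ Q₃)))
                      (p₁ ∷ q₁ ∷ p₂ ∷ q₂ ∷ weight a b * p₃ ∷ weight a b * q₃ ∷ [])
      where
      open +-Solver
      P₁ = var #0 ; Q₁ = var (#s #0) ; P₂ = var (#s (#s #0))
      Q₂ = var (#s (#s (#s #0))) ; P₃ = var (#s (#s (#s (#s #0)))) ; Q₃ = var (#s (#s (#s (#s (#s #0)))))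

  ⟨[Δ]⋆[Δ]⟩-∷ : ∀ a u b v h → ⟨[Δ]⋆[Δ]⟩ (a ∷ u) (b ∷ v) h ≈
    ⟨ (a ∷ u) ⋆ (b ∷ v) ∣ (λ w → h ([] , w)) ⟩ +
    (⟨[Δ]⋆[Δ]⟩ u (b ∷ v) (h ∘ consˡ a) + (⟨[Δ]⋆[Δ]⟩ (a ∷ u) v (h ∘ consˡ b) + weight a b * ⟨[Δ]⋆[Δ]⟩ u v (h ∘ consˡ a)))
  ⟨[Δ]⋆[Δ]⟩-∷ a u b v h = begin
    ⟨[Δ]⋆[Δ]⟩ U V h                                 ≈⟨ ⟨deconcat⟩-∷ a u Φ ⟩
    Φ ([] , U) + ⟨ deconcat u ∣ Φ ∘ consˡ a ⟩          ≈⟨ +-cong first-empty first-nonempty ⟩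
    (T₀ + K₁) + (K₂ + (M₁ + (M₂ + weight a b * M₃)))   ≈⟨ regroup ⟩
    T₀ + ((K₂ + M₁) + ((K₁ + M₂) + weight a b * M₃))   ≈⟨ +-congˡ (+-cong (sym drop-a) (+-congʳ (sym drop-b))) ⟩
    _ ∎
    where
    U = a ∷ u
    V = b ∷ v
    Φ = λ p → ⟨ deconcat V ∣ ⟨⋆⊗⋆⟩ h p ⟩
    T₀ = ⟨ U ⋆ V ∣ (λ w → h ([] , w)) ⟩
    k₁ = λ (q : Word × Word) → ⟨ U ⋆ proj₂ q ∣ (λ w₂ → h (b ∷ proj₁ q , w₂)) ⟩
    K₁ = ⟨ deconcat v ∣ k₁ ⟩
    k₂ = λ (p : Word × Word) → ⟨ proj₂ p ⋆ V ∣ (λ w₂ → h (a ∷ proj₁ p , w₂)) ⟩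
    K₂ = ⟨ deconcat u ∣ k₂ ⟩
    G = λ (p q : Word × Word) (w₁ : Word) → ⟨ proj₂ p ⋆ proj₂ q ∣ (λ w₂ → h (w₁ , w₂)) ⟩
    m₁ = λ (p q : Word × Word) → ⟨ proj₁ p ⋆ (b ∷ proj₁ q) ∣ G p q ∘ (a ∷_) ⟩
    m₂ = λ (p q : Word × Word) → ⟨ (a ∷ proj₁ p) ⋆ proj₁ q ∣ G p q ∘ (b ∷_) ⟩
    m₃ = λ (p q : Word × Word) → ⟨ proj₁ p ⋆ proj₁ q ∣ G p q ∘ (a ∷_) ⟩
    M₁ = ⟨ deconcat u ∣ (λ p → ⟨ deconcat v ∣ m₁ p ⟩) ⟩
    M₂ = ⟨ deconcat u ∣ (λ p → ⟨ deconcat v ∣ m₂ p ⟩) ⟩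
    M₃ = ⟨ deconcat u ∣ (λ p → ⟨ deconcat v ∣ m₃ p ⟩) ⟩
    first-empty : Φ ([] , U) ≈ T₀ + K₁
    first-empty = trans (⟨deconcat⟩-∷ b v (⟨⋆⊗⋆⟩ h ([] , U)))
      (+-cong (⟨⟩-basis (λ w₁ → ⟨ U ⋆ V ∣ (λ w₂ → h (w₁ , w₂)) ⟩) [])
              (⟨⟩-cong (deconcat v) (λ q → ⟨⟩-basis (λ w₁ → ⟨ U ⋆ proj₂ q ∣ (λ w₂ → h (w₁ , w₂)) ⟩) (b ∷ proj₁ q))))
    first-nonempty-at : ∀ p → Φ (consˡ a p) ≈
      k₂ p + (⟨ deconcat v ∣ m₁ p ⟩ + (⟨ deconcat v ∣ m₂ p ⟩ + weight a b * ⟨ deconcat v ∣ m₃ p ⟩))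
    first-nonempty-at p = trans (⟨deconcat⟩-∷ b v (⟨⋆⊗⋆⟩ h (consˡ a p)))
      (+-cong (⟨⟩-basis (λ w₁ → ⟨ proj₂ p ⋆ V ∣ (λ w₂ → h (w₁ , w₂)) ⟩) (a ∷ proj₁ p))
              (trans (⟨⟩-cong (deconcat v) (λ q → ⟨⋆⟩-∷ a (proj₁ p) b (proj₁ q) (G p q)))
                     (⟨⟩-split₃ (deconcat v) (m₁ p) (m₂ p) (m₃ p) (weight a b))))
    first-nonempty : ⟨ deconcat u ∣ Φ ∘ consˡ a ⟩ ≈ K₂ + (M₁ + (M₂ + weight a b * M₃))
    first-nonempty = trans (⟨⟩-cong (deconcat u) first-nonempty-at)
      (trans (⟨⟩-+ k₂ _ (deconcat u)) (+-congˡ (⟨⟩-split₃ (deconcat u) _ _ _ (weight a b))))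
    drop-a : ⟨[Δ]⋆[Δ]⟩ u V (h ∘ consˡ a) ≈ K₂ + M₁
    drop-a = trans (⟨⟩-cong (deconcat u) (λ p → trans (⟨deconcat⟩-∷ b v (⟨⋆⊗⋆⟩ (h ∘ consˡ a) p))
                (+-congʳ (trans (reflexive (cong (λ L → ⟨ L ∣ (λ w₁ → ⟨ proj₂ p ⋆ V ∣ (λ w₂ → h (a ∷ w₁ , w₂)) ⟩) ⟩)
                                                  (⋆-identityʳ (proj₁ p))))
                                (⟨⟩-basis (λ w₁ → ⟨ proj₂ p ⋆ V ∣ (λ w₂ → h (a ∷ w₁ , w₂)) ⟩) (proj₁ p))))))
             (⟨⟩-+ k₂ (λ p → ⟨ deconcat v ∣ m₁ p ⟩) (deconcat u))
    drop-b : ⟨[Δ]⋆[Δ]⟩ U v (h ∘ consˡ b) ≈ K₁ + M₂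
    drop-b = trans (⟨deconcat⟩-∷ a u (λ p → ⟨ deconcat v ∣ ⟨⋆⊗⋆⟩ (h ∘ consˡ b) p ⟩))
      (+-congʳ (⟨⟩-cong (deconcat v) (λ q → ⟨⟩-basis (λ w₁ → ⟨ U ⋆ proj₂ q ∣ (λ w₂ → h (b ∷ w₁ , w₂)) ⟩) (proj₁ q))))
    regroup = prove 6 ((Z ⊕ X₁) ⊕ (X₂ ⊕ (Y₁ ⊕ (Y₂ ⊕ Y₃)))) (Z ⊕ ((X₂ ⊕ Y₁) ⊕ ((X₁ ⊕ Y₂) ⊕ Y₃)))
                      (T₀ ∷ K₁ ∷ K₂ ∷ M₁ ∷ M₂ ∷ weight a b * M₃ ∷ [])
      where
      open +-Solver
      Z = var #0 ; X₁ = var (#s #0) ; X₂ = var (#s (#s #0))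
      Y₁ = var (#s (#s (#s #0))) ; Y₂ = var (#s (#s (#s (#s #0)))) ; Y₃ = var (#s (#s (#s (#s (#s #0)))))

  deconcat-⋆ : ∀ u v h → ⟨Δ[⋆]⟩ u v h ≈ ⟨[Δ]⋆[Δ]⟩ u v h
  deconcat-⋆ [] v h = trans (⟨⟩-basis (λ w → ⟨ deconcat w ∣ h ⟩) v)
    (sym (trans (⟨⟩-basis (λ p → ⟨ deconcat v ∣ ⟨⋆⊗⋆⟩ h p ⟩) ([] , []))
                (⟨⟩-cong (deconcat v) (λ q → ⟨basis⊗basis⟩ (proj₁ q) (proj₂ q) h))))
  deconcat-⋆ (a ∷ u) [] h = trans (⟨⟩-basis (λ w → ⟨ deconcat w ∣ h ⟩) (a ∷ u))
    (sym (⟨⟩-cong (deconcat (a ∷ u)) (λ p → trans (⟨⟩-basis (⟨⋆⊗⋆⟩ h p) ([] , []))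
       (trans (reflexive (cong₂ (λ L₁ L₂ → ⟨ L₁ ∣ (λ w₁ → ⟨ L₂ ∣ (λ w₂ → h (w₁ , w₂)) ⟩) ⟩)
                                (⋆-identityʳ (proj₁ p)) (⋆-identityʳ (proj₂ p))))
              (⟨basis⊗basis⟩ (proj₁ p) (proj₂ p) h)))))
  deconcat-⋆ (a ∷ u) (b ∷ v) h = begin
    ⟨Δ[⋆]⟩ (a ∷ u) (b ∷ v) h ≈⟨ ⟨Δ[⋆]⟩-∷ a u b v h ⟩
    _ ≈⟨ +-congˡ (+-cong (deconcat-⋆ u (b ∷ v) _) (+-cong (deconcat-⋆ (a ∷ u) v _) (*-congˡ (deconcat-⋆ u v _)))) ⟩
    _ ≈⟨ ⟨[Δ]⋆[Δ]⟩-∷ a u b v h ⟨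
    ⟨[Δ]⋆[Δ]⟩ (a ∷ u) (b ∷ v) h ∎

  ⟨deconcat⟩-map : ∀ φ w h → ⟨ deconcat (map φ w) ∣ h ⟩ ≈ ⟨ deconcat w ∣ (λ p → h (map φ (proj₁ p) , map φ (proj₂ p))) ⟩
  ⟨deconcat⟩-map φ []      h = refl
  ⟨deconcat⟩-map φ (a ∷ x) h = begin
    ⟨ deconcat (φ a ∷ map φ x) ∣ h ⟩ ≈⟨ ⟨deconcat⟩-∷ (φ a) (map φ x) h ⟩
    _                                ≈⟨ +-congˡ (⟨deconcat⟩-map φ x _) ⟩
    _                                ≈⟨ ⟨deconcat⟩-∷ a x _ ⟨
    ⟨ deconcat (a ∷ x) ∣ (λ p → h (map φ (proj₁ p) , map φ (proj₂ p))) ⟩ ∎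

  deconcat-factors : ∀ w → AbsDistinct w →
    All (λ p → AbsDistinctOver w (proj₁ (proj₂ p)) × AbsDistinctOver w (proj₂ (proj₂ p))) (deconcat w)
  deconcat-factors []      []               = (([] , []) , ([] , [])) ∷ []
  deconcat-factors (a ∷ x) d@(fresh ∷ d-x) =
    (([] , []) , (d , All.tabulate id)) ∷ extend (deconcat x) (deconcat-factors x d-x)
    where
    Factors : Word → Carrier × (Word × Word) → Set
    Factors S p = AbsDistinctOver S (proj₁ (proj₂ p)) × AbsDistinctOver S (proj₂ (proj₂ p))
    extend : ∀ L → All (Factors x) L → All (Factors (a ∷ x)) (mapLin (consˡ a) L)
    extend []      []                         = []
    extend (_ ∷ L) ((left , (d₂ , ⊆₂)) ∷ fs) =
      (∷-absDistinctOver there (here ≡.refl) fresh left , (d₂ , All.map there ⊆₂)) ∷ extend L fs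

module StandardizedProducts {c ℓ} (F : Field c ℓ) (λ' : Field.Carrier F) where
  open Field F
  open HSymDefs F
  open Pairing F
  open QuasiShuffle F λ'
  open import Relation.Binary.Reasoning.Setoid setoid

  ⟨⋆⟩-map : ∀ φ → (∀ x → isNeg (φ x) ≡ isNeg x) → ∀ u v g → ⟨ map φ u ⋆ map φ v ∣ g ⟩ ≈ ⟨ u ⋆ v ∣ g ∘ map φ ⟩
  ⟨⋆⟩-map φ sign []      v       g = refl
  ⟨⋆⟩-map φ sign (a ∷ u) []      g = refl
  ⟨⋆⟩-map φ sign (a ∷ u) (b ∷ v) g = begin
    ⟨ (φ a ∷ map φ u) ⋆ (φ b ∷ map φ v) ∣ g ⟩
      ≈⟨ ⟨⋆⟩-∷ (φ a) (map φ u) (φ b) (map φ v) g ⟩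
    _ ≈⟨ +-cong (⟨⋆⟩-map φ sign u (b ∷ v) _) (+-cong (⟨⋆⟩-map φ sign (a ∷ u) v _)
                (*-cong (reflexive (cong₂ (λ s t → if s ∧ t then λ' else 0#) (sign a) (sign b))) (⟨⋆⟩-map φ sign u v _))) ⟩
    _ ≈⟨ ⟨⋆⟩-∷ a u b v (g ∘ map φ) ⟨
    ⟨ (a ∷ u) ⋆ (b ∷ v) ∣ g ∘ map φ ⟩ ∎

  ⋆-words : ∀ u v → AbsDistinct (u ++ v) → All (λ p → AbsDistinctOver (u ++ v) (proj₂ p)) (u ⋆ v)
  ⋆-words []      v       d = (d , All.tabulate id) ∷ []
  ⋆-words (a ∷ u) []      d rewrite Listₚ.++-identityʳ u = (d , All.tabulate id) ∷ []
  ⋆-words (a ∷ u) (b ∷ v) d@(a-fresh ∷ d-tail) =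
    Allₚ.++⁺ (Allₚ.map⁺ (All.map (∷-absDistinctOver there (here ≡.refl) a-fresh) (⋆-words u (b ∷ v) d-tail)))
    (Allₚ.++⁺ (Allₚ.map⁺ (All.map (∷-absDistinctOver (∈-insert⁺ (a ∷ u)) (∈-++⁺ʳ (a ∷ u) (here ≡.refl)) b-fresh)
                                  (⋆-words (a ∷ u) v d-without-b)))
              weighted)
    where
    d-without-b = proj₁ (absDistinct-remove (a ∷ u) d)
    b-fresh = proj₂ (absDistinct-remove (a ∷ u) d)
    weighted : All (λ p → AbsDistinctOver ((a ∷ u) ++ b ∷ v) (proj₂ p))
                   (if isNeg a ∧ isNeg b then scale λ' (prepend a (u ⋆ v)) else [])
    weighted with isNeg a ∧ isNeg b
    ... | true  = Allₚ.map⁺ (Allₚ.map⁺ (All.map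
                    (∷-absDistinctOver (there ∘ ∈-insert⁺ u) (here ≡.refl) (proj₁ (All-remove u a-fresh)))
                    (⋆-words u v (proj₁ (absDistinct-remove u d-tail)))))
    ... | false = []

  st* : (SPerm → Carrier) → Word → Carrier
  st* g w = ⟨ asBasis (stWord w) ∣ g ⟩

  st*-map : ∀ φ g → (∀ x → isNeg (φ x) ≡ isNeg x) → ∀ {w} → OrderEmbeddingOn φ w → st* g (map φ w) ≈ st* g w
  st*-map φ g sign {w} emb = reflexive (cong (λ z → ⟨ asBasis z ∣ g ⟩) (stWord-map φ sign w emb))

  ⟨⋆⟩-separated : ∀ u v → AbsDistinct u → AbsDistinct v → Separated u v → ∀ g →
                  ⟨ u ⋆ v ∣ st* g ⟩ ≈ ⟨ stWord u ⋆ shift (length u) (stWord v) ∣ st* g ⟩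
  ⟨⋆⟩-separated u v du dv sep g = begin
    ⟨ u ⋆ v ∣ st* g ⟩
      ≈⟨ ⟨⟩-cong-local (u ⋆ v) (All.map (λ (_ , w⊆) → sym
          (st*-map relabel g isNeg-relabel (OrderEmbeddingOn-⊆ {relabel} relabel-embedding w⊆)))
                                        (⋆-words u v (absDistinct-++ du dv sep))) ⟩
    ⟨ u ⋆ v ∣ st* g ∘ map relabel ⟩                              ≈⟨ ⟨⋆⟩-map relabel isNeg-relabel u v (st* g) ⟨
    ⟨ map relabel u ⋆ map relabel v ∣ st* g ⟩
      ≡⟨ cong₂ (λ x y → ⟨ x ⋆ y ∣ st* g ⟩) map-relabel-left map-relabel-right ⟩
    ⟨ stWord u ⋆ shift (length u) (stWord v) ∣ st* g ⟩           ∎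
    where open SeparatedStandardization u v du dv sep

module HSymOnBasis {c ℓ} (F : Field c ℓ) (λ' : Field.Carrier F) where
  open Field F
  open HSymDefs F
  open Pairing F
  open QuasiShuffle F λ'
  open Deconcatenation F λ'
  open StandardizedProducts F λ'
  open import Relation.Binary.Reasoning.Setoid setoid

  infix 6 _⊙_
  _⊙_ : SPerm → SPerm → Lin SPerm
  _⊙_ = starBar λ'

  ⟨asBasis⟩ : ∀ w (p : T (isSPerm w)) g → ⟨ asBasis w ∣ g ⟩ ≈ g (sp w p)
  ⟨asBasis⟩ w p g with T? (isSPerm w)
  ... | yes p′ = ⟨⟩-basis g (sp w p′)
  ... | no ¬p  = ⊥-elim (¬p p)

  st*-absDistinct : ∀ w (d : AbsDistinct w) g → st* g w ≈ g (stSPerm w d)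
  st*-absDistinct w d g = ⟨asBasis⟩ (stWord w) (stWord-isSPerm w d) g

  st*-word : ∀ σ g → st* g (word σ) ≈ g σ
  st*-word σ g = trans (reflexive (cong (λ z → ⟨ asBasis z ∣ g ⟩) (SPerm-properties.stWord-id σ)))
                       (⟨asBasis⟩ (word σ) (isSPerm-word σ) g)

  ⟨⊙⟩ : ∀ σ τ g → ⟨ σ ⊙ τ ∣ g ⟩ ≈ ⟨ word σ ⋆ shift (size σ) (word τ) ∣ st* g ⟩
  ⟨⊙⟩ σ τ g = ⟨⟩-ext g (λ w → asBasis (stWord w)) (word σ ⋆ shift (size σ) (word τ))

  ⊙-identityˡ : ∀ τ g → ⟨ ι ⊙ τ ∣ g ⟩ ≈ g τ
  ⊙-identityˡ τ g = begin
    ⟨ ι ⊙ τ ∣ g ⟩                      ≈⟨ ⟨⊙⟩ ι τ g ⟩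
    ⟨ [] ⋆ shift 0 (word τ) ∣ st* g ⟩  ≈⟨ ⟨⟩-basis (st* g) (shift 0 (word τ)) ⟩
    st* g (shift 0 (word τ))           ≡⟨ cong (λ z → ⟨ asBasis z ∣ g ⟩) (stWord-shift 0 (word τ)) ⟩
    st* g (word τ)                     ≈⟨ st*-word τ g ⟩
    g τ                                ∎

  ⊙-identityʳ : ∀ σ g → ⟨ σ ⊙ ι ∣ g ⟩ ≈ g σ
  ⊙-identityʳ σ g = begin
    ⟨ σ ⊙ ι ∣ g ⟩               ≈⟨ ⟨⊙⟩ σ ι g ⟩
    ⟨ word σ ⋆ [] ∣ st* g ⟩     ≡⟨ cong (λ L → ⟨ L ∣ st* g ⟩) (⋆-identityʳ (word σ)) ⟩
    ⟨ basis (word σ) ∣ st* g ⟩  ≈⟨ ⟨⟩-basis (st* g) (word σ) ⟩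
    st* g (word σ)              ≈⟨ st*-word σ g ⟩
    g σ                         ∎

  st*² : (SPerm × SPerm → Carrier) → Word × Word → Carrier
  st*² g q = st* (λ σ → st* (λ τ → g (σ , τ)) (proj₂ q)) (proj₁ q)

  st*²-absDistinct : ∀ (q : Word × Word) (d₁ : AbsDistinct (proj₁ q)) (d₂ : AbsDistinct (proj₂ q)) g →
                     st*² g q ≈ g (stSPerm (proj₁ q) d₁ , stSPerm (proj₂ q) d₂)
  st*²-absDistinct q d₁ d₂ g = trans (st*-absDistinct (proj₁ q) d₁ _) (st*-absDistinct (proj₂ q) d₂ _)

  st*²-map : ∀ φ g → (∀ x → isNeg (φ x) ≡ isNeg x) → ∀ {x y} → OrderEmbeddingOn φ x → OrderEmbeddingOn φ y →
             st*² g (map φ x , map φ y) ≈ st*² g (x , y)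
  st*²-map φ g sign {x} {y} ex ey = reflexive (cong₂ (λ s t → ⟨ asBasis s ∣ (λ σ → ⟨ asBasis t ∣ (λ τ → g (σ , τ)) ⟩) ⟩)
                                                     (stWord-map φ sign x ex) (stWord-map φ sign y ey))

  ∑-splittings : ∀ w G → ∑ (upTo (suc (length w))) (λ p → G (take p w , drop p w)) ≈ ⟨ deconcat w ∣ G ⟩
  ∑-splittings []      G = +-congʳ (sym (*-identityˡ _))
  ∑-splittings (a ∷ x) G = trans
    (+-congˡ (trans (reflexive (∑-applyUpTo suc id (suc (length x)) _ _ (λ _ → ≡.refl))) (∑-splittings x (G ∘ consˡ a))))
    (sym (⟨deconcat⟩-∷ a x G))

  ⟨coprod⟩ : ∀ σ g → ⟨ coprod σ ∣ g ⟩ ≈ ⟨ deconcat (word σ) ∣ st*² g ⟩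
  ⟨coprod⟩ σ g = begin
    ⟨ coprod σ ∣ g ⟩
      ≈⟨ ⟨⟩-concatMap (λ p → tensor (left p) (right p)) (upTo (suc (size σ))) g ⟩
    ∑ (upTo (suc (size σ))) (λ p → ⟨ tensor (left p) (right p) ∣ g ⟩)
      ≈⟨ ∑-cong-local (upTo (suc (size σ))) (λ {p} _ → ⟨⟩-tensor g (left p) (right p)) ⟩
    ∑ (upTo (suc (size σ))) (λ p → st*² g (take p (word σ) , drop p (word σ)))
      ≈⟨ ∑-splittings (word σ) (st*² g) ⟩
    ⟨ deconcat (word σ) ∣ st*² g ⟩ ∎
    where
    left = λ p → asBasis (stWord (take p (word σ)))
    right = λ p → asBasis (stWord (drop p (word σ)))

  ⟨coprod-stSPerm⟩ : ∀ w d g → ⟨ coprod (stSPerm w d) ∣ g ⟩ ≈ ⟨ deconcat w ∣ st*² g ⟩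
  ⟨coprod-stSPerm⟩ w d g = begin
    ⟨ coprod (stSPerm w d) ∣ g ⟩                   ≈⟨ ⟨coprod⟩ (stSPerm w d) g ⟩
    ⟨ deconcat (stWord w) ∣ st*² g ⟩
      ≡⟨ cong (λ v → ⟨ deconcat v ∣ st*² g ⟩) (stWord-absDistinct w d) ⟩
    ⟨ deconcat (map (stLetter w) w) ∣ st*² g ⟩     ≈⟨ ⟨deconcat⟩-map (stLetter w) w (st*² g) ⟩
    ⟨ deconcat w ∣ (λ p → st*² g (map (stLetter w) (proj₁ p) , map (stLetter w) (proj₂ p))) ⟩
      ≈⟨ ⟨⟩-cong-local (deconcat w) (All.map (λ ((_ , ⊆₁) , (_ , ⊆₂)) → st*²-map (stLetter w) g (λ x → isNeg-signedSuc x _)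
                                                   (OrderEmbeddingOn-⊆ {stLetter w} (stLetter-embedding w) ⊆₁)
                                                   (OrderEmbeddingOn-⊆ {stLetter w} (stLetter-embedding w) ⊆₂))
                                             (deconcat-factors w d)) ⟩
    ⟨ deconcat w ∣ st*² g ⟩ ∎

  st*-counit-[] : st* counitB [] ≈ 1#
  st*-counit-[] = ⟨⟩-basis counitB ι

  st*-counit-∷ : ∀ a x → st* counitB (a ∷ x) ≈ 0#
  st*-counit-∷ a x = nonempty (stLetterIn e (0 , a)) (map (stLetterIn e) (zip (applyUpTo suc (length x)) x))
    where
    e = enumerate (a ∷ x)
    nonempty : ∀ l ls → ⟨ asBasis (l ∷ ls) ∣ counitB ⟩ ≈ 0#
    nonempty l ls with T? (isSPerm (l ∷ ls))
    ... | yes _ = trans (+-identityʳ _) (zeroʳ 1#)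
    ... | no _  = refl

  st*-*ˡ : ∀ (h : SPerm → Carrier) k w → st* (λ y → k * h y) w ≈ k * st* h w
  st*-*ˡ h k w = ⟨⟩-* k h (asBasis (stWord w))

  st*-*ʳ : ∀ (h : SPerm → Carrier) k w → st* (λ y → h y * k) w ≈ st* h w * k
  st*-*ʳ h k w = trans (⟨⟩-cong (asBasis (stWord w)) (λ y → *-comm (h y) k)) (trans (st*-*ˡ h k w) (*-comm k _))

  ⟨deconcat⟩-counitʳ : ∀ w (k : Word → Carrier) → ⟨ deconcat w ∣ (λ q → st* counitB (proj₂ q) * k (proj₁ q)) ⟩ ≈ k w
  ⟨deconcat⟩-counitʳ []      k = trans (+-identityʳ _) (trans (*-identityˡ _) (trans (*-congʳ st*-counit-[]) (*-identityˡ _)))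
  ⟨deconcat⟩-counitʳ (a ∷ x) k = trans (⟨deconcat⟩-∷ a x _)
    (trans (+-cong (trans (*-congʳ (st*-counit-∷ a x)) (zeroˡ _)) (⟨deconcat⟩-counitʳ x (k ∘ (a ∷_)))) (+-identityˡ _))

  ⟨deconcat⟩-counitˡ : ∀ w (k : Word → Carrier) → ⟨ deconcat w ∣ (λ q → st* counitB (proj₁ q) * k (proj₂ q)) ⟩ ≈ k w
  ⟨deconcat⟩-counitˡ []      k = trans (+-identityʳ _) (trans (*-identityˡ _) (trans (*-congʳ st*-counit-[]) (*-identityˡ _)))
  ⟨deconcat⟩-counitˡ (a ∷ x) k = trans (⟨deconcat⟩-∷ a x _)
    (trans (+-cong (trans (*-congʳ st*-counit-[]) (*-identityˡ _))
                   (trans (⟨⟩-cong (deconcat x) (λ q → trans (*-congʳ (st*-counit-∷ a (proj₁ q)))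
                       (zeroˡ _))) (⟨⟩-0 (deconcat x))))
           (+-identityʳ _))

  coprod-counitʳ : ∀ σ (h : SPerm → Carrier) → ⟨ coprod σ ∣ (λ p → counitB (proj₂ p) * h (proj₁ p)) ⟩ ≈ h σ
  coprod-counitʳ σ h = begin
    ⟨ coprod σ ∣ (λ p → counitB (proj₂ p) * h (proj₁ p)) ⟩ ≈⟨ ⟨coprod⟩ σ _ ⟩
    ⟨ deconcat (word σ) ∣ st*² (λ p → counitB (proj₂ p) * h (proj₁ p)) ⟩
      ≈⟨ ⟨⟩-cong (deconcat (word σ)) (λ q → trans (⟨⟩-cong (asBasis (stWord (proj₁ q))) (λ x → st*-*ʳ counitB (h x) (proj₂ q)))
                                                 (st*-*ˡ h _ (proj₁ q))) ⟩
    ⟨ deconcat (word σ) ∣ (λ q → st* counitB (proj₂ q) * st* h (proj₁ q)) ⟩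
      ≈⟨ ⟨deconcat⟩-counitʳ (word σ) (st* h) ⟩
    st* h (word σ) ≈⟨ st*-word σ h ⟩
    h σ ∎

  coprod-counitˡ : ∀ σ (h : SPerm → Carrier) → ⟨ coprod σ ∣ (λ p → counitB (proj₁ p) * h (proj₂ p)) ⟩ ≈ h σ
  coprod-counitˡ σ h = begin
    ⟨ coprod σ ∣ (λ p → counitB (proj₁ p) * h (proj₂ p)) ⟩ ≈⟨ ⟨coprod⟩ σ _ ⟩
    ⟨ deconcat (word σ) ∣ st*² (λ p → counitB (proj₁ p) * h (proj₂ p)) ⟩
      ≈⟨ ⟨⟩-cong (deconcat (word σ)) (λ q → trans (⟨⟩-cong (asBasis (stWord (proj₁ q))) (λ x → st*-*ˡ h (counitB x) (proj₂ q)))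
                                                 (st*-*ʳ counitB _ (proj₁ q))) ⟩
    ⟨ deconcat (word σ) ∣ (λ q → st* counitB (proj₁ q) * st* h (proj₂ q)) ⟩
      ≈⟨ ⟨deconcat⟩-counitˡ (word σ) (st* h) ⟩
    st* h (word σ) ≈⟨ st*-word σ h ⟩
    h σ ∎

  ⋆-nonempty : ∀ a x v → All (λ p → ∃ λ b → ∃ λ w → proj₂ p ≡ b ∷ w) ((a ∷ x) ⋆ v)
  ⋆-nonempty a x []      = (a , x , ≡.refl) ∷ []
  ⋆-nonempty a x (b ∷ v) =
    Allₚ.++⁺ (Allₚ.map⁺ (All.universal (λ p → a , proj₂ p , ≡.refl) (x ⋆ (b ∷ v))))
    (Allₚ.++⁺ (Allₚ.map⁺ (All.universal (λ p → b , proj₂ p , ≡.refl) ((a ∷ x) ⋆ v))) weighted)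
    where
    weighted : All (λ p → ∃ λ b → ∃ λ w → proj₂ p ≡ b ∷ w) (if isNeg a ∧ isNeg b then scale λ' (prepend a (x ⋆ v)) else [])
    weighted with isNeg a ∧ isNeg b
    ... | true  = Allₚ.map⁺ (Allₚ.map⁺ (All.universal (λ p → a , proj₂ p , ≡.refl) (x ⋆ v)))
    ... | false = []

  counit-⊙ : ∀ σ τ → ⟨ σ ⊙ τ ∣ counitB ⟩ ≈ counitB σ * counitB τ
  counit-⊙ (sp [] _) (sp [] _) =
    trans (⟨⊙⟩ ι ι counitB) (trans (⟨⟩-basis (st* counitB) []) (trans st*-counit-[] (sym (*-identityˡ 1#))))
  counit-⊙ (sp [] _) τ@(sp (b ∷ y) _) =
    trans (⟨⊙⟩ ι τ counitB) (trans (⟨⟩-basis (st* counitB) (shift 0 (b ∷ y)))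
          (trans (st*-counit-∷ (shiftL 0 b) (shift 0 y)) (sym (zeroʳ 1#))))
  counit-⊙ σ@(sp (a ∷ x) _) τ = begin
    ⟨ σ ⊙ τ ∣ counitB ⟩                ≈⟨ ⟨⊙⟩ σ τ counitB ⟩
    ⟨ (a ∷ x) ⋆ τm ∣ st* counitB ⟩
      ≈⟨ ⟨⟩-cong-local ((a ∷ x) ⋆ τm) (All.map (λ { (b , w , ≡.refl) → st*-counit-∷ b w }) (⋆-nonempty a x τm)) ⟩
    ⟨ (a ∷ x) ⋆ τm ∣ (λ _ → 0#) ⟩      ≈⟨ ⟨⟩-0 ((a ∷ x) ⋆ τm) ⟩
    0#                                 ≈⟨ zeroˡ (counitB τ) ⟨
    0# * counitB τ                     ∎
    where τm = shift (suc (length x)) (word τ)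

  coprod-ι : ∀ g → ⟨ coprod ι ∣ g ⟩ ≈ g (ι , ι)
  coprod-ι g = trans (⟨coprod⟩ ι g) (trans (⟨⟩-basis (st*² g) ([] , [])) (st*²-absDistinct ([] , []) [] [] g))

  ⟨⊙⟩-separated : ∀ K {u v} (du : AbsDistinct u) (dv : AbsDistinct v) →
                  All (λ a → ∣ a ∣ ≤ K) u → All (λ b → 0 < ∣ b ∣) v → ∀ h →
                  ⟨ stSPerm u du ⊙ stSPerm v dv ∣ h ⟩ ≈ ⟨ u ⋆ shift K v ∣ st* h ⟩
  ⟨⊙⟩-separated K {u} {v} du dv u≤K v⁺ h = begin
    ⟨ stSPerm u du ⊙ stSPerm v dv ∣ h ⟩
      ≈⟨ ⟨⊙⟩ (stSPerm u du) (stSPerm v dv) h ⟩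
    ⟨ stWord u ⋆ shift (length (stWord u)) (stWord v) ∣ st* h ⟩
      ≡⟨ cong₂ (λ k z → ⟨ stWord u ⋆ shift k z ∣ st* h ⟩) (length-stWord u) (≡.sym (stWord-shift K v)) ⟩
    ⟨ stWord u ⋆ shift (length u) (stWord (shift K v)) ∣ st* h ⟩
      ≈⟨ ⟨⋆⟩-separated u (shift K v) du (absDistinct-shift K dv) (separated-by K u≤K (shift-above K v⁺)) h ⟨
    ⟨ u ⋆ shift K v ∣ st* h ⟩
      ∎

  st*-⊙ʳ : ∀ K ρ g {w} → AbsDistinct w → All (λ a → ∣ a ∣ ≤ K) w →
           st* (λ t → ⟨ t ⊙ ρ ∣ g ⟩) w ≈ ⟨ w ⋆ shift K (word ρ) ∣ st* g ⟩
  st*-⊙ʳ K ρ g {w} dw w≤K = begin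
    st* (λ t → ⟨ t ⊙ ρ ∣ g ⟩) w                          ≈⟨ st*-absDistinct w dw _ ⟩
    ⟨ stSPerm w dw ⊙ ρ ∣ g ⟩                             ≡⟨ cong (λ r → ⟨ stSPerm w dw ⊙ r ∣ g ⟩) (stSPerm-word ρ) ⟨
    ⟨ stSPerm w dw ⊙ stSPerm (word ρ) Pρ.absDistinct ∣ g ⟩ ≈⟨ ⟨⊙⟩-separated K dw Pρ.absDistinct w≤K Pρ.abs-positive g ⟩
    ⟨ w ⋆ shift K (word ρ) ∣ st* g ⟩                      ∎
    where module Pρ = SPerm-properties ρ

  st*-⊙ˡ : ∀ σ g {w} → AbsDistinct w → All (λ b → 0 < ∣ b ∣) w →
           st* (λ t → ⟨ σ ⊙ t ∣ g ⟩) w ≈ ⟨ word σ ⋆ shift (size σ) w ∣ st* g ⟩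
  st*-⊙ˡ σ g {w} dw w⁺ = begin
    st* (λ t → ⟨ σ ⊙ t ∣ g ⟩) w                          ≈⟨ st*-absDistinct w dw _ ⟩
    ⟨ σ ⊙ stSPerm w dw ∣ g ⟩                             ≡⟨ cong (λ s → ⟨ s ⊙ stSPerm w dw ∣ g ⟩) (stSPerm-word σ) ⟨
    ⟨ stSPerm (word σ) Pσ.absDistinct ⊙ stSPerm w dw ∣ g ⟩ ≈⟨ ⟨⊙⟩-separated (size σ) Pσ.absDistinct dw Pσ.abs-bounded w⁺ g ⟩
    ⟨ word σ ⋆ shift (size σ) w ∣ st* g ⟩                 ∎
    where module Pσ = SPerm-properties σ

  ⊙-assoc : ∀ σ τ ρ g → ⟨ σ ⊙ τ ∣ (λ t → ⟨ t ⊙ ρ ∣ g ⟩) ⟩ ≈ ⟨ τ ⊙ ρ ∣ (λ t → ⟨ σ ⊙ t ∣ g ⟩) ⟩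
  ⊙-assoc σ τ ρ g = begin
    ⟨ σ ⊙ τ ∣ (λ t → ⟨ t ⊙ ρ ∣ g ⟩) ⟩
      ≈⟨ ⟨⊙⟩ σ τ _ ⟩
    ⟨ σw ⋆ τm ∣ st* (λ t → ⟨ t ⊙ ρ ∣ g ⟩) ⟩
      ≈⟨ ⟨⟩-cong-local (σw ⋆ τm) (All.map (λ (dw , w⊆) → st*-⊙ʳ (m +ℕ n) ρ g dw (All.map (All.lookup στ-bounded) w⊆))
                                          (⋆-words σw τm dστ)) ⟩
    ⟨[⋆]⋆⟩ σw τm (shift (m +ℕ n) ρw) (st* g)
      ≈⟨ ⋆-assoc σw τm (shift (m +ℕ n) ρw) (st* g) ⟩
    ⟨⋆[⋆]⟩ σw τm (shift (m +ℕ n) ρw) (st* g)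
      ≡⟨ cong (λ r → ⟨ τm ⋆ r ∣ (λ w → ⟨ σw ⋆ w ∣ st* g ⟩) ⟩) (shift-shift m n ρw) ⟨
    ⟨ shift m τw ⋆ shift m ρn ∣ (λ w → ⟨ σw ⋆ w ∣ st* g ⟩) ⟩
      ≈⟨ ⟨⋆⟩-map (shiftL m) (isNeg-shiftL m) τw ρn _ ⟩
    ⟨ τw ⋆ ρn ∣ (λ w → ⟨ σw ⋆ shift m w ∣ st* g ⟩) ⟩
      ≈⟨ ⟨⟩-cong-local (τw ⋆ ρn) (All.map (λ (dw , w⊆) → st*-⊙ˡ σ g dw (All.map (All.lookup τρ-positive) w⊆))
                                          (⋆-words τw ρn dτρ)) ⟨
    ⟨ τw ⋆ ρn ∣ st* (λ t → ⟨ σ ⊙ t ∣ g ⟩) ⟩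
      ≈⟨ ⟨⊙⟩ τ ρ _ ⟨
    ⟨ τ ⊙ ρ ∣ (λ t → ⟨ σ ⊙ t ∣ g ⟩) ⟩
      ∎
    where
    module Pσ = SPerm-properties σ
    module Pτ = SPerm-properties τ
    module Pρ = SPerm-properties ρ
    m = size σ
    n = size τ
    σw = word σ
    τw = word τ
    ρw = word ρ
    τm = shift m τw
    ρn = shift n ρw
    dστ = absDistinct-++ Pσ.absDistinct (absDistinct-shift m Pτ.absDistinct)
                         (separated-by m Pσ.abs-bounded (shift-above m Pτ.abs-positive))
    dτρ = absDistinct-++ Pτ.absDistinct (absDistinct-shift n Pρ.absDistinct)
                         (separated-by n Pτ.abs-bounded (shift-above n Pρ.abs-positive))
    στ-bounded : All (λ a → ∣ a ∣ ≤ m +ℕ n) (σw ++ τm)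
    στ-bounded = Allₚ.++⁺ (All.map (λ a≤ → ℕₚ.≤-trans a≤ (ℕₚ.m≤m+n m n)) Pσ.abs-bounded)
                          (subst (λ k → All (λ a → ∣ a ∣ ≤ k) τm) (ℕₚ.+-comm n m) (shift-below m Pτ.abs-bounded))
    τρ-positive : All (λ a → 0 < ∣ a ∣) (τw ++ ρn)
    τρ-positive = Allₚ.++⁺ Pτ.abs-positive (All.map (ℕₚ.≤-<-trans z≤n) (shift-above n Pρ.abs-positive))

  coprod-coassoc : ∀ σ (g : SPerm × (SPerm × SPerm) → Carrier) →
    ⟨ coprod σ ∣ (λ p → ⟨ coprod (proj₁ p) ∣ (λ q → g (proj₁ q , (proj₂ q , proj₂ p))) ⟩) ⟩ ≈
    ⟨ coprod σ ∣ (λ p → ⟨ coprod (proj₂ p) ∣ (λ q → g (proj₁ p , (proj₁ q , proj₂ q))) ⟩) ⟩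
  coprod-coassoc σ g = begin
    _                        ≈⟨ ⟨coprod⟩ σ _ ⟩
    ⟨ deconcat σw ∣ st*² H₁ ⟩
      ≈⟨ ⟨⟩-cong-local (deconcat σw) (All.map (λ ((d₁ , _) , (d₂ , _)) → left d₁ d₂) factors) ⟩
    ⟨[Δ]Δ⟩ σw g₃             ≈⟨ deconcat-coassoc σw g₃ ⟩
    ⟨Δ[Δ]⟩ σw g₃
      ≈⟨ ⟨⟩-cong-local (deconcat σw) (All.map (λ ((d₁ , _) , (d₂ , _)) → right d₁ d₂) factors) ⟨
    ⟨ deconcat σw ∣ st*² H₂ ⟩ ≈⟨ ⟨coprod⟩ σ _ ⟨
    _                        ∎
    where
    σw = word σ
    factors = deconcat-factors σw (SPerm-properties.absDistinct σ)
    H₁ = λ (p : SPerm × SPerm) → ⟨ coprod (proj₁ p) ∣ (λ q → g (proj₁ q , (proj₂ q , proj₂ p))) ⟩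
    H₂ = λ (p : SPerm × SPerm) → ⟨ coprod (proj₂ p) ∣ (λ q → g (proj₁ p , (proj₁ q , proj₂ q))) ⟩
    g₃ : Word × (Word × Word) → Carrier
    g₃ t = st* (λ x → st* (λ y → st* (λ z → g (x , (y , z))) (proj₂ (proj₂ t))) (proj₁ (proj₂ t))) (proj₁ t)
    left : ∀ {p} → AbsDistinct (proj₁ p) → AbsDistinct (proj₂ p) →
           st*² H₁ p ≈ ⟨ deconcat (proj₁ p) ∣ (λ q → g₃ (proj₁ q , (proj₂ q , proj₂ p))) ⟩
    left {p} d₁ d₂ = trans (st*²-absDistinct p d₁ d₂ H₁) (trans (⟨coprod-stSPerm⟩ (proj₁ p) d₁ _)
      (⟨⟩-cong (deconcat (proj₁ p)) (λ q → ⟨⟩-cong (asBasis (stWord (proj₁ q)))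
          (λ x → ⟨⟩-cong (asBasis (stWord (proj₂ q))) (λ y →
          sym (st*-absDistinct (proj₂ p) d₂ (λ z → g (x , (y , z)))))))))
    right : ∀ {p} → AbsDistinct (proj₁ p) → AbsDistinct (proj₂ p) →
            st*² H₂ p ≈ ⟨ deconcat (proj₂ p) ∣ (λ q → g₃ (proj₁ p , (proj₁ q , proj₂ q))) ⟩
    right {p} d₁ d₂ = trans (st*²-absDistinct p d₁ d₂ H₂) (trans (⟨coprod-stSPerm⟩ (proj₂ p) d₂ _)
      (⟨⟩-cong (deconcat (proj₂ p)) (λ q → sym (st*-absDistinct (proj₁ p) d₁ (λ x → st*² (λ yz → g (x , yz)) q)))))


  ⟨⋆⊗⋆⟩-separated : ∀ K g {p q : Word × Word}
    (dp₁ : AbsDistinct (proj₁ p)) (dp₂ : AbsDistinct (proj₂ p)) (dq₁ : AbsDistinct (proj₁ q)) (dq₂ : AbsDistinct (proj₂ q)) →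
    All (λ a → ∣ a ∣ ≤ K) (proj₁ p) → All (λ a → ∣ a ∣ ≤ K) (proj₂ p) →
    All (λ b → 0 < ∣ b ∣) (proj₁ q) → All (λ b → 0 < ∣ b ∣) (proj₂ q) →
    ⟨⋆⊗⋆⟩ (st*² g) p (shift K (proj₁ q) , shift K (proj₂ q)) ≈
    ⟨ stSPerm (proj₁ p) dp₁ ⊙ stSPerm (proj₁ q) dq₁ ∣ (λ s → ⟨ stSPerm (proj₂ p) dp₂ ⊙ stSPerm (proj₂ q) dq₂ ∣ (λ t → g (s , t)) ⟩) ⟩
  ⟨⋆⊗⋆⟩-separated K g {p₁ , p₂} {q₁ , q₂} dp₁ dp₂ dq₁ dq₂ p₁≤K p₂≤K q₁⁺ q₂⁺ = begin
    ⟨ p₁ ⋆ shift K q₁ ∣ (λ w₁ → ⟨ p₂ ⋆ shift K q₂ ∣ (λ w₂ → st*² g (w₁ , w₂)) ⟩) ⟩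
      ≈⟨ ⟨⟩-cong (p₁ ⋆ shift K q₁) (λ w₁ → ⟨⟩-swap (λ s w₂ → st* (λ t → g (s , t)) w₂) (asBasis (stWord w₁)) (p₂ ⋆ shift K q₂)) ⟨
    ⟨ p₁ ⋆ shift K q₁ ∣ st* (λ s → ⟨ p₂ ⋆ shift K q₂ ∣ st* (λ t → g (s , t)) ⟩) ⟩
      ≈⟨ ⟨⟩-cong (p₁ ⋆ shift K q₁) (λ w₁ → ⟨⟩-cong (asBasis (stWord w₁)) (λ s →
           ⟨⊙⟩-separated K dp₂ dq₂ p₂≤K q₂⁺ (λ t → g (s , t)))) ⟨
    ⟨ p₁ ⋆ shift K q₁ ∣ st* (λ s → ⟨ stSPerm p₂ dp₂ ⊙ stSPerm q₂ dq₂ ∣ (λ t → g (s , t)) ⟩) ⟩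
      ≈⟨ ⟨⊙⟩-separated K dp₁ dq₁ p₁≤K q₁⁺ _ ⟨
    ⟨ stSPerm p₁ dp₁ ⊙ stSPerm q₁ dq₁ ∣ (λ s → ⟨ stSPerm p₂ dp₂ ⊙ stSPerm q₂ dq₂ ∣ (λ t → g (s , t)) ⟩) ⟩
      ∎

  coprod-⊙ : ∀ σ τ (g : SPerm × SPerm → Carrier) →
    ⟨ σ ⊙ τ ∣ (λ t → ⟨ coprod t ∣ g ⟩) ⟩ ≈
    ⟨ coprod σ ∣ (λ p → ⟨ coprod τ ∣ (λ q → ⟨ proj₁ p ⊙ proj₁ q ∣ (λ s → ⟨ proj₂ p ⊙ proj₂ q ∣ (λ t → g (s , t)) ⟩) ⟩) ⟩) ⟩
  coprod-⊙ σ τ g = begin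
    ⟨ σ ⊙ τ ∣ (λ t → ⟨ coprod t ∣ g ⟩) ⟩
      ≈⟨ ⟨⊙⟩ σ τ _ ⟩
    ⟨ σw ⋆ τm ∣ st* (λ t → ⟨ coprod t ∣ g ⟩) ⟩
      ≈⟨ ⟨⟩-cong-local (σw ⋆ τm) (All.map (λ {(_ , w)} (d , _) → trans (st*-absDistinct w d _) (⟨coprod-stSPerm⟩ w d g))
                                          (⋆-words σw τm dστ)) ⟩
    ⟨Δ[⋆]⟩ σw τm (st*² g)
      ≈⟨ deconcat-⋆ σw τm (st*² g) ⟩
    ⟨[Δ]⋆[Δ]⟩ σw τm (st*² g)
      ≈⟨ ⟨⟩-cong-local (deconcat σw) (All.map (λ ((d₁ , ⊆₁) , (d₂ , ⊆₂)) → right-sum d₁ d₂ (bounded ⊆₁) (bounded ⊆₂))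
                                              (deconcat-factors σw Pσ.absDistinct)) ⟩
    ⟨ deconcat σw ∣ st*² H ⟩
      ≈⟨ ⟨coprod⟩ σ _ ⟨
    ⟨ coprod σ ∣ H ⟩
      ∎
    where
    module Pσ = SPerm-properties σ
    module Pτ = SPerm-properties τ
    m = size σ
    σw = word σ
    τw = word τ
    τm = shift m τw
    dστ = absDistinct-++ Pσ.absDistinct (absDistinct-shift m Pτ.absDistinct)
                         (separated-by m Pσ.abs-bounded (shift-above m Pτ.abs-positive))
    bounded : ∀ {u} → All (_∈ σw) u → All (λ a → ∣ a ∣ ≤ m) u
    bounded = All.map (All.lookup Pσ.abs-bounded)
    K = λ (p q : SPerm × SPerm) → ⟨ proj₁ p ⊙ proj₁ q ∣ (λ s → ⟨ proj₂ p ⊙ proj₂ q ∣ (λ t → g (s , t)) ⟩) ⟩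
    H = λ (p : SPerm × SPerm) → ⟨ coprod τ ∣ K p ⟩
    right-sum : ∀ {p} (d₁ : AbsDistinct (proj₁ p)) (d₂ : AbsDistinct (proj₂ p)) →
                All (λ a → ∣ a ∣ ≤ m) (proj₁ p) → All (λ a → ∣ a ∣ ≤ m) (proj₂ p) →
                ⟨ deconcat τm ∣ ⟨⋆⊗⋆⟩ (st*² g) p ⟩ ≈ st*² H p
    right-sum {p} d₁ d₂ p₁≤m p₂≤m = begin
      ⟨ deconcat τm ∣ ⟨⋆⊗⋆⟩ (st*² g) p ⟩
        ≈⟨ ⟨deconcat⟩-map (shiftL m) τw _ ⟩
      ⟨ deconcat τw ∣ (λ q → ⟨⋆⊗⋆⟩ (st*² g) p (shift m (proj₁ q) , shift m (proj₂ q))) ⟩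
        ≈⟨ ⟨⟩-cong-local (deconcat τw) (All.map (λ {q} ((dq₁ , ⊆q₁) , (dq₂ , ⊆q₂)) →
             trans (⟨⋆⊗⋆⟩-separated m g d₁ d₂ dq₁ dq₂ p₁≤m p₂≤m (positive ⊆q₁) (positive ⊆q₂))
                   (sym (st*²-absDistinct (proj₂ q) dq₁ dq₂ _)))
             (deconcat-factors τw Pτ.absDistinct)) ⟩
      ⟨ deconcat τw ∣ st*² (K (stSPerm (proj₁ p) d₁ , stSPerm (proj₂ p) d₂)) ⟩
        ≈⟨ ⟨coprod⟩ τ _ ⟨
      H (stSPerm (proj₁ p) d₁ , stSPerm (proj₂ p) d₂)
        ≈⟨ st*²-absDistinct p d₁ d₂ H ⟨
      st*² H p
        ∎
      where
      positive : ∀ {u} → All (_∈ τw) u → All (λ b → 0 < ∣ b ∣) u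
      positive = All.map (All.lookup Pτ.abs-positive)

module HSymBialgebra {c ℓ} (F : Field c ℓ) (λ' : Field.Carrier F) where
  open Field F
  open HSymDefs F
  open HSymHopf λ'
  open Pairing F
  open HSymOnBasis F λ'
  open import Relation.Binary.Reasoning.Setoid setoid

  ⟨mul⟩ : ∀ u v g → ⟨ mul u v ∣ g ⟩ ≈ ⟨ u ∣ (λ x → ⟨ v ∣ (λ y → ⟨ x ⊙ y ∣ g ⟩) ⟩) ⟩
  ⟨mul⟩ u v g = ⟨⟩-ext2 _⊙_ u v g

  ⟨Δ⟩ : ∀ u (g : SPerm × SPerm → Carrier) → ⟨ Δ u ∣ g ⟩ ≈ ⟨ u ∣ (λ x → ⟨ coprod x ∣ g ⟩) ⟩
  ⟨Δ⟩ u g = ⟨⟩-ext g coprod u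

  ⟨mul-assoc⟩ : ∀ u v w g → ⟨ mul (mul u v) w ∣ g ⟩ ≈ ⟨ mul u (mul v w) ∣ g ⟩
  ⟨mul-assoc⟩ u v w g = begin
    ⟨ mul (mul u v) w ∣ g ⟩                                          ≈⟨ ⟨mul⟩ (mul u v) w g ⟩
    ⟨ mul u v ∣ (λ t → ⟨ w ∣ (λ z → ⟨ t ⊙ z ∣ g ⟩) ⟩) ⟩               ≈⟨ ⟨mul⟩ u v _ ⟩
    ⟨ u ∣ (λ x → ⟨ v ∣ (λ y → ⟨ x ⊙ y ∣ (λ t → ⟨ w ∣ (λ z → ⟨ t ⊙ z ∣ g ⟩) ⟩) ⟩) ⟩) ⟩
      ≈⟨ ⟨⟩-cong u (λ x → ⟨⟩-cong v (λ y → trans (⟨⟩-swap (λ t z → ⟨ t ⊙ z ∣ g ⟩) (x ⊙ y) w)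
                                                    (⟨⟩-cong w (λ z → ⊙-assoc x y z g)))) ⟩
    ⟨ u ∣ (λ x → ⟨ v ∣ (λ y → ⟨ w ∣ (λ z → ⟨ y ⊙ z ∣ (λ t → ⟨ x ⊙ t ∣ g ⟩) ⟩) ⟩) ⟩) ⟩
      ≈⟨ ⟨⟩-cong u (λ x → ⟨mul⟩ v w (λ t → ⟨ x ⊙ t ∣ g ⟩)) ⟨
    ⟨ u ∣ (λ x → ⟨ mul v w ∣ (λ t → ⟨ x ⊙ t ∣ g ⟩) ⟩) ⟩              ≈⟨ ⟨mul⟩ u (mul v w) g ⟨
    ⟨ mul u (mul v w) ∣ g ⟩                                          ∎

  ⟨coassoc⟩ : ∀ u (g : SPerm × (SPerm × SPerm) → Carrier) →
              ⟨ mapLin reassoc ((coprod ⊗L basis) (Δ u)) ∣ g ⟩ ≈ ⟨ (basis ⊗L coprod) (Δ u) ∣ g ⟩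
  ⟨coassoc⟩ u g = begin
    ⟨ mapLin reassoc ((coprod ⊗L basis) (Δ u)) ∣ g ⟩
      ≡⟨ ⟨⟩-mapLin g reassoc ((coprod ⊗L basis) (Δ u)) ⟩
    ⟨ (coprod ⊗L basis) (Δ u) ∣ g ∘ reassoc ⟩
      ≈⟨ ⟨⟩-ext (g ∘ reassoc) (λ p → tensor (coprod (proj₁ p)) (basis (proj₂ p))) (Δ u) ⟩
    _ ≈⟨ ⟨⟩-cong (Δ u) (λ p → trans (⟨⟩-tensor (g ∘ reassoc) (coprod (proj₁ p)) (basis (proj₂ p)))
                                    (⟨⟩-cong (coprod (proj₁ p))
                                        (λ q → ⟨⟩-basis (λ y → g (proj₁ q , (proj₂ q , y))) (proj₂ p)))) ⟩
    ⟨ Δ u ∣ (λ p → ⟨ coprod (proj₁ p) ∣ (λ q → g (proj₁ q , (proj₂ q , proj₂ p))) ⟩) ⟩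
      ≈⟨ ⟨Δ⟩ u _ ⟩
    _ ≈⟨ ⟨⟩-cong u (λ x → coprod-coassoc x g) ⟩
    _ ≈⟨ ⟨Δ⟩ u _ ⟨
    ⟨ Δ u ∣ (λ p → ⟨ coprod (proj₂ p) ∣ (λ q → g (proj₁ p , q)) ⟩) ⟩
      ≈⟨ ⟨⟩-cong (Δ u) (λ p → trans (⟨⟩-tensor g (basis (proj₁ p)) (coprod (proj₂ p)))
                                    (⟨⟩-basis (λ x → ⟨ coprod (proj₂ p) ∣ (λ y → g (x , y)) ⟩) (proj₁ p))) ⟨
    _ ≈⟨ ⟨⟩-ext g (λ p → tensor (basis (proj₁ p)) (coprod (proj₂ p))) (Δ u) ⟨
    ⟨ (basis ⊗L coprod) (Δ u) ∣ g ⟩ ∎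

  ⟨Δ-mul⟩ : ∀ u v (g : SPerm × SPerm → Carrier) → ⟨ Δ (mul u v) ∣ g ⟩ ≈ ⟨ mul2 (Δ u) (Δ v) ∣ g ⟩
  ⟨Δ-mul⟩ u v g = begin
    ⟨ Δ (mul u v) ∣ g ⟩                                            ≈⟨ ⟨Δ⟩ (mul u v) g ⟩
    ⟨ mul u v ∣ (λ t → ⟨ coprod t ∣ g ⟩) ⟩                          ≈⟨ ⟨mul⟩ u v _ ⟩
    _                                                              ≈⟨ ⟨⟩-cong u (λ x → ⟨⟩-cong v (λ y → coprod-⊙ x y g)) ⟩
    ⟨ u ∣ (λ x → ⟨ v ∣ (λ y → ⟨ coprod x ∣ (λ p → ⟨ coprod y ∣ K p ⟩) ⟩) ⟩) ⟩
      ≈⟨ ⟨⟩-cong u (λ x → ⟨⟩-swap (λ p y → ⟨ coprod y ∣ K p ⟩) (coprod x) v) ⟨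
    ⟨ u ∣ (λ x → ⟨ coprod x ∣ (λ p → ⟨ v ∣ (λ y → ⟨ coprod y ∣ K p ⟩) ⟩) ⟩) ⟩
      ≈⟨ ⟨⟩-cong u (λ x → ⟨⟩-cong (coprod x) (λ p → ⟨Δ⟩ v (K p))) ⟨
    ⟨ u ∣ (λ x → ⟨ coprod x ∣ (λ p → ⟨ Δ v ∣ K p ⟩) ⟩) ⟩              ≈⟨ ⟨Δ⟩ u _ ⟨
    ⟨ Δ u ∣ (λ p → ⟨ Δ v ∣ K p ⟩) ⟩
      ≈⟨ trans (⟨⟩-ext2 _ (Δ u) (Δ v) g)
               (⟨⟩-cong (Δ u) (λ p → ⟨⟩-cong (Δ v) (λ q → ⟨⟩-tensor g (proj₁ p ⊙ proj₁ q) (proj₂ p ⊙ proj₂ q)))) ⟨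
    ⟨ mul2 (Δ u) (Δ v) ∣ g ⟩                                        ∎
    where
    K = λ (p q : SPerm × SPerm) → ⟨ proj₁ p ⊙ proj₁ q ∣ (λ s → ⟨ proj₂ p ⊙ proj₂ q ∣ (λ t → g (s , t)) ⟩) ⟩

  ⟨counit-scale⟩ : ∀ u g (pick : SPerm × SPerm → SPerm) (drop : SPerm × SPerm → SPerm) →
    ⟨ ext (λ p → scale (counitB (drop p)) (basis (pick p))) (Δ u) ∣ g ⟩ ≈
    ⟨ u ∣ (λ x → ⟨ coprod x ∣ (λ p → counitB (drop p) * g (pick p)) ⟩) ⟩
  ⟨counit-scale⟩ u g pick drop =
    trans (⟨⟩-ext g _ (Δ u)) (trans (⟨⟩-cong (Δ u) (λ p → trans (⟨⟩-scale g _ (basis (pick p))) (*-congˡ (⟨⟩-basis g _))))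
                                    (⟨Δ⟩ u _))

  hsym-isBialgebra : IsBialgebra
  hsym-isBialgebra = record
    { mul-assoc   = λ u v w → ≋-intro _≟SP_ {mul (mul u v) w} {mul u (mul v w)} (⟨mul-assoc⟩ u v w)
    ; mul-unitˡ   = λ u → ≋-intro _≟SP_ {mul unit u} {u} (λ g →
        trans (⟨mul⟩ unit u g) (trans (⟨⟩-basis (λ x → ⟨ u ∣ (λ y → ⟨ x ⊙ y ∣ g ⟩) ⟩) ι) (⟨⟩-cong u (λ y → ⊙-identityˡ y g))))
    ; mul-unitʳ   = λ u → ≋-intro _≟SP_ {mul u unit} {u} (λ g →
        trans (⟨mul⟩ u unit g) (⟨⟩-cong u (λ x → trans (⟨⟩-basis (λ y → ⟨ x ⊙ y ∣ g ⟩) ι) (⊙-identityʳ x g))))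
    ; coassoc     = λ u → ≋-intro _≟3_ {mapLin reassoc ((coprod ⊗L basis) (Δ u))} {(basis ⊗L coprod) (Δ u)} (⟨coassoc⟩ u)
    ; counitˡ     = λ u → ≋-intro _≟SP_ {ext (λ p → scale (counitB (proj₁ p)) (basis (proj₂ p))) (Δ u)} {u} (λ g →
        trans (⟨counit-scale⟩ u g proj₂ proj₁) (⟨⟩-cong u (λ x → coprod-counitˡ x g)))
    ; counitʳ     = λ u → ≋-intro _≟SP_ {ext (λ p → scale (counitB (proj₂ p)) (basis (proj₁ p))) (Δ u)} {u} (λ g →
        trans (⟨counit-scale⟩ u g proj₁ proj₂) (⟨⟩-cong u (λ x → coprod-counitʳ x g)))
    ; Δ-mul       = λ u v → ≋-intro _≟2_ {Δ (mul u v)} {mul2 (Δ u) (Δ v)} (⟨Δ-mul⟩ u v)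
    ; Δ-unit      = ≋-intro _≟2_ {Δ unit} {tensor unit unit} (λ g → begin
        ⟨ Δ unit ∣ g ⟩                                       ≈⟨ ⟨Δ⟩ unit g ⟩
        ⟨ unit ∣ (λ x → ⟨ coprod x ∣ g ⟩) ⟩                  ≈⟨ ⟨⟩-basis (λ x → ⟨ coprod x ∣ g ⟩) ι ⟩
        ⟨ coprod ι ∣ g ⟩                                      ≈⟨ coprod-ι g ⟩
        g (ι , ι)                                            ≈⟨ ⟨⟩-basis (λ y → g (ι , y)) ι ⟨
        ⟨ unit ∣ (λ y → g (ι , y)) ⟩                          ≈⟨ ⟨⟩-basis (λ x → ⟨ unit ∣ (λ y → g (x , y)) ⟩) ι ⟨
        ⟨ unit ∣ (λ x → ⟨ unit ∣ (λ y → g (x , y)) ⟩) ⟩      ≈⟨ ⟨⟩-tensor g unit unit ⟨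
        ⟨ tensor unit unit ∣ g ⟩                             ∎)
    ; counit-mul  = λ u v → begin
        counit (mul u v)                                         ≈⟨ ⟨mul⟩ u v counitB ⟩
        ⟨ u ∣ (λ x → ⟨ v ∣ (λ y → ⟨ x ⊙ y ∣ counitB ⟩) ⟩) ⟩
          ≈⟨ ⟨⟩-cong u (λ x → ⟨⟩-cong v (λ y → counit-⊙ x y)) ⟩
        ⟨ u ∣ (λ x → ⟨ v ∣ (λ y → counitB x * counitB y) ⟩) ⟩   ≈⟨ ⟨⟩-cong u (λ x → ⟨⟩-* (counitB x) counitB v) ⟩
        ⟨ u ∣ (λ x → counitB x * counit v) ⟩                    ≈⟨ ⟨⟩-cong u (λ x → *-comm _ _) ⟩
        ⟨ u ∣ (λ x → counit v * counitB x) ⟩                    ≈⟨ ⟨⟩-* _ counitB u ⟩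
        counit v * counit u                                      ≈⟨ *-comm _ _ ⟩
        counit u * counit v                                      ∎
    ; counit-unit = ⟨⟩-basis counitB ι
    }

module HSymAntipode {c ℓ} (F : Field c ℓ) (λ' : Field.Carrier F) where
  open Field F
  open HSymDefs F
  open HSymHopf λ'
  open Pairing F
  open StandardizedProducts F λ' using (st*)
  open HSymOnBasis F λ'
  open HSymBialgebra F λ'
  open import Relation.Binary.Reasoning.Setoid setoid

  -- S ι = ι and S σ = − Σ_{p < |σ|} S(st(σ₁⋯σ_p)) · st(σ_{p+1}⋯σ_m); the fuel need only exceed |σ|
  mutual
    antipodeWithFuel : ℕ → SPerm → Lin SPerm
    antipodeWithFuel zero    σ = basis ι
    antipodeWithFuel (suc k) σ with word σ
    ... | []    = basis ι
    ... | _ ∷ _ = scale (- 1#) (concatMap (antipodeTerm k σ) (upTo (size σ)))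

    antipodeTerm : ℕ → SPerm → ℕ → Lin SPerm
    antipodeTerm k σ p = ext (λ x → ext (λ y → mul (antipodeWithFuel k x) (basis y)) (asBasis (stWord (drop p (word σ)))))
                             (asBasis (stWord (take p (word σ))))

  antipode : SPerm → Lin SPerm
  antipode σ = antipodeWithFuel (size σ) σ

  asBasis-word : ∀ v → All (λ q → word (proj₂ q) ≡ v) (asBasis v)
  asBasis-word v with T? (isSPerm v)
  ... | yes _ = ≡.refl ∷ []
  ... | no _  = []

  size-st-take : ∀ σ p → All (λ q → size (proj₂ q) ≤ p) (asBasis (stWord (take p (word σ))))
  size-st-take σ p = All.map (λ e → ℕₚ.≤-trans (ℕₚ.≤-reflexive (≡.trans (cong length e) (length-stWord (take p (word σ)))))
                                               (ℕₚ.≤-trans (ℕₚ.≤-reflexive (Listₚ.length-take p (word σ))) (ℕₚ.m⊓n≤m p _)))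
                             (asBasis-word (stWord (take p (word σ))))

  antipodeWithFuel-irrelevant : ∀ a b σ → size σ ≤ a → size σ ≤ b → antipodeWithFuel a σ ≡ antipodeWithFuel b σ
  antipodeWithFuel-irrelevant zero    zero    σ          _ _ = ≡.refl
  antipodeWithFuel-irrelevant zero    (suc b) (sp [] _)  _ _ = ≡.refl
  antipodeWithFuel-irrelevant (suc a) zero    (sp [] _)  _ _ = ≡.refl
  antipodeWithFuel-irrelevant (suc a) (suc b) (sp [] _)  _ _ = ≡.refl
  antipodeWithFuel-irrelevant (suc a) (suc b) σ@(sp (_ ∷ w) _) (s≤s σ≤a) (s≤s σ≤b) =
    cong (scale (- 1#) ∘ concat) (Listₚ.map-cong-local (All.tabulate same-term))
    where
    same-term : ∀ {p} → p ∈ upTo (size σ) → antipodeTerm a σ p ≡ antipodeTerm b σ p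
    same-term {p} p∈ = ext-cong-local (asBasis (stWord (take p (word σ)))) (All.map (λ {r} r≤p →
      let r<σ = ℕₚ.≤-trans r≤p (ℕₚ.≤-pred (∈-upTo⁻ p∈)) in
      cong (λ z → ext (λ y → mul z (basis y)) (asBasis (stWord (drop p (word σ)))))
           (antipodeWithFuel-irrelevant a b (proj₂ r) (ℕₚ.≤-trans r<σ σ≤a) (ℕₚ.≤-trans r<σ σ≤b)))
      (size-st-take σ p))

  ⟨mul-ι⟩ : ∀ U g → ⟨ mul U (basis ι) ∣ g ⟩ ≈ ⟨ U ∣ g ⟩
  ⟨mul-ι⟩ U g = trans (⟨mul⟩ U (basis ι) g) (⟨⟩-cong U (λ x → trans (⟨⟩-basis (λ y → ⟨ x ⊙ y ∣ g ⟩) ι) (⊙-identityʳ x g)))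

  splitTerm : SPerm → (SPerm × SPerm → Carrier) → ℕ → Carrier
  splitTerm σ h p = ⟨ asBasis (stWord (take p (word σ))) ∣ (λ x → ⟨ asBasis (stWord (drop p (word σ))) ∣ (λ y → h (x , y)) ⟩) ⟩

  ⟨coprod⟩-split : ∀ σ h → ⟨ coprod σ ∣ h ⟩ ≈ ∑ (upTo (size σ)) (splitTerm σ h) + splitTerm σ h (size σ)
  ⟨coprod⟩-split σ h = begin
    ⟨ coprod σ ∣ h ⟩
      ≈⟨ ⟨⟩-concatMap (λ p → tensor (asBasis (stWord (take p (word σ))))
          (asBasis (stWord (drop p (word σ))))) (upTo (suc (size σ))) h ⟩
    _ ≈⟨ ∑-cong-local (upTo (suc (size σ))) (λ {p} _ → ⟨⟩-tensor h (asBasis (stWord (take p (word σ))))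
        (asBasis (stWord (drop p (word σ))))) ⟩
    ∑ (upTo (suc (size σ))) (splitTerm σ h)
      ≡⟨ cong (λ l → ∑ l (splitTerm σ h)) (Listₚ.applyUpTo-∷ʳ id (size σ)) ⟨
    ∑ (upTo (size σ) ++ size σ ∷ []) (splitTerm σ h)                ≈⟨ ∑-++ (upTo (size σ)) _ (splitTerm σ h) ⟩
    ∑ (upTo (size σ)) (splitTerm σ h) + (splitTerm σ h (size σ) + 0#) ≈⟨ +-congˡ (+-identityʳ _) ⟩
    ∑ (upTo (size σ)) (splitTerm σ h) + splitTerm σ h (size σ)        ∎

  splitTerm-last : ∀ σ h → splitTerm σ h (size σ) ≈ h (σ , ι)
  splitTerm-last σ h = begin
    splitTerm σ h (size σ)
      ≡⟨ cong₂ (λ a b → ⟨ asBasis (stWord a) ∣ (λ x → ⟨ asBasis (stWord b) ∣ (λ y → h (x , y)) ⟩) ⟩)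
               (Listₚ.take-all (size σ) (word σ) ℕₚ.≤-refl) (Listₚ.drop-all (size σ) (word σ) ℕₚ.≤-refl) ⟩
    st* (λ x → ⟨ basis ι ∣ (λ y → h (x , y)) ⟩) (word σ) ≈⟨ st*-word σ _ ⟩
    ⟨ basis ι ∣ (λ y → h (σ , y)) ⟩                    ≈⟨ ⟨⟩-basis (λ y → h (σ , y)) ι ⟩
    h (σ , ι)                                           ∎

  antipode-left : ∀ σ g → ⟨ coprod σ ∣ (λ q → ⟨ mul (antipode (proj₁ q)) (basis (proj₂ q)) ∣ g ⟩) ⟩ ≈ counitB σ * g ι
  antipode-left σ@(sp [] _) g = begin
    ⟨ coprod σ ∣ h ⟩                 ≈⟨ ⟨coprod⟩-split σ h ⟩
    0# + splitTerm σ h 0             ≈⟨ +-identityˡ _ ⟩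
    splitTerm σ h 0                  ≈⟨ splitTerm-last σ h ⟩
    ⟨ mul (basis ι) (basis ι) ∣ g ⟩  ≈⟨ ⟨mul-ι⟩ (basis ι) g ⟩
    ⟨ basis ι ∣ g ⟩                  ≈⟨ ⟨⟩-basis g ι ⟩
    g ι                              ≈⟨ *-identityˡ _ ⟨
    1# * g ι                         ∎
    where h = λ (q : SPerm × SPerm) → ⟨ mul (antipode (proj₁ q)) (basis (proj₂ q)) ∣ g ⟩
  antipode-left σ@(sp (a ∷ x) _) g = begin
    ⟨ coprod σ ∣ h ⟩                                  ≈⟨ ⟨coprod⟩-split σ h ⟩
    ∑ (upTo m) (splitTerm σ h) + splitTerm σ h m      ≈⟨ +-cong split≈body last≈-body ⟩
    ⟨ body ∣ g ⟩ + - 1# * ⟨ body ∣ g ⟩                ≈⟨ x+-1*x≈0 _ ⟩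
    0#                                                ≈⟨ zeroˡ _ ⟨
    0# * g ι                                          ∎
    where
    k = length x
    m = suc k
    body = concatMap (antipodeTerm k σ) (upTo m)
    h = λ (q : SPerm × SPerm) → ⟨ mul (antipode (proj₁ q)) (basis (proj₂ q)) ∣ g ⟩
    last≈-body : splitTerm σ h m ≈ - 1# * ⟨ body ∣ g ⟩
    last≈-body = trans (splitTerm-last σ h) (trans (⟨mul-ι⟩ (antipode σ) g) (⟨⟩-scale g (- 1#) body))
    term≈split : ∀ {p} → p ∈ upTo m → ⟨ antipodeTerm k σ p ∣ g ⟩ ≈ splitTerm σ h p
    term≈split {p} p∈ = trans (⟨⟩-ext g _ left) (trans (⟨⟩-cong left (λ z → ⟨⟩-ext g _ right))
      (⟨⟩-cong-local left (All.map (λ {r} r≤p → reflexive (cong (λ z → ⟨ right ∣ (λ y → ⟨ mul z (basis y) ∣ g ⟩) ⟩)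
          (antipodeWithFuel-irrelevant k (size (proj₂ r)) (proj₂ r) (ℕₚ.≤-trans r≤p (ℕₚ.≤-pred (∈-upTo⁻ p∈))) ℕₚ.≤-refl)))
        (size-st-take σ p))))
      where
      left = asBasis (stWord (take p (word σ)))
      right = asBasis (stWord (drop p (word σ)))
    split≈body : ∑ (upTo m) (splitTerm σ h) ≈ ⟨ body ∣ g ⟩
    split≈body = sym (trans (⟨⟩-concatMap (antipodeTerm k σ) (upTo m) g) (∑-cong-local (upTo m) term≈split))

  infixl 7 _∗_
  _∗_ : (SPerm → Lin SPerm) → (SPerm → Lin SPerm) → SPerm → Lin SPerm
  (f ∗ h) σ = ext (λ p → mul (f (proj₁ p)) (h (proj₂ p))) (coprod σ)

  ⟨∗⟩ : ∀ f h σ g → ⟨ (f ∗ h) σ ∣ g ⟩ ≈ ⟨ coprod σ ∣ (λ p → ⟨ f (proj₁ p) ∣ (λ x → ⟨ h (proj₂ p) ∣ (λ y → ⟨ x ⊙ y ∣ g ⟩) ⟩) ⟩) ⟩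
  ⟨∗⟩ f h σ g = trans (⟨⟩-ext g (λ p → mul (f (proj₁ p)) (h (proj₂ p))) (coprod σ))
                      (⟨⟩-cong (coprod σ) (λ p → ⟨mul⟩ (f (proj₁ p)) (h (proj₂ p)) g))

  unitCounit : SPerm → Lin SPerm
  unitCounit σ = scale (counitB σ) unit

  ⟨unitCounit⟩ : ∀ σ (Φ : SPerm → Carrier) → ⟨ unitCounit σ ∣ Φ ⟩ ≈ counitB σ * Φ ι
  ⟨unitCounit⟩ σ Φ = trans (⟨⟩-scale Φ (counitB σ) unit) (*-congˡ (⟨⟩-basis Φ ι))

  ∗-assoc : ∀ f h k σ g → ⟨ ((f ∗ h) ∗ k) σ ∣ g ⟩ ≈ ⟨ (f ∗ (h ∗ k)) σ ∣ g ⟩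
  ∗-assoc f h k σ g = begin
    ⟨ ((f ∗ h) ∗ k) σ ∣ g ⟩ ≈⟨ ⟨∗⟩ (f ∗ h) k σ g ⟩
    _ ≈⟨ ⟨⟩-cong (coprod σ) (λ p → trans (⟨∗⟩ f h (proj₁ p) _) (⟨⟩-cong (coprod (proj₁ p)) (λ q →
           ⟨⟩-cong (f (proj₁ q)) (λ x → ⟨⟩-cong (h (proj₂ q))
               (λ y → ⟨⟩-swap (λ t z → ⟨ t ⊙ z ∣ g ⟩) (x ⊙ y) (k (proj₂ p))))))) ⟩
    ⟨ coprod σ ∣ (λ p → ⟨ coprod (proj₁ p) ∣ (λ q → G (proj₁ q , (proj₂ q , proj₂ p))) ⟩) ⟩ ≈⟨ coprod-coassoc σ G ⟩
    ⟨ coprod σ ∣ (λ p → ⟨ coprod (proj₂ p) ∣ (λ q → G (proj₁ p , (proj₁ q , proj₂ q))) ⟩) ⟩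
      ≈⟨ ⟨⟩-cong (coprod σ) (λ p → begin
           ⟨ coprod (proj₂ p) ∣ (λ q → G (proj₁ p , q)) ⟩
             ≈⟨ ⟨⟩-swap (λ x q → ⟨ h (proj₁ q) ∣ (λ y → ⟨ k (proj₂ q) ∣ (λ z → ⟨ x ⊙ y ∣ (λ s → ⟨ s ⊙ z ∣ g ⟩) ⟩) ⟩) ⟩)
                        (f (proj₁ p)) (coprod (proj₂ p)) ⟨
           _ ≈⟨ ⟨⟩-cong (f (proj₁ p)) (λ x → ⟨⟩-cong (coprod (proj₂ p)) (λ q → ⟨⟩-cong (h (proj₁ q)) (λ y →
                  ⟨⟩-cong (k (proj₂ q)) (λ z → ⊙-assoc x y z g)))) ⟩
           _ ≈⟨ ⟨⟩-cong (f (proj₁ p)) (λ x → ⟨∗⟩ h k (proj₂ p) (λ t → ⟨ x ⊙ t ∣ g ⟩)) ⟨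
           ⟨ f (proj₁ p) ∣ (λ x → ⟨ (h ∗ k) (proj₂ p) ∣ (λ t → ⟨ x ⊙ t ∣ g ⟩) ⟩) ⟩ ∎) ⟩
    _ ≈⟨ ⟨∗⟩ f (h ∗ k) σ g ⟨
    ⟨ (f ∗ (h ∗ k)) σ ∣ g ⟩ ∎
    where
    G : SPerm × (SPerm × SPerm) → Carrier
    G t = ⟨ f (proj₁ t) ∣ (λ x → ⟨ h (proj₁ (proj₂ t)) ∣ (λ y → ⟨ k (proj₂ (proj₂ t)) ∣ (λ z →
            ⟨ x ⊙ y ∣ (λ s → ⟨ s ⊙ z ∣ g ⟩) ⟩) ⟩) ⟩) ⟩

  ∗-identityʳ : ∀ f σ g → ⟨ (f ∗ unitCounit) σ ∣ g ⟩ ≈ ⟨ f σ ∣ g ⟩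
  ∗-identityʳ f σ g = trans (⟨∗⟩ f unitCounit σ g) (trans (⟨⟩-cong (coprod σ) (λ p →
      trans (⟨⟩-cong (f (proj₁ p)) (λ x → trans (⟨unitCounit⟩ (proj₂ p) (λ y → ⟨ x ⊙ y ∣ g ⟩)) (*-congˡ (⊙-identityʳ x g))))
            (⟨⟩-* (counitB (proj₂ p)) g (f (proj₁ p)))))
    (coprod-counitʳ σ (λ x → ⟨ f x ∣ g ⟩)))

  ∗-identityˡ : ∀ f σ g → ⟨ (unitCounit ∗ f) σ ∣ g ⟩ ≈ ⟨ f σ ∣ g ⟩
  ∗-identityˡ f σ g = trans (⟨∗⟩ unitCounit f σ g) (trans (⟨⟩-cong (coprod σ) (λ p →
      trans (⟨unitCounit⟩ (proj₁ p) (λ x → ⟨ f (proj₂ p) ∣ (λ y → ⟨ x ⊙ y ∣ g ⟩) ⟩))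
            (*-congˡ (⟨⟩-cong (f (proj₂ p)) (λ y → ⊙-identityˡ y g)))))
    (coprod-counitˡ σ (λ x → ⟨ f x ∣ g ⟩)))

  ∗-congˡ : ∀ f h h′ → (∀ τ g → ⟨ h τ ∣ g ⟩ ≈ ⟨ h′ τ ∣ g ⟩) → ∀ σ g → ⟨ (f ∗ h) σ ∣ g ⟩ ≈ ⟨ (f ∗ h′) σ ∣ g ⟩
  ∗-congˡ f h h′ h≈h′ σ g =
    trans (⟨∗⟩ f h σ g) (trans (⟨⟩-cong (coprod σ) (λ p → ⟨⟩-cong (f (proj₁ p)) (λ x → h≈h′ (proj₂ p) _))) (sym (⟨∗⟩ f h′ σ g)))

  antipode-∗-id : ∀ σ g → ⟨ (antipode ∗ basis) σ ∣ g ⟩ ≈ ⟨ unitCounit σ ∣ g ⟩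
  antipode-∗-id σ g = trans (⟨⟩-ext g _ (coprod σ)) (trans (antipode-left σ g) (sym (⟨unitCounit⟩ σ g)))

  defect : SPerm → Lin SPerm
  defect σ = (basis ∗ antipode) σ ++ scale (- 1#) (unitCounit σ)

  ⟨defect⟩ : ∀ σ Φ → ⟨ defect σ ∣ Φ ⟩ ≈ ⟨ (basis ∗ antipode) σ ∣ Φ ⟩ + - 1# * ⟨ unitCounit σ ∣ Φ ⟩
  ⟨defect⟩ σ Φ = trans (⟨⟩-++ Φ ((basis ∗ antipode) σ) _) (+-congˡ (⟨⟩-scale Φ (- 1#) (unitCounit σ)))

  defect-∗-id≈0 : ∀ σ g → ⟨ (defect ∗ basis) σ ∣ g ⟩ ≈ 0#
  defect-∗-id≈0 σ g = begin
    ⟨ (defect ∗ basis) σ ∣ g ⟩                                   ≈⟨ ⟨∗⟩ defect basis σ g ⟩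
    ⟨ coprod σ ∣ (λ p → ⟨ defect (proj₁ p) ∣ Φ p ⟩) ⟩
      ≈⟨ ⟨⟩-cong (coprod σ) (λ p → ⟨defect⟩ (proj₁ p) (Φ p)) ⟩
    ⟨ coprod σ ∣ (λ p → ⟨ (basis ∗ antipode) (proj₁ p) ∣ Φ p ⟩ + - 1# * ⟨ unitCounit (proj₁ p) ∣ Φ p ⟩) ⟩
      ≈⟨ ⟨⟩-+ _ _ (coprod σ) ⟩
    _ + ⟨ coprod σ ∣ (λ p → - 1# * ⟨ unitCounit (proj₁ p) ∣ Φ p ⟩) ⟩
      ≈⟨ +-cong (sym (⟨∗⟩ (basis ∗ antipode) basis σ g))
          (trans (⟨⟩-* (- 1#) _ (coprod σ)) (*-congˡ (sym (⟨∗⟩ unitCounit basis σ g)))) ⟩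
    ⟨ (basis ∗ antipode ∗ basis) σ ∣ g ⟩ + - 1# * ⟨ (unitCounit ∗ basis) σ ∣ g ⟩
      ≈⟨ +-cong (trans (∗-assoc basis antipode basis σ g)
                       (trans (∗-congˡ basis (antipode ∗ basis) unitCounit antipode-∗-id σ g) (∗-identityʳ basis σ g)))
                (*-congˡ (∗-identityˡ basis σ g)) ⟩
    ⟨ basis σ ∣ g ⟩ + - 1# * ⟨ basis σ ∣ g ⟩                     ≈⟨ x+-1*x≈0 _ ⟩
    0#                                                          ∎
    where
    Φ = λ (p : SPerm × SPerm) (x : SPerm) → ⟨ basis (proj₂ p) ∣ (λ y → ⟨ x ⊙ y ∣ g ⟩) ⟩

  -- in (defect ∗ id)(σ) every term but defect σ · ι involves defects of smaller permutations
  defect≈0 : ∀ n σ → size σ < n → ∀ g → ⟨ defect σ ∣ g ⟩ ≈ 0#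
  defect≈0 (suc n) σ (s≤s σ≤n) g = begin
    ⟨ defect σ ∣ g ⟩                                                ≈⟨ ⟨mul-ι⟩ (defect σ) g ⟨
    h (σ , ι)                                                       ≈⟨ splitTerm-last σ h ⟨
    splitTerm σ h (size σ)                                          ≈⟨ +-identityˡ _ ⟨
    0# + splitTerm σ h (size σ)
      ≈⟨ +-congʳ (sym (trans (∑-cong-local (upTo (size σ)) smaller) (∑-0 (upTo (size σ))))) ⟩
    ∑ (upTo (size σ)) (splitTerm σ h) + splitTerm σ h (size σ)      ≈⟨ ⟨coprod⟩-split σ h ⟨
    ⟨ coprod σ ∣ h ⟩
      ≈⟨ ⟨⟩-ext g (λ p → mul (defect (proj₁ p)) (basis (proj₂ p))) (coprod σ) ⟨
    ⟨ (defect ∗ basis) σ ∣ g ⟩                                      ≈⟨ defect-∗-id≈0 σ g ⟩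
    0#                                                              ∎
    where
    h = λ (q : SPerm × SPerm) → ⟨ mul (defect (proj₁ q)) (basis (proj₂ q)) ∣ g ⟩
    smaller : ∀ {p} → p ∈ upTo (size σ) → splitTerm σ h p ≈ 0#
    smaller {p} p∈ = trans (⟨⟩-cong-local (asBasis (stWord (take p (word σ)))) (All.map (λ {r} r≤p →
        trans (⟨⟩-cong (asBasis (stWord (drop p (word σ)))) (λ y → trans (⟨mul⟩ (defect (proj₂ r)) (basis y) g)
                 (defect≈0 n (proj₂ r) (ℕₚ.≤-trans (s≤s r≤p) (ℕₚ.≤-trans (∈-upTo⁻ p∈) σ≤n)) _)))
              (⟨⟩-0 (asBasis (stWord (drop p (word σ))))))
        (size-st-take σ p))) (⟨⟩-0 (asBasis (stWord (take p (word σ)))))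

  antipode-right : ∀ σ g → ⟨ (basis ∗ antipode) σ ∣ g ⟩ ≈ counitB σ * g ι
  antipode-right σ g = trans (x+-1*y≈0⇒x≈y (trans (sym (⟨defect⟩ σ g)) (defect≈0 (suc (size σ)) σ ℕₚ.≤-refl g)))
                             (⟨unitCounit⟩ σ g)

  hsym-isAntipode : IsAntipode antipode
  hsym-isAntipode = record
    { antipodeˡ = λ u → ≋-intro _≟SP_ {ext (λ p → mul (antipode (proj₁ p)) (basis (proj₂ p))) (Δ u)} {scale (counit u) unit}
        (λ g → trans (⟨⟩-ext g _ (Δ u)) (trans (⟨Δ⟩ u _)
            (trans (⟨⟩-cong u (λ x → antipode-left x g)) (counit-unit-pairing u g))))
    ; antipodeʳ = λ u → ≋-intro _≟SP_ {ext (λ p → mul (basis (proj₁ p)) (antipode (proj₂ p))) (Δ u)} {scale (counit u) unit}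
        (λ g → trans (⟨⟩-ext g _ (Δ u)) (trans (⟨Δ⟩ u _)
                 (trans (⟨⟩-cong u (λ x → trans (sym (⟨⟩-ext g _ (coprod x))) (antipode-right x g)))
                     (counit-unit-pairing u g))))
    }
    where
    counit-unit-pairing : ∀ u g → ⟨ u ∣ (λ x → counitB x * g ι) ⟩ ≈ ⟨ scale (counit u) unit ∣ g ⟩
    counit-unit-pairing u g = begin
      ⟨ u ∣ (λ x → counitB x * g ι) ⟩  ≈⟨ ⟨⟩-cong u (λ x → *-comm _ _) ⟩
      ⟨ u ∣ (λ x → g ι * counitB x) ⟩  ≈⟨ ⟨⟩-* (g ι) counitB u ⟩
      g ι * counit u                  ≈⟨ *-comm _ _ ⟩
      counit u * g ι                  ≈⟨ trans (⟨⟩-scale g (counit u) unit) (*-congˡ (⟨⟩-basis g ι)) ⟨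
      ⟨ scale (counit u) unit ∣ g ⟩   ∎

module SSymSubalgebra {c ℓ} (F : Field c ℓ) (λ' : Field.Carrier F) where
  open Field F
  open HSymDefs F
  open Pairing F
  open QuasiShuffle F λ'
  open HSymHopf λ' using (mul)
  open HSymOnBasis F λ' using (_⊙_)
  open HSymAntipode F λ'

  ⋆≡shuffle : ∀ u v → Positive u → Positive v → u ⋆ v ≡ shuffle u v
  ⋆≡shuffle []      v       _ _ = ≡.refl
  ⋆≡shuffle (a ∷ u) []      _ _ = ≡.refl
  ⋆≡shuffle (a ∷ u) (b ∷ v) (a⁺ ∷ u⁺) (b⁺ ∷ v⁺) = begin
    prepend a (u ⋆ (b ∷ v)) ++ prepend b ((a ∷ u) ⋆ v) ++ weighted (isNeg a)
      ≡⟨ cong (λ W → prepend a (u ⋆ (b ∷ v)) ++ prepend b ((a ∷ u) ⋆ v) ++ W) (unweighted (isNeg a) a⁺) ⟩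
    prepend a (u ⋆ (b ∷ v)) ++ prepend b ((a ∷ u) ⋆ v) ++ []
      ≡⟨ cong (prepend a (u ⋆ (b ∷ v)) ++_) (Listₚ.++-identityʳ _) ⟩
    prepend a (u ⋆ (b ∷ v)) ++ prepend b ((a ∷ u) ⋆ v)
      ≡⟨ cong₂ (λ L L′ → prepend a L ++ prepend b L′) (⋆≡shuffle u (b ∷ v) u⁺ (b⁺ ∷ v⁺)) (⋆≡shuffle (a ∷ u) v (a⁺ ∷ u⁺) v⁺) ⟩
    shuffle (a ∷ u) (b ∷ v) ∎
    where
    open ≡.≡-Reasoning
    weighted : Bool → Lin Word
    weighted x = if x ∧ isNeg b then scale λ' (prepend a (u ⋆ v)) else []
    unweighted : ∀ x → x ≡ false → weighted x ≡ []
    unweighted false _ = ≡.refl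

  Rearranges : Word → Word → Word → Set
  Rearranges u v w = (∀ p → countᵇ p w ≡ countᵇ p (u ++ v)) × length w ≡ length (u ++ v)

  shuffle-rearranges : ∀ u v → All (λ q → Rearranges u v (proj₂ q)) (shuffle u v)
  shuffle-rearranges []      v       = ((λ _ → ≡.refl) , ≡.refl) ∷ []
  shuffle-rearranges (a ∷ u) []      = ((λ p → cong (countᵇ p) (≡.sym (Listₚ.++-identityʳ (a ∷ u)))) ,
                                        cong length (≡.sym (Listₚ.++-identityʳ (a ∷ u)))) ∷ []
  shuffle-rearranges (a ∷ u) (b ∷ v) =
    Allₚ.++⁺ (Allₚ.map⁺ (All.map (λ (counts , len) → (λ p → cong (λ z → if p a then suc z else z) (counts p)) , cong suc len)
                                 (shuffle-rearranges u (b ∷ v))))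
             (Allₚ.map⁺ (All.map (λ (counts , len) →
                (λ p → ≡.trans (cong (λ z → if p b then suc z else z) (counts p)) (≡.sym (count-middle p (a ∷ u) b v))) ,
                ≡.trans (cong suc len) (≡.sym (length-middle (a ∷ u))))
                                 (shuffle-rearranges (a ∷ u) v)))
    where
    length-middle : ∀ (xs : Word) {ys} → length (xs ++ b ∷ ys) ≡ suc (length (xs ++ ys))
    length-middle []       = ≡.refl
    length-middle (_ ∷ xs) = cong suc (length-middle xs)

  shuffle-positive : ∀ u v → Positive u → Positive v → All (λ q → Positive (proj₂ q)) (shuffle u v)
  shuffle-positive []      v       _  v⁺ = v⁺ ∷ []
  shuffle-positive (a ∷ u) []      u⁺ _  = u⁺ ∷ []
  shuffle-positive (a ∷ u) (b ∷ v) u⁺@(a⁺ ∷ u⁺′) v⁺@(b⁺ ∷ v⁺′) =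
    Allₚ.++⁺ (Allₚ.map⁺ (All.map (a⁺ ∷_) (shuffle-positive u (b ∷ v) u⁺′ v⁺)))
             (Allₚ.map⁺ (All.map (b⁺ ∷_) (shuffle-positive (a ∷ u) v u⁺ v⁺′)))

  UnsignedSupport : Lin SPerm → Set c
  UnsignedSupport = All (λ q → T (isUnsigned (proj₂ q)))

  coeff-outside-support : ∀ (L : Lin SPerm) ρ → UnsignedSupport L → ¬ T (isUnsigned ρ) → coeff _≟SP_ L ρ ≈ 0#
  coeff-outside-support []            ρ []       _    = refl
  coeff-outside-support ((a , x) ∷ L) ρ (u ∷ us) ¬uρ with x ≟SP ρ
  ... | yes ≡.refl = ⊥-elim (¬uρ u)
  ... | no _       = trans (+-identityˡ _) (coeff-outside-support L ρ us ¬uρ)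

  asBasis-unsigned : ∀ v → Positive v → UnsignedSupport (asBasis v)
  asBasis-unsigned v v⁺ with T? (isSPerm v)
  ... | yes p = positive⇒unsigned (sp v p) v⁺ ∷ []
  ... | no _  = []

  ext⁺ : {X Y : Set} {Q : Y → Set} (f : X → Lin Y) (L : Lin X) →
         All (λ q → All (λ r → Q (proj₂ r)) (f (proj₂ q))) L → All (λ r → Q (proj₂ r)) (ext f L)
  ext⁺ f []            []       = []
  ext⁺ f ((a , x) ∷ L) (h ∷ hs) = Allₚ.++⁺ (Allₚ.map⁺ h) (ext⁺ f L hs)

  tensor⁺ : {X Y : Set} {P : X → Set} {Q : Y → Set} (U : Lin X) (V : Lin Y) →
            All (λ q → P (proj₂ q)) U → All (λ q → Q (proj₂ q)) V →
            All (λ r → P (proj₁ (proj₂ r)) × Q (proj₂ (proj₂ r))) (tensor U V)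
  tensor⁺ U V hu hv = Allₚ.concat⁺ (Allₚ.map⁺ (All.map (λ pu → Allₚ.map⁺ (All.map (pu ,_) hv)) hu))

  ⊙-unsigned : ∀ σ τ → T (isUnsigned σ) → T (isUnsigned τ) → UnsignedSupport (σ ⊙ τ)
  ⊙-unsigned σ τ uσ uτ = ext⁺ _ (word σ ⋆ τm)
    (subst (All (λ q → All _ (asBasis (stWord (proj₂ q))))) (≡.sym (⋆≡shuffle (word σ) τm σ⁺ τm⁺))
      (All.map (λ w⁺ → asBasis-unsigned _ (positive-stWord _ w⁺)) (shuffle-positive (word σ) τm σ⁺ τm⁺)))
    where
    τm = shift (size σ) (word τ)
    σ⁺ = unsigned⇒positive σ uσ
    τm⁺ = positive-shift (size σ) (unsigned⇒positive τ uτ)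

  mul-unsigned : ∀ U V → UnsignedSupport U → UnsignedSupport V → UnsignedSupport (mul U V)
  mul-unsigned U V uU uV = ext⁺ _ (tensor U V) (All.map
      (λ {r} (u₁ , u₂) → ⊙-unsigned (proj₁ (proj₂ r)) (proj₂ (proj₂ r)) u₁ u₂) (tensor⁺ U V uU uV))

  coprod-unsigned : ∀ σ → T (isUnsigned σ) →
    All (λ r → T (isUnsigned (proj₁ (proj₂ r))) × T (isUnsigned (proj₂ (proj₂ r)))) (coprod σ)
  coprod-unsigned σ uσ = Allₚ.concat⁺ (Allₚ.map⁺ (All.universal (λ p →
    tensor⁺ (asBasis (stWord (take p (word σ)))) (asBasis (stWord (drop p (word σ))))
            (asBasis-unsigned _ (positive-stWord _ (Allₚ.take⁺ p σ⁺)))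
            (asBasis-unsigned _ (positive-stWord _ (Allₚ.drop⁺ p σ⁺)))) (upTo (suc (size σ)))))
    where σ⁺ = unsigned⇒positive σ uσ

  antipodeWithFuel-unsigned : ∀ k σ → T (isUnsigned σ) → UnsignedSupport (antipodeWithFuel k σ)
  antipodeWithFuel-unsigned zero    σ                 _  = tt ∷ []
  antipodeWithFuel-unsigned (suc k) (sp [] _)         _  = tt ∷ []
  antipodeWithFuel-unsigned (suc k) σ@(sp (_ ∷ _) _) uσ =
    Allₚ.map⁺ (Allₚ.concat⁺ (Allₚ.map⁺ (All.universal (λ p →
      ext⁺ _ (asBasis (stWord (take p (word σ)))) (All.map (λ {q} ux →
        ext⁺ _ (asBasis (stWord (drop p (word σ)))) (All.map (λ uy →
          mul-unsigned (antipodeWithFuel k (proj₂ q)) (basis _) (antipodeWithFuel-unsigned k (proj₂ q) ux) (uy ∷ []))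
          (asBasis-unsigned _ (positive-stWord _ (Allₚ.drop⁺ p σ⁺)))))
        (asBasis-unsigned _ (positive-stWord _ (Allₚ.take⁺ p σ⁺))))) (upTo (size σ)))))
    where σ⁺ = unsigned⇒positive σ uσ

  ⊙≡shuffleBar : ∀ σ τ → T (isUnsigned σ) → T (isUnsigned τ) → σ ⊙ τ ≡ shuffleBar σ τ
  ⊙≡shuffleBar σ τ uσ uτ = ≡.trans (cong (ext (λ w → asBasis (stWord w))) (⋆≡shuffle σw τm σ⁺ τm⁺))
    (ext-cong-local (shuffle σw τm) (All.map (λ {q} (counts , len) →
       cong asBasis (SignedPermutation.stWord-id (proj₂ q)
         (subst T (≡.sym (isSPerm-cong (proj₂ q) (σw ++ τm) counts len))
                  (isSPerm-++-shift σw (word τ) (isSPerm-word σ) (isSPerm-word τ)))))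
       (shuffle-rearranges σw τm)))
    where
    σw = word σ
    τm = shift (size σ) (word τ)
    σ⁺ = unsigned⇒positive σ uσ
    τm⁺ = positive-shift (size σ) (unsigned⇒positive τ uτ)

  ssym-hopfSubalgebra : SSymHopfSub λ' antipode
  ssym-hopfSubalgebra = record
    { unit-in    = tt
    ; mul-closed = λ σ τ uσ uτ ρ ¬uρ → coeff-outside-support (σ ⊙ τ) ρ (⊙-unsigned σ τ uσ uτ) ¬uρ
    ; Δ-closed   = λ σ uσ ρ₁ ρ₂ ¬u → coeff-outside-pair σ ρ₁ ρ₂ (coprod-unsigned σ uσ) ¬u
    ; S-closed   = λ σ uσ ρ ¬uρ → coeff-outside-support (antipode σ) ρ (antipodeWithFuel-unsigned (size σ) σ uσ) ¬uρ
    ; mul-is-MR  = λ σ τ uσ uτ ρ → reflexive (cong (λ L → coeff _≟SP_ L ρ) (⊙≡shuffleBar σ τ uσ uτ))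
    }
    where
    coeff-outside-pair : ∀ σ ρ₁ ρ₂ → All (λ r → T (isUnsigned (proj₁ (proj₂ r))) × T
        (isUnsigned (proj₂ (proj₂ r)))) (coprod σ) →
                         ¬ (T (isUnsigned ρ₁) × T (isUnsigned ρ₂)) → coeff (≡-dec _≟SP_ _≟SP_) (coprod σ) (ρ₁ , ρ₂) ≈ 0#
    coeff-outside-pair σ ρ₁ ρ₂ = go (coprod σ)
      where
      go : ∀ L → All (λ r → T (isUnsigned (proj₁ (proj₂ r))) × T (isUnsigned (proj₂ (proj₂ r)))) L →
           ¬ (T (isUnsigned ρ₁) × T (isUnsigned ρ₂)) → coeff (≡-dec _≟SP_ _≟SP_) L (ρ₁ , ρ₂) ≈ 0#
      go []            []       _ = refl
      go ((a , x) ∷ L) (u ∷ us) ¬u with ≡-dec _≟SP_ _≟SP_ x (ρ₁ , ρ₂)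
      ... | yes ≡.refl = ⊥-elim (¬u u)
      ... | no _       = trans (+-identityˡ _) (go L us ¬u)

theorem2p5 : ∀ {c ℓ : Level} → Theorem2p5 c ℓ
theorem2p5 F _ λ' =
  HSymBialgebra.hsym-isBialgebra F λ' ,
  HSymAntipode.antipode F λ' ,
  HSymAntipode.hsym-isAntipode F λ' ,
  SSymSubalgebra.ssym-hopfSubalgebra F λ'
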